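{- Given two ordered pairs of non-tangent lines $(\ell,m)$ and $(\ell', m')$ with $\ell\neq m$ and $\ell'\neq m'$, there exists an element of $G(\mathcal{O})$ mapping $(\ell,m)$ to $(\ell', m')$ if and only if (i) $\ell$ and $\ell'$ are of the same type; (ii) $m$ and $m'$ are of the same type; and (iii) $\rho(\ell,m)=\rho(\ell',m')$.
   Context: Let $q$ be a prime power and let $\mathcal{O}=\{(\xi,\xi^2,1)^\top\mid \xi\in\mathbf{F}_q\}\cup\{(0,1,0)^\top\}$ be the nonsingular conic in $\mathrm{PG}(2,q)$. For $\xi$ in an extension field $\mathbf{F}_{q^m}$ write $P_\xi=(\xi,\xi^2,1)^\top$ and $P_\infty=(0,1,0)^\top$, and let $\mathcal{O}_{q^2}=\{P_\xi\mid \xi\in\mathbf{F}_{q^2}\cup\{\infty\}\}$. The group $\mathrm{PGL}(2,q)$ acts on $\mathbf{F}_q\cup\{\infty\}$ (and on $\mathbf{F}_{q^2}\cup\{\infty\}$) by $x\mapsto (ax+b)/(cx+d)$, and is embedded in $\mathrm{PGL}(3,q)$ via $\begin{pmatrix}a&b\\c&d\end{pmatrix}\mapsto\begin{pmatrix}ad+bc&ac&bd\\2ab&a^2&b^2\\2cd&c^2&d^2\end{pmatrix}$; the image $G(\mathcal{O})$ is the subgroup of $\mathrm{PGL}(3,q)$ fixing $\mathcal{O}$, and it maps $P_\xi$ to $P_{A(\xi)}$. A non-tangent line $\ell$ of $\mathcal{O}$ in $\mathrm{PG}(2,q)$ (viewed as a line of $\mathrm{PG}(2,q^2)$) meets $\mathcal{O}_{q^2}$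 in two points $P_\alpha,P_\beta$; $\ell$ is hyperbolic (secant) if $\alpha,\beta\in\mathbf{F}_q\cup\{\infty\}$ and elliptic (exterior) if $\beta=\alpha^q$ with $\alpha\in\mathbf{F}_{q^2}\setminus\mathbf{F}_q$; these are the two "types". The cross-ratio of four elements (no three equal) is $\rho(\alpha,\beta,\gamma,\delta)=\frac{(\alpha-\gamma)(\beta-\delta)}{(\alpha-\delta)(\beta-\gamma)}$ (with the usual interpretation when some entries are $\infty$). For non-tangent lines $\ell,m$ with $\ell\cap\mathcal{O}_{q^2}=\{P_\alpha,P_\beta\}$ and $m\cap\mathcal{O}_{q^2}=\{P_\gamma,P_\delta\}$, the cross-ratio of the lines is defined as $\rho(\ell,m)=\{r,r^{ -1}\}$ where $r=\rho(\alpha,\beta,\gamma,\delta)$. -}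

module Defs where

open import Data.Nat using (ℕ; zero; suc) renaming (_*_ to _*ℕ_)
open import Data.Fin using (Fin)
open import Data.Product using (Σ; ∃; ∃₂; _×_; _,_; proj₁)
open import Data.Sum using (_⊎_)
open import Data.Maybe using (Maybe; just; nothing)
open import Data.Unit using (⊤)
open import Relation.Nullary using (¬_)
open import Relation.Binary.PropositionalEquality using (_≡_)
open import Algebra.Structures using (IsCommutativeRing)
open import Function.Bundles using (_↔_; _⇔_)

record Field : Set₁ where
  infixl 7 _*_
  infixl 6 _+_ _-_
  infix  8 -_
  field
    Carrier : Set
    _+_ _*_ : Carrier → Carrier → Carrier
    -_      : Carrier → Carrier
    0# 1#   : Carrier
    isCommutativeRing : IsCommutativeRing _≡_ _+_ _*_ -_ 0# 1#
    _⁻¹     : Carrier → Carrier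
    inverse : ∀ x → ¬ x ≡ 0# → x * (x ⁻¹) ≡ 1#
    0≢1     : ¬ 0# ≡ 1#

  _-_ : Carrier → Carrier → Carrier
  x - y = x + (- y)

  _^_ : Carrier → ℕ → Carrier
  x ^ zero  = 1#
  x ^ suc n = x * (x ^ n)

record Setup : Set₁ where
  field
    𝔽 𝕂 : Field
    q   : ℕ
    cardF : Fin q ↔ Field.Carrier 𝔽
    cardK : Fin (q *ℕ q) ↔ Field.Carrier 𝕂
    ι     : Field.Carrier 𝔽 → Field.Carrier 𝕂
    ι-+   : ∀ x y → ι (Field._+_ 𝔽 x y) ≡ Field._+_ 𝕂 (ι x) (ι y)
    ι-*   : ∀ x y → ι (Field._*_ 𝔽 x y) ≡ Field._*_ 𝕂 (ι x) (ι y)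
    ι-1   : ι (Field.1# 𝔽) ≡ Field.1# 𝕂

module _ (S : Setup) where
  open Setup S
  private
    module F = Field 𝔽
    module K = Field 𝕂
    FC = F.Carrier
    KC = K.Carrier

  -- vectors of F^3 (homogeneous coordinates, column vectors)
  V3 : Set
  V3 = FC × FC × FC

  -- a line of PG(2,q), given by a nonzero coefficient vector (l1,l2,l3):
  -- the point (x,y,z) lies on it iff l1 x + l2 y + l3 z = 0
  Line : Set
  Line = Σ V3 (λ v → ¬ v ≡ (F.0# , F.0# , F.0#))

  _∈L_ : V3 → Line → Set
  (x , y , z) ∈L ((l1 , l2 , l3) , _) = F._+_ (F._+_ (F._*_ l1 x) (F._*_ l2 y)) (F._*_ l3 z) ≡ F.0#

  SameLine : Line → Line → Set
  SameLine ((l1 , l2 , l3) , _) ((m1 , m2 , m3) , _) =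
    ∃ λ c → (m1 , m2 , m3) ≡ (F._*_ c l1 , F._*_ c l2 , F._*_ c l3)

  record GL2 : Set where
    field
      a b c d : FC
      det≢0  : ¬ F._-_ (F._*_ a d) (F._*_ b c) ≡ F.0#

  -- the embedding PGL(2,q) → PGL(3,q) from the paper, applied to a vector
  embed : GL2 → V3 → V3
  embed g (x , y , z) =
      F._+_ (F._+_ (F._*_ (F._+_ (F._*_ a d) (F._*_ b c)) x) (F._*_ (F._*_ a c) y)) (F._*_ (F._*_ b d) z)
    , F._+_ (F._+_ (F._*_ (F._*_ (F._+_ F.1# F.1#) (F._*_ a b)) x) (F._*_ (F._*_ a a) y)) (F._*_ (F._*_ b b) z)
    , F._+_ (F._+_ (F._*_ (F._*_ (F._+_ F.1# F.1#) (F._*_ c d)) x) (F._*_ (F._*_ c c) y)) (F._*_ (F._*_ d d) z)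
    where open GL2 g

  MapsLine : GL2 → Line → Line → Set
  MapsLine g ℓ ℓ' = ∀ p → (p ∈L ℓ) ⇔ (embed g p ∈L ℓ')

  -- parameters of O_{q^2}: K ∪ {∞}, with nothing = ∞
  P1 : Set
  P1 = Maybe KC

  -- P_ξ lies on ℓ (ℓ viewed as a line of PG(2,q^2))
  OnLine : Line → P1 → Set
  OnLine ((l1 , l2 , l3) , _) (just ξ) =
    K._+_ (K._+_ (K._*_ (ι l1) ξ) (K._*_ (ι l2) (K._*_ ξ ξ))) (ι l3) ≡ K.0#
  OnLine ((l1 , l2 , l3) , _) nothing = l2 ≡ F.0#

  Meets : Line → P1 → P1 → Set
  Meets ℓ α β = ¬ α ≡ β × OnLine ℓ α × OnLine ℓ β × (∀ γ → OnLine ℓ γ → γ ≡ α ⊎ γ ≡ β)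

  NonTangent : Line → Set
  NonTangent ℓ = ∃₂ λ α β → Meets ℓ α β

  InFqK : KC → Set
  InFqK x = ∃ λ y → ι y ≡ x

  InFq : P1 → Set
  InFq nothing  = ⊤
  InFq (just x) = InFqK x

  Hyperbolic : Line → Set
  Hyperbolic ℓ = ∃₂ λ α β → Meets ℓ α β × InFq α × InFq β

  Elliptic : Line → Set
  Elliptic ℓ = ∃ λ α → ¬ InFqK α × Meets ℓ (just α) (just (K._^_ α q))

  SameType : Line → Line → Set
  SameType ℓ ℓ' = (Hyperbolic ℓ × Hyperbolic ℓ') ⊎ (Elliptic ℓ × Elliptic ℓ')

  hom : P1 → KC × KC
  hom nothing  = K.1# , K.0#
  hom (just ξ) = ξ , K.1#

  -- [α, γ] = α₁γ₂ − α₂γ₁  (equals α − γ for finite α, γ)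
  br : P1 → P1 → KC
  br α γ with hom α | hom γ
  ... | (a1 , a2) | (c1 , c2) = K._-_ (K._*_ a1 c2) (K._*_ a2 c1)

  -- IsCR α β γ δ r : r = ρ(α,β,γ,δ) = [α,γ][β,δ] / ([α,δ][β,γ]) in K ∪ {∞}
  IsCR : P1 → P1 → P1 → P1 → P1 → Set
  IsCR α β γ δ nothing  = K._*_ (br α δ) (br β γ) ≡ K.0#
  IsCR α β γ δ (just x) =
    ¬ K._*_ (br α δ) (br β γ) ≡ K.0#
    × K._*_ x (K._*_ (br α δ) (br β γ)) ≡ K._*_ (br α γ) (br β δ)

  -- s = r⁻¹ in K ∪ {∞} (with 0⁻¹ = ∞, ∞⁻¹ = 0)
  IsInv : P1 → P1 → Set
  IsInv nothing  s        = s ≡ just K.0#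
  IsInv (just x) nothing  = x ≡ K.0#
  IsInv (just x) (just y) = K._*_ x y ≡ K.1#

  InRho : P1 → P1 → P1 → P1 → P1 → Set
  InRho α β γ δ x = IsCR α β γ δ x ⊎ (∃ λ r → IsCR α β γ δ r × IsInv r x)

  -- x ∈ ρ(ℓ,m)  (ρ(ℓ,m) = {r, r⁻¹}, r computed from any labelling of the intersections)
  InCR : Line → Line → P1 → Set
  InCR ℓ m x = ∃₂ λ α β → ∃₂ λ γ δ → Meets ℓ α β × Meets m γ δ × InRho α β γ δ x

  SameCR : Line → Line → Line → Line → Set
  SameCR ℓ m ℓ' m' = ∀ x → InCR ℓ m x ⇔ InCR ℓ' m' x

-- Parametrise the conic over 𝔽_{q²} by ξ ∈ 𝔽_{q²} ∪ {∞} in homogeneous coordinates (ξ : 1). A line of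
-- PG(2,q) becomes the binary quadratic form vanishing at the parameters of its two intersection points,
-- and g ∈ GL(2,q) acts on those parameters as a Möbius transformation. Möbius maps preserve cross
-- ratios, and those with coefficients in 𝔽_q commute with the Frobenius σ, which fixes the two points
-- of a hyperbolic line and swaps those of an elliptic one; this gives necessity. Conversely, a Möbius
-- map M over 𝔽_{q²} sends three points in general position wherever we like, and equal cross ratios
-- force the fourth point to follow. Equal types make M and σ(M) agree on all four points, so σ(M) is a
-- multiple of M and a rescaling of M lies in GL(2,q). The finite fields enter only through Fermat's
-- x^q = x on 𝔽_q, from which, by counting roots of polynomials, σ is additive and fixes exactly 𝔽_q.

module Submission where

open import Defs
open import Algebra.Bundles using (CommutativeRing; RawRing)
open import Algebra.Structures using (IsCommutativeRing)
import Algebra.Properties.CommutativeMonoid.Sum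
open import Data.Bool as Bool using (Bool; true; false)
open import Data.Empty using (⊥; ⊥-elim)
open import Data.Fin using (Fin; zero; suc; fromℕ; toℕ)
import Data.Fin.Permutation as Perm
import Data.Fin.Properties as FinP
open import Data.Maybe using (just; nothing)
open import Data.Maybe.Properties using (just-injective)
open import Data.Nat as ℕ using (ℕ; zero; suc)
import Data.Nat.Properties as ℕP
open import Data.Product using (Σ; _×_; _,_; proj₁; proj₂)
open import Data.Sum as Sum using (_⊎_; inj₁; inj₂)
open import Data.Unit using (tt)
open import Data.Vec using (Vec; []; _∷_; lookup; replicate; zipWith; map)
import Data.Vec.Properties as VecP
open import Function using (_∘_)
open import Function.Bundles using (_↔_; _⇔_; Inverse; mk⇔; Equivalence)
open import Relation.Binary using (Decidable)
open import Relation.Binary.PropositionalEquality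
open import Relation.Nullary using (¬_; Dec; yes; no)
import Tactic.RingSolver.Core.AlmostCommutativeRing as TACR
open import Tactic.RingSolver.Core.Expression using (Expr; Κ; Ι; _⊕_; _⊗_; ⊝_; _⊛_; module Eval)
open import Tactic.RingSolver.Core.Polynomial.Parameters using (Homomorphism)
open import Tactic.RingSolver using (solve-∀)

-- The library ring solvers take coefficients in the ring itself, where an abstract field cannot decide
-- whether a coefficient vanishes; with integer coefficients normal forms are compared by computation.
module IntegerRingSolver (𝔽 : Field) where
  private
    commutativeRing : CommutativeRing _ _
    commutativeRing = record { isCommutativeRing = Field.isCommutativeRing 𝔽 }
    open CommutativeRing commutativeRing
      using (Carrier; _+_; _*_; -_; _-_; 0#; 1#; +-identityˡ; +-identityʳ; -‿inverseʳ; zeroˡ; *-identityˡ; ring; +-abelianGroup)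
    almostRing : TACR.AlmostCommutativeRing _ _
    almostRing = TACR.fromCommutativeRing commutativeRing (λ _ → nothing)
    module A = TACR.AlmostCommutativeRing almostRing

    ⟪_⟫ : ℕ → Carrier
    ⟪ zero ⟫ = 0#
    ⟪ suc zero ⟫ = 1#
    ⟪ suc (suc n) ⟫ = 1# + ⟪ suc n ⟫

    ⟪suc⟫ : ∀ n → ⟪ suc n ⟫ ≡ 1# + ⟪ n ⟫
    ⟪suc⟫ zero = sym (+-identityʳ 1#)
    ⟪suc⟫ (suc n) = refl

    ⟪+⟫ : ∀ m n → ⟪ m ℕ.+ n ⟫ ≡ ⟪ m ⟫ + ⟪ n ⟫
    ⟪+⟫ zero n = sym (+-identityˡ _)
    ⟪+⟫ (suc m) n = trans (⟪suc⟫ (m ℕ.+ n)) (trans (cong (1# +_) (⟪+⟫ m n))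
                      (trans (sym (+-assoc 1# _ _)) (cong (_+ ⟪ n ⟫) (sym (⟪suc⟫ m)))))
      where
      +-assoc : ∀ a b c → (a A.+ b) A.+ c ≡ a A.+ (b A.+ c)
      +-assoc = solve-∀ almostRing

    ⟪*⟫ : ∀ m n → ⟪ m ℕ.* n ⟫ ≡ ⟪ m ⟫ * ⟪ n ⟫
    ⟪*⟫ zero n = sym (zeroˡ _)
    ⟪*⟫ (suc m) n = trans (⟪+⟫ n (m ℕ.* n)) (trans (cong₂ _+_ (sym (*-identityˡ _)) (⟪*⟫ m n))
                      (trans (sym (distribʳ 1# _ _)) (cong (_* ⟪ n ⟫) (sym (⟪suc⟫ m)))))
      where
      distribʳ : ∀ a b c → (a A.+ b) A.* c ≡ a A.* c A.+ b A.* c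
      distribʳ = solve-∀ almostRing

  -- An integer is a pair (a , b) of naturals read as a − b, kept with one side zero so that equal integers are equal pairs.
  ℤ⁺⁻ : Set
  ℤ⁺⁻ = ℕ × ℕ

  private
    _⊖ℕ_ : ℕ → ℕ → ℤ⁺⁻
    zero ⊖ℕ b = zero , b
    suc a ⊖ℕ zero = suc a , zero
    suc a ⊖ℕ suc b = a ⊖ℕ b

    rawRing : RawRing _ _
    rawRing = record
      { Carrier = ℤ⁺⁻ ; _≈_ = _≡_
      ; _+_ = λ { (a , b) (c , d) → (a ℕ.+ c) ⊖ℕ (b ℕ.+ d) }
      ; _*_ = λ { (a , b) (c , d) → (a ℕ.* c ℕ.+ b ℕ.* d) ⊖ℕ (a ℕ.* d ℕ.+ b ℕ.* c) }
      ; -_ = λ { (a , b) → b , a }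
      ; 0# = 0 , 0 ; 1# = 1 , 0 }

    ⟦_⟧ℤ : ℤ⁺⁻ → Carrier
    ⟦ a , zero ⟧ℤ = ⟪ a ⟫
    ⟦ a , suc b ⟧ℤ = ⟪ a ⟫ - ⟪ suc b ⟫

    -0#≡0# : - 0# ≡ 0#
    -0#≡0# = trans (sym (+-identityˡ (- 0#))) (-‿inverseʳ 0#)

    ⟦⟧ℤ-pair : ∀ a b → ⟦ a , b ⟧ℤ ≡ ⟪ a ⟫ - ⟪ b ⟫
    ⟦⟧ℤ-pair a zero = sym (trans (cong (⟪ a ⟫ +_) -0#≡0#) (+-identityʳ _))
    ⟦⟧ℤ-pair a (suc b) = refl

    ⟦⊖ℕ⟧ : ∀ a b → ⟦ a ⊖ℕ b ⟧ℤ ≡ ⟪ a ⟫ - ⟪ b ⟫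
    ⟦⊖ℕ⟧ zero b = ⟦⟧ℤ-pair zero b
    ⟦⊖ℕ⟧ (suc a) zero = ⟦⟧ℤ-pair (suc a) zero
    ⟦⊖ℕ⟧ (suc a) (suc b) = trans (⟦⊖ℕ⟧ a b) (trans (sym (sub-shift 1# _ _)) (sym (cong₂ _-_ (⟪suc⟫ a) (⟪suc⟫ b))))
      where
      negate-+ : ∀ x y → - (x + y) ≡ - x + - y
      negate-+ x y = sym (⁻¹-∙-comm x y)
        where open import Algebra.Properties.AbelianGroup +-abelianGroup
      regroup : ∀ o a b → (o A.+ a) A.+ (A.- o A.+ A.- b) ≡ (o A.+ A.- o) A.+ (a A.- b)
      regroup = solve-∀ almostRing
      sub-shift : ∀ o a b → (o + a) - (o + b) ≡ a - b
      sub-shift o a b = trans (cong ((o + a) +_) (negate-+ o b))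
        (trans (regroup o a b) (trans (cong (_+ (a - b)) (-‿inverseʳ o)) (+-identityˡ _)))

    +-homo : ∀ p q → ⟦ RawRing._+_ rawRing p q ⟧ℤ ≡ ⟦ p ⟧ℤ + ⟦ q ⟧ℤ
    +-homo (a , b) (c , d) = trans (⟦⊖ℕ⟧ (a ℕ.+ c) (b ℕ.+ d))
      (trans (cong₂ _-_ (⟪+⟫ a c) (⟪+⟫ b d)) (trans (interchange _ _ _ _) (sym (cong₂ _+_ (⟦⟧ℤ-pair a b) (⟦⟧ℤ-pair c d)))))
      where
      interchange : ∀ a b c d → (a A.+ c) A.- (b A.+ d) ≡ (a A.- b) A.+ (c A.- d)
      interchange = solve-∀ almostRing

    *-homo : ∀ p q → ⟦ RawRing._*_ rawRing p q ⟧ℤ ≡ ⟦ p ⟧ℤ * ⟦ q ⟧ℤ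
    *-homo (a , b) (c , d) = trans (⟦⊖ℕ⟧ (a ℕ.* c ℕ.+ b ℕ.* d) (a ℕ.* d ℕ.+ b ℕ.* c))
      (trans (cong₂ _-_ (trans (⟪+⟫ (a ℕ.* c) (b ℕ.* d)) (cong₂ _+_ (⟪*⟫ a c) (⟪*⟫ b d)))
                        (trans (⟪+⟫ (a ℕ.* d) (b ℕ.* c)) (cong₂ _+_ (⟪*⟫ a d) (⟪*⟫ b c))))
        (trans (expand _ _ _ _) (sym (cong₂ _*_ (⟦⟧ℤ-pair a b) (⟦⟧ℤ-pair c d)))))
      where
      open import Algebra.Properties.Ring ring
      foil : ∀ a B c D → (a A.+ B) A.* (c A.+ D) ≡ (a A.* c A.+ B A.* D) A.+ (a A.* D A.+ B A.* c)
      foil = solve-∀ almostRing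
      expand : ∀ a b c d → (a * c + b * d) - (a * d + b * c) ≡ (a - b) * (c - d)
      expand a b c d = sym (trans (foil a (- b) c (- d))
        (cong₂ _+_ (cong ((a * c) +_) (trans (sym (-‿distribˡ-* b (- d))) (trans (cong -_ (sym (-‿distribʳ-* b d))) (-‿involutive _))))
                   (trans (cong₂ _+_ (sym (-‿distribʳ-* a d)) (sym (-‿distribˡ-* b c))) (-‿+-comm _ _))))

    -‿homo : ∀ p → ⟦ RawRing.-_ rawRing p ⟧ℤ ≡ - ⟦ p ⟧ℤ
    -‿homo (a , b) = trans (⟦⟧ℤ-pair b a) (trans (sym (⁻¹-anti-homo‿- ⟪ a ⟫ ⟪ b ⟫)) (cong -_ (sym (⟦⟧ℤ-pair a b))))
      where open import Algebra.Properties.AbelianGroup +-abelianGroup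

    isZero : ℤ⁺⁻ → Bool
    isZero (zero , zero) = true
    isZero _ = false

    isZero-sound : ∀ x → Bool.T (isZero x) → 0# ≡ ⟦ x ⟧ℤ
    isZero-sound (zero , zero) _ = refl

    homomorphism : Homomorphism _ _ _ _
    homomorphism = record
      { from = record { rawRing = rawRing ; isZero = isZero }
      ; to = almostRing
      ; morphism = record { ⟦_⟧ = ⟦_⟧ℤ ; +-homo = +-homo ; *-homo = *-homo ; -‿homo = -‿homo ; 0-homo = refl ; 1-homo = refl }
      ; Zero-C⟶Zero-R = isZero-sound
      }

    open import Tactic.RingSolver.Core.Polynomial.Base (Homomorphism.from homomorphism)
    open import Tactic.RingSolver.Core.Polynomial.Semantics homomorphism renaming (⟦_⟧ to ⟦_⟧ₚ)
    open import Tactic.RingSolver.Core.Polynomial.Homomorphism homomorphism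
    open Eval A.rawRing ⟦_⟧ℤ

    norm : ∀ {n} → Expr ℤ⁺⁻ n → Poly n
    norm (Κ x)   = κ x
    norm (Ι x)   = ι x
    norm (x ⊕ y) = norm x ⊞ norm y
    norm (x ⊗ y) = norm x ⊠ norm y
    norm (⊝ x)   = ⊟ norm x
    norm (x ⊛ i) = norm x ⊡ i

    ⟦_⇓⟧ : ∀ {n} → Expr ℤ⁺⁻ n → Vec Carrier n → Carrier
    ⟦ e ⇓⟧ = ⟦ norm e ⟧ₚ

    correct : ∀ {n} (e : Expr ℤ⁺⁻ n) ρ → ⟦ e ⇓⟧ ρ ≡ ⟦ e ⟧ ρ
    correct (Κ x)   ρ = κ-hom x ρ
    correct (Ι x)   ρ = ι-hom x ρ
    correct (x ⊕ y) ρ = trans (⊞-hom (norm x) (norm y) ρ) (cong₂ _+_ (correct x ρ) (correct y ρ))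
    correct (x ⊗ y) ρ = trans (⊠-hom (norm x) (norm y) ρ) (cong₂ _*_ (correct x ρ) (correct y ρ))
    correct (⊝ x)   ρ = trans (⊟-hom (norm x) ρ) (cong -_ (correct x ρ))
    correct (x ⊛ i) ρ = trans (⊡-hom (norm x) i ρ) (^-congˡ i (correct x ρ))
      where open import Algebra.Properties.Semiring.Exp.TCOptimised A.semiring using (^-congˡ)

  open import Relation.Binary.Reflection (setoid Carrier) Ι ⟦_⟧ ⟦_⇓⟧ correct public using (solve; _⊜_)

  𝟎 𝟏 𝟐 : ∀ {n} → Expr ℤ⁺⁻ n
  𝟎 = Κ (0 , 0)
  𝟏 = Κ (1 , 0)
  𝟐 = Κ (2 , 0)
module FieldProperties (𝔽 : Field) (_≟_ : Decidable {A = Field.Carrier 𝔽} _≡_) where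
  open Field 𝔽 public
  open IsCommutativeRing isCommutativeRing public
    using (zeroˡ; zeroʳ; *-identityˡ; *-identityʳ; +-identityˡ; +-identityʳ; *-comm; *-assoc; -‿inverseʳ)
  open IntegerRingSolver 𝔽 public

  _≢0 : Carrier → Set
  x ≢0 = ¬ x ≡ 0#

  1≢0 : 1# ≢0
  1≢0 e = 0≢1 (sym e)

  -0#≡0# : - 0# ≡ 0#
  -0#≡0# = trans (sym (+-identityˡ (- 0#))) (-‿inverseʳ 0#)

  x-0≡x : ∀ x → x - 0# ≡ x
  x-0≡x = solve 1 (λ x → (x ⊕ (⊝ 𝟎)) ⊜ x) refl

  x-y≡0⇒x≡y : ∀ {x y} → x - y ≡ 0# → x ≡ y
  x-y≡0⇒x≡y {x} {y} e = trans (x≡x-y+y x y) (trans (cong (_+ y) e) (+-identityˡ y))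
    where
    x≡x-y+y : ∀ x y → x ≡ (x - y) + y
    x≡x-y+y = solve 2 (λ x y → x ⊜ ((x ⊕ (⊝ y)) ⊕ y)) refl

  x≡y⇒x-y≡0 : ∀ {x y} → x ≡ y → x - y ≡ 0#
  x≡y⇒x-y≡0 {x} refl = -‿inverseʳ x

  +-cancel-middle : ∀ {a b c} → a + b ≡ b + c → a ≡ c
  +-cancel-middle {a} {b} {c} e = trans (a≡a+b-b a b) (trans (cong (_- b) e) (b+c-b≡c b c))
    where
    a≡a+b-b : ∀ a b → a ≡ (a + b) - b
    a≡a+b-b = solve 2 (λ a b → a ⊜ ((a ⊕ b) ⊕ (⊝ b))) refl
    b+c-b≡c : ∀ b c → (b + c) - b ≡ c
    b+c-b≡c = solve 2 (λ b c → ((b ⊕ c) ⊕ (⊝ b)) ⊜ c) refl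

  -x≡0⇒x≡0 : ∀ {x} → - x ≡ 0# → x ≡ 0#
  -x≡0⇒x≡0 {x} e = trans (sym (-‿involutive x)) (trans (cong -_ e) -0#≡0#)
    where
    -‿involutive : ∀ x → - (- x) ≡ x
    -‿involutive = solve 1 (λ x → (⊝ (⊝ x)) ⊜ x) refl

  -‿≢0 : ∀ {x} → x ≢0 → (- x) ≢0
  -‿≢0 nz e = nz (-x≡0⇒x≡0 e)

  inverseˡ : ∀ {x} → x ≢0 → x ⁻¹ * x ≡ 1#
  inverseˡ {x} nz = trans (*-comm (x ⁻¹) x) (inverse x nz)

  xy≡0⇒y≡0 : ∀ {x y} → x * y ≡ 0# → x ≢0 → y ≡ 0#
  xy≡0⇒y≡0 {x} {y} e nz = begin
      y                 ≡⟨ sym (*-identityˡ y) ⟩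
      1# * y            ≡⟨ cong (_* y) (sym (inverseˡ nz)) ⟩
      (x ⁻¹ * x) * y    ≡⟨ *-assoc _ _ _ ⟩
      x ⁻¹ * (x * y)    ≡⟨ cong (x ⁻¹ *_) e ⟩
      x ⁻¹ * 0#         ≡⟨ zeroʳ _ ⟩
      0# ∎
    where open ≡-Reasoning

  xy≡0⇒x≡0 : ∀ {x y} → x * y ≡ 0# → y ≢0 → x ≡ 0#
  xy≡0⇒x≡0 {x} {y} e nz = xy≡0⇒y≡0 (trans (*-comm y x) e) nz

  xy≡0⇒x≡0⊎y≡0 : ∀ {x y} → x * y ≡ 0# → x ≡ 0# ⊎ y ≡ 0#
  xy≡0⇒x≡0⊎y≡0 {x} e with x ≟ 0#
  ... | yes p = inj₁ p
  ... | no p = inj₂ (xy≡0⇒y≡0 e p)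

  *-≢0 : ∀ {x y} → x ≢0 → y ≢0 → (x * y) ≢0
  *-≢0 nx ny e = ny (xy≡0⇒y≡0 e nx)

  x*y≢0⇒x≢0 : ∀ {x y} → (x * y) ≢0 → x ≢0
  x*y≢0⇒x≢0 {x} {y} n x≡0 = n (trans (cong (_* y) x≡0) (zeroˡ y))

  x*y≢0⇒y≢0 : ∀ {x y} → (x * y) ≢0 → y ≢0
  x*y≢0⇒y≢0 {x} {y} n y≡0 = n (trans (cong (x *_) y≡0) (zeroʳ x))

  ⁻¹-≢0 : ∀ {x} → x ≢0 → (x ⁻¹) ≢0
  ⁻¹-≢0 {x} nz e = 0≢1 (trans (sym (zeroʳ x)) (trans (cong (x *_) (sym e)) (inverse x nz)))

  ⁻¹-*-cancel : ∀ {x} → x ≢0 → ∀ y → x ⁻¹ * (x * y) ≡ y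
  ⁻¹-*-cancel {x} nz y = trans (sym (*-assoc _ _ _)) (trans (cong (_* y) (inverseˡ nz)) (*-identityˡ y))

  *-⁻¹-cancel : ∀ {x} → x ≢0 → ∀ y → x * (x ⁻¹ * y) ≡ y
  *-⁻¹-cancel {x} nz y = trans (sym (*-assoc _ _ _)) (trans (cong (_* y) (inverse x nz)) (*-identityˡ y))

  *-cancelˡ : ∀ {x y z} → x ≢0 → x * y ≡ x * z → y ≡ z
  *-cancelˡ {x} {y} {z} nz e = trans (sym (⁻¹-*-cancel nz y)) (trans (cong (x ⁻¹ *_) e) (⁻¹-*-cancel nz z))

  xy≡z⇒y≡x⁻¹z : ∀ {x y z} → x ≢0 → x * y ≡ z → y ≡ x ⁻¹ * z
  xy≡z⇒y≡x⁻¹z nz refl = sym (⁻¹-*-cancel nz _)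

  ⁻¹-unique : ∀ {x y} → x ≢0 → x * y ≡ 1# → y ≡ x ⁻¹
  ⁻¹-unique {x} nz e = *-cancelˡ nz (trans e (sym (inverse x nz)))

  1^n≡1 : ∀ n → 1# ^ n ≡ 1#
  1^n≡1 zero = refl
  1^n≡1 (suc n) = trans (*-identityˡ _) (1^n≡1 n)

  0^suc≡0 : ∀ n → 0# ^ suc n ≡ 0#
  0^suc≡0 n = zeroˡ _

  ^-distrib-* : ∀ x y n → (x * y) ^ n ≡ x ^ n * y ^ n
  ^-distrib-* x y zero = sym (*-identityˡ 1#)
  ^-distrib-* x y (suc n) = trans (cong ((x * y) *_) (^-distrib-* x y n)) (interchange x y (x ^ n) (y ^ n))
    where
    interchange : ∀ x y a b → (x * y) * (a * b) ≡ (x * a) * (y * b)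
    interchange = solve 4 (λ x y a b → ((x ⊗ y) ⊗ (a ⊗ b)) ⊜ ((x ⊗ a) ⊗ (y ⊗ b))) refl

  ^-distribˡ-+-* : ∀ x m n → x ^ (m ℕ.+ n) ≡ x ^ m * x ^ n
  ^-distribˡ-+-* x zero n = sym (*-identityˡ _)
  ^-distribˡ-+-* x (suc m) n = trans (cong (x *_) (^-distribˡ-+-* x m n)) (sym (*-assoc _ _ _))

  ^-*-assoc : ∀ x m n → x ^ (m ℕ.* n) ≡ (x ^ m) ^ n
  ^-*-assoc x m zero = cong (x ^_) (ℕP.*-zeroʳ m)
  ^-*-assoc x m (suc n) = trans (cong (x ^_) (ℕP.*-suc m n))
    (trans (^-distribˡ-+-* x m (m ℕ.* n)) (cong (x ^ m *_) (^-*-assoc x m n)))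

  ^-≢0 : ∀ {x} n → x ≢0 → (x ^ n) ≢0
  ^-≢0 zero nz = 1≢0
  ^-≢0 (suc n) nz = *-≢0 nz (^-≢0 n nz)

  ⁻¹-^ : ∀ {x} n → x ≢0 → (x ⁻¹) ^ n ≡ (x ^ n) ⁻¹
  ⁻¹-^ {x} n nz = ⁻¹-unique (^-≢0 n nz)
    (trans (sym (^-distrib-* x (x ⁻¹) n)) (trans (cong (_^ n) (inverse x nz)) (1^n≡1 n)))

  -- Polynomials are coefficient vectors, lowest degree first.
  horner : ∀ {N} → Vec Carrier N → Carrier → Carrier
  horner [] x = 0#
  horner (c ∷ cs) x = c + x * horner cs x

  quo : ∀ {N} → Carrier → Vec Carrier (suc N) → Vec Carrier N
  rem : ∀ {N} → Carrier → Vec Carrier (suc N) → Carrier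
  quo a (c ∷ []) = []
  quo a (c ∷ c' ∷ cs) = rem a (c' ∷ cs) ∷ quo a (c' ∷ cs)
  rem a (c ∷ []) = c
  rem a (c ∷ c' ∷ cs) = c + a * rem a (c' ∷ cs)

  horner-divide : ∀ {N} a (c : Vec Carrier (suc N)) x → horner c x ≡ (x - a) * horner (quo a c) x + rem a c
  horner-divide a (c ∷ []) x = constant c x a
    where
    constant : ∀ c x a → c + x * 0# ≡ (x - a) * 0# + c
    constant = solve 3 (λ c x a → (c ⊕ (x ⊗ 𝟎)) ⊜ (((x ⊕ (⊝ a)) ⊗ 𝟎) ⊕ c)) refl
  horner-divide a (c ∷ c' ∷ cs) x =
    trans (cong (λ W → c + x * W) (horner-divide a (c' ∷ cs) x)) (step c x a (horner (quo a (c' ∷ cs)) x) (rem a (c' ∷ cs)))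
    where
    step : ∀ c x a Q r → c + x * ((x - a) * Q + r) ≡ (x - a) * (r + x * Q) + (c + a * r)
    step = solve 5 (λ c x a Q r → (c ⊕ (x ⊗ (((x ⊕ (⊝ a)) ⊗ Q) ⊕ r))) ⊜ (((x ⊕ (⊝ a)) ⊗ (r ⊕ (x ⊗ Q))) ⊕ (c ⊕ (a ⊗ r)))) refl

  rem≡horner : ∀ {N} a (c : Vec Carrier (suc N)) → rem a c ≡ horner c a
  rem≡horner a c = sym (trans (horner-divide a c a) (vanish a _ _))
    where
    vanish : ∀ a Q r → (a - a) * Q + r ≡ r
    vanish = solve 3 (λ a Q r → (((a ⊕ (⊝ a)) ⊗ Q) ⊕ r) ⊜ r) refl

  divide-zero : ∀ {N} a (c : Vec Carrier (suc N)) →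
                (∀ i → lookup (quo a c) i ≡ 0#) → rem a c ≡ 0# → ∀ i → lookup c i ≡ 0#
  divide-zero a (c ∷ []) qz rz zero = rz
  divide-zero a (c ∷ c' ∷ cs) qz rz zero = trans (sym (c+a*0≡c c a)) (trans (cong (λ W → c + a * W) (sym (qz zero))) rz)
    where
    c+a*0≡c : ∀ c a → c + a * 0# ≡ c
    c+a*0≡c = solve 2 (λ c a → (c ⊕ (a ⊗ 𝟎)) ⊜ c) refl
  divide-zero a (c ∷ c' ∷ cs) qz rz (suc i) = divide-zero a (c' ∷ cs) (λ j → qz (suc j)) (qz zero) i

  manyRoots⇒zero : ∀ {N} (c : Vec Carrier N) (p : Fin N → Carrier) → (∀ i j → p i ≡ p j → i ≡ j) →
                   (∀ i → horner c (p i) ≡ 0#) → ∀ i → lookup c i ≡ 0#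
  manyRoots⇒zero {zero} [] p inj roots ()
  manyRoots⇒zero {suc N} c p inj roots = divide-zero a c (manyRoots⇒zero (quo a c) (p ∘ suc) inj' quo-roots) rem≡0
    where
    a = p zero
    rem≡0 : rem a c ≡ 0#
    rem≡0 = trans (rem≡horner a c) (roots zero)
    inj' : ∀ i j → p (suc i) ≡ p (suc j) → i ≡ j
    inj' i j e = FinP.suc-injective (inj (suc i) (suc j) e)
    quo-roots : ∀ j → horner (quo a c) (p (suc j)) ≡ 0#
    quo-roots j = xy≡0⇒y≡0 product≡0 (λ e → FinP.0≢1+n (inj zero (suc j) (sym (x-y≡0⇒x≡y e))))
      where
      x = p (suc j)
      +0 : ∀ z Q → z * Q + 0# ≡ z * Q
      +0 = solve 2 (λ z Q → ((z ⊗ Q) ⊕ 𝟎) ⊜ (z ⊗ Q)) refl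
      product≡0 : (x - a) * horner (quo a c) x ≡ 0#
      product≡0 = trans (sym (+0 _ _)) (trans (cong ((x - a) * horner (quo a c) x +_) (sym rem≡0))
                    (trans (sym (horner-divide a c x)) (roots (suc j))))

  -- binomialTail n is the polynomial (x + 1)ⁿ − xⁿ, with n coefficients.
  shiftAdd : ∀ {n} → Carrier → Vec Carrier n → Vec Carrier (suc n)
  shiftAdd p [] = (1# + p) ∷ []
  shiftAdd p (v ∷ vs) = (v + p) ∷ shiftAdd v vs

  horner-shiftAdd : ∀ {n} p (v : Vec Carrier n) x → horner (shiftAdd p v) x ≡ p + horner v x + x * horner v x + x ^ n
  horner-shiftAdd p [] x = base p x
    where
    base : ∀ p x → (1# + p) + x * 0# ≡ ((p + 0#) + x * 0#) + 1#
    base = solve 2 (λ p x → ((𝟏 ⊕ p) ⊕ (x ⊗ 𝟎)) ⊜ (((p ⊕ 𝟎) ⊕ (x ⊗ 𝟎)) ⊕ 𝟏)) refl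
  horner-shiftAdd {suc n} p (v ∷ vs) x =
    trans (cong (λ W → (v + p) + x * W) (horner-shiftAdd v vs x)) (step v p x (horner vs x) (x ^ n))
    where
    step : ∀ v p x E xn → (v + p) + x * (((v + E) + x * E) + xn) ≡ ((p + (v + x * E)) + x * (v + x * E)) + x * xn
    step = solve 5 (λ v p x E xn → ((v ⊕ p) ⊕ (x ⊗ (((v ⊕ E) ⊕ (x ⊗ E)) ⊕ xn))) ⊜ (((p ⊕ (v ⊕ (x ⊗ E))) ⊕ (x ⊗ (v ⊕ (x ⊗ E)))) ⊕ (x ⊗ xn))) refl

  binomialTail : (n : ℕ) → Vec Carrier n
  binomialTail zero = []
  binomialTail (suc n) = shiftAdd 0# (binomialTail n)

  horner-binomialTail : ∀ n x → horner (binomialTail n) x + x ^ n ≡ (x + 1#) ^ n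
  horner-binomialTail zero x = +-identityˡ 1#
  horner-binomialTail (suc n) x =
    trans (cong (_+ x * x ^ n) (horner-shiftAdd 0# (binomialTail n) x))
      (trans (factor (horner (binomialTail n) x) x (x ^ n)) (cong ((x + 1#) *_) (horner-binomialTail n x)))
    where
    factor : ∀ E x xn → (((0# + E) + x * E) + xn) + x * xn ≡ (x + 1#) * (E + xn)
    factor = solve 3 (λ E x xn → ((((𝟎 ⊕ E) ⊕ (x ⊗ E)) ⊕ xn) ⊕ (x ⊗ xn)) ⊜ ((x ⊕ 𝟏) ⊗ (E ⊕ xn))) refl

  monomial : ∀ {N} → Fin N → Vec Carrier N
  monomial {suc N} zero = 1# ∷ replicate N 0#
  monomial (suc i) = 0# ∷ monomial i

  horner-replicate-0 : ∀ N x → horner (replicate N 0#) x ≡ 0#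
  horner-replicate-0 zero x = refl
  horner-replicate-0 (suc N) x = trans (cong (λ W → 0# + x * W) (horner-replicate-0 N x)) (trans (+-identityˡ _) (zeroʳ x))

  horner-monomial : ∀ {N} (i : Fin N) x → horner (monomial i) x ≡ x ^ toℕ i
  horner-monomial {suc N} zero x =
    trans (cong (λ W → 1# + x * W) (horner-replicate-0 N x)) (trans (cong (1# +_) (zeroʳ x)) (+-identityʳ 1#))
  horner-monomial (suc i) x = trans (+-identityˡ _) (cong (x *_) (horner-monomial i x))

  lookup-monomial : ∀ {N} (i : Fin N) → lookup (monomial i) i ≡ 1#
  lookup-monomial {suc N} zero = refl
  lookup-monomial (suc i) = lookup-monomial i

  lookup-monomial-≢ : ∀ {N} (i j : Fin N) → ¬ i ≡ j → lookup (monomial i) j ≡ 0#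
  lookup-monomial-≢ {suc N} zero zero ne = ⊥-elim (ne refl)
  lookup-monomial-≢ {suc N} zero (suc j) ne = VecP.lookup-replicate j 0#
  lookup-monomial-≢ (suc i) zero ne = refl
  lookup-monomial-≢ (suc i) (suc j) ne = lookup-monomial-≢ i j (λ e → ne (cong suc e))

  horner-zipWith- : ∀ {N} (u v : Vec Carrier N) x → horner (zipWith _-_ u v) x ≡ horner u x - horner v x
  horner-zipWith- [] [] x = sym (-‿inverseʳ 0#)
  horner-zipWith- (a ∷ u) (b ∷ v) x = trans (cong (λ W → (a - b) + x * W) (horner-zipWith- u v x)) (regroup a b x _ _)
    where
    regroup : ∀ a b x U V → (a - b) + x * (U - V) ≡ (a + x * U) - (b + x * V)
    regroup = solve 5 (λ a b x U V → ((a ⊕ (⊝ b)) ⊕ (x ⊗ (U ⊕ (⊝ V)))) ⊜ ((a ⊕ (x ⊗ U)) ⊕ (⊝ (b ⊕ (x ⊗ V))))) refl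

  horner-cong : ∀ {N} (u v : Vec Carrier N) x → (∀ i → lookup u i ≡ lookup v i) → horner u x ≡ horner v x
  horner-cong [] [] x same = refl
  horner-cong (a ∷ u) (b ∷ v) x same = cong₂ (λ A B → A + x * B) (same zero) (horner-cong u v x (λ i → same (suc i)))

module ProjectiveLine (𝔽 : Field) (_≟_ : Decidable {A = Field.Carrier 𝔽} _≡_) where
  open FieldProperties 𝔽 _≟_

  V2 : Set
  V2 = Carrier × Carrier

  wedge : V2 → V2 → Carrier
  wedge (s , t) (s' , t') = s * t' - t * s'

  Nonzero : V2 → Set
  Nonzero (s , t) = ¬ (s ≡ 0# × t ≡ 0#)

  _•_ : Carrier → V2 → V2
  k • (s , t) = (k * s , k * t)

  _~_ : V2 → V2 → Set
  u ~ v = wedge u v ≡ 0#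

  record Mat : Set where
    constructor mat
    field m11 m12 m21 m22 : Carrier

  act : Mat → V2 → V2
  act (mat a b c d) (s , t) = (a * s + b * t , c * s + d * t)

  det : Mat → Carrier
  det (mat a b c d) = a * d - b * c

  adj : Mat → Mat
  adj (mat a b c d) = mat d (- b) (- c) a

  mul : Mat → Mat → Mat
  mul (mat a b c d) (mat e f g h) = mat (a * e + b * g) (a * f + b * h) (c * e + d * g) (c * f + d * h)

  _•M_ : Carrier → Mat → Mat
  k •M (mat a b c d) = mat (k * a) (k * b) (k * c) (k * d)

  wedge-act : ∀ M u v → wedge (act M u) (act M v) ≡ det M * wedge u v
  wedge-act (mat a b c d) (s , t) (u , v) = identity a b c d s t u v
    where
    identity : ∀ a b c d s t u v → (a * s + b * t) * (c * u + d * v) - (c * s + d * t) * (a * u + b * v) ≡ (a * d - b * c) * (s * v - t * u)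
    identity = solve 8 (λ a b c d s t u v → ((((a ⊗ s) ⊕ (b ⊗ t)) ⊗ ((c ⊗ u) ⊕ (d ⊗ v))) ⊕ (⊝ (((c ⊗ s) ⊕ (d ⊗ t)) ⊗ ((a ⊗ u) ⊕ (b ⊗ v))))) ⊜ (((a ⊗ d) ⊕ (⊝ (b ⊗ c))) ⊗ ((s ⊗ v) ⊕ (⊝ (t ⊗ u))))) refl

  act-adj : ∀ M u → act M (act (adj M) u) ≡ det M • u
  act-adj (mat a b c d) (s , t) = cong₂ _,_ (first a b c d s t) (second a b c d s t)
    where
    first : ∀ a b c d s t → a * (d * s + (- b) * t) + b * ((- c) * s + a * t) ≡ (a * d - b * c) * s
    first = solve 6 (λ a b c d s t → ((a ⊗ ((d ⊗ s) ⊕ ((⊝ b) ⊗ t))) ⊕ (b ⊗ (((⊝ c) ⊗ s) ⊕ (a ⊗ t)))) ⊜ (((a ⊗ d) ⊕ (⊝ (b ⊗ c))) ⊗ s)) refl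
    second : ∀ a b c d s t → c * (d * s + (- b) * t) + d * ((- c) * s + a * t) ≡ (a * d - b * c) * t
    second = solve 6 (λ a b c d s t → ((c ⊗ ((d ⊗ s) ⊕ ((⊝ b) ⊗ t))) ⊕ (d ⊗ (((⊝ c) ⊗ s) ⊕ (a ⊗ t)))) ⊜ (((a ⊗ d) ⊕ (⊝ (b ⊗ c))) ⊗ t)) refl

  adj-act : ∀ M u → act (adj M) (act M u) ≡ det M • u
  adj-act (mat a b c d) (s , t) = cong₂ _,_ (first a b c d s t) (second a b c d s t)
    where
    first : ∀ a b c d s t → d * (a * s + b * t) + (- b) * (c * s + d * t) ≡ (a * d - b * c) * s
    first = solve 6 (λ a b c d s t → ((d ⊗ ((a ⊗ s) ⊕ (b ⊗ t))) ⊕ ((⊝ b) ⊗ ((c ⊗ s) ⊕ (d ⊗ t)))) ⊜ (((a ⊗ d) ⊕ (⊝ (b ⊗ c))) ⊗ s)) refl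
    second : ∀ a b c d s t → (- c) * (a * s + b * t) + a * (c * s + d * t) ≡ (a * d - b * c) * t
    second = solve 6 (λ a b c d s t → (((⊝ c) ⊗ ((a ⊗ s) ⊕ (b ⊗ t))) ⊕ (a ⊗ ((c ⊗ s) ⊕ (d ⊗ t)))) ⊜ (((a ⊗ d) ⊕ (⊝ (b ⊗ c))) ⊗ t)) refl

  det-adj : ∀ M → det (adj M) ≡ det M
  det-adj (mat a b c d) = identity a b c d
    where
    identity : ∀ a b c d → d * a - (- b) * (- c) ≡ a * d - b * c
    identity = solve 4 (λ a b c d → ((d ⊗ a) ⊕ (⊝ ((⊝ b) ⊗ (⊝ c)))) ⊜ ((a ⊗ d) ⊕ (⊝ (b ⊗ c)))) refl

  det-adj≢0 : ∀ M → det M ≢0 → det (adj M) ≢0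
  det-adj≢0 M = subst _≢0 (sym (det-adj M))

  act-mul : ∀ A B u → act (mul A B) u ≡ act A (act B u)
  act-mul (mat a b c d) (mat e f g h) (s , t) = cong₂ _,_ (row a b e f g h s t) (row c d e f g h s t)
    where
    row : ∀ a b e f g h s t → (a * e + b * g) * s + (a * f + b * h) * t ≡ a * (e * s + f * t) + b * (g * s + h * t)
    row = solve 8 (λ a b e f g h s t → ((((a ⊗ e) ⊕ (b ⊗ g)) ⊗ s) ⊕ (((a ⊗ f) ⊕ (b ⊗ h)) ⊗ t)) ⊜ ((a ⊗ ((e ⊗ s) ⊕ (f ⊗ t))) ⊕ (b ⊗ ((g ⊗ s) ⊕ (h ⊗ t))))) refl

  det-mul : ∀ A B → det (mul A B) ≡ det A * det B
  det-mul (mat a b c d) (mat e f g h) = identity a b c d e f g h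
    where
    identity : ∀ a b c d e f g h → (a * e + b * g) * (c * f + d * h) - (a * f + b * h) * (c * e + d * g) ≡ (a * d - b * c) * (e * h - f * g)
    identity = solve 8 (λ a b c d e f g h → ((((a ⊗ e) ⊕ (b ⊗ g)) ⊗ ((c ⊗ f) ⊕ (d ⊗ h))) ⊕ (⊝ (((a ⊗ f) ⊕ (b ⊗ h)) ⊗ ((c ⊗ e) ⊕ (d ⊗ g))))) ⊜ (((a ⊗ d) ⊕ (⊝ (b ⊗ c))) ⊗ ((e ⊗ h) ⊕ (⊝ (f ⊗ g))))) refl

  det-•M : ∀ k M → det (k •M M) ≡ (k * k) * det M
  det-•M k (mat a b c d) = identity k a b c d
    where
    identity : ∀ k a b c d → (k * a) * (k * d) - (k * b) * (k * c) ≡ (k * k) * (a * d - b * c)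
    identity = solve 5 (λ k a b c d → (((k ⊗ a) ⊗ (k ⊗ d)) ⊕ (⊝ ((k ⊗ b) ⊗ (k ⊗ c)))) ⊜ ((k ⊗ k) ⊗ ((a ⊗ d) ⊕ (⊝ (b ⊗ c))))) refl

  act-•M : ∀ k M v → act (k •M M) v ≡ k • act M v
  act-•M k (mat a b c d) (s , t) = cong₂ _,_ (row k a b s t) (row k c d s t)
    where
    row : ∀ k a b s t → (k * a) * s + (k * b) * t ≡ k * (a * s + b * t)
    row = solve 5 (λ k a b s t → (((k ⊗ a) ⊗ s) ⊕ ((k ⊗ b) ⊗ t)) ⊜ (k ⊗ ((a ⊗ s) ⊕ (b ⊗ t)))) refl

  wedge-•ˡ : ∀ k u v → wedge (k • u) v ≡ k * wedge u v
  wedge-•ˡ k (s , t) (u , v) = identity k s t u v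
    where
    identity : ∀ k s t u v → (k * s) * v - (k * t) * u ≡ k * (s * v - t * u)
    identity = solve 5 (λ k s t u v → (((k ⊗ s) ⊗ v) ⊕ (⊝ ((k ⊗ t) ⊗ u))) ⊜ (k ⊗ ((s ⊗ v) ⊕ (⊝ (t ⊗ u))))) refl

  wedge-•ʳ : ∀ k u v → wedge u (k • v) ≡ k * wedge u v
  wedge-•ʳ k (s , t) (u , v) = identity k s t u v
    where
    identity : ∀ k s t u v → s * (k * v) - t * (k * u) ≡ k * (s * v - t * u)
    identity = solve 5 (λ k s t u v → ((s ⊗ (k ⊗ v)) ⊕ (⊝ (t ⊗ (k ⊗ u)))) ⊜ (k ⊗ ((s ⊗ v) ⊕ (⊝ (t ⊗ u))))) refl

  wedge-antisym : ∀ u v → wedge v u ≡ - wedge u v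
  wedge-antisym (s , t) (u , v) = identity s t u v
    where
    identity : ∀ s t u v → u * t - v * s ≡ - (s * v - t * u)
    identity = solve 4 (λ s t u v → ((u ⊗ t) ⊕ (⊝ (v ⊗ s))) ⊜ (⊝ ((s ⊗ v) ⊕ (⊝ (t ⊗ u))))) refl

  wedge-swap-≢0 : ∀ {u v} → wedge u v ≢0 → wedge v u ≢0
  wedge-swap-≢0 {u} {v} n e = -‿≢0 n (trans (sym (wedge-antisym u v)) e)

  ~refl : ∀ u → u ~ u
  ~refl (s , t) = identity s t
    where
    identity : ∀ s t → s * t - t * s ≡ 0#
    identity = solve 2 (λ s t → ((s ⊗ t) ⊕ (⊝ (t ⊗ s))) ⊜ 𝟎) refl

  ~sym : ∀ {u v} → u ~ v → v ~ u
  ~sym {u} {v} e = trans (wedge-antisym u v) (trans (cong -_ e) -0#≡0#)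

  ~• : ∀ k u → u ~ (k • u)
  ~• k u = trans (wedge-•ʳ k u u) (trans (cong (k *_) (~refl u)) (zeroʳ k))

  •~ : ∀ k u → (k • u) ~ u
  •~ k u = ~sym (~• k u)

  ~act : ∀ M {u v} → u ~ v → act M u ~ act M v
  ~act M {u} {v} e = trans (wedge-act M u v) (trans (cong (det M *_) e) (zeroʳ _))

  -- The Plücker relation [y,z]x + [z,x]y + [x,y]z = 0, read at a nonzero coordinate of y.
  ~trans : ∀ {x y z} → x ~ y → y ~ z → Nonzero y → x ~ z
  ~trans {x1 , x2} {y1 , y2} {z1 , z2} x~y y~z nzy = ~sym (zx≡0 (y1 ≟ 0#))
    where
    zx = wedge (z1 , z2) (x1 , x2)
    drop-zeros : ∀ a b c → (0# * a + b) + 0# * c ≡ b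
    drop-zeros = solve 3 (λ a b c → (((𝟎 ⊗ a) ⊕ b) ⊕ (𝟎 ⊗ c)) ⊜ b) refl
    plücker₁ : ∀ x1 x2 y1 y2 z1 z2 → ((y1 * z2 - y2 * z1) * x1 + (z1 * x2 - z2 * x1) * y1) + (x1 * y2 - x2 * y1) * z1 ≡ 0#
    plücker₁ = solve 6 (λ x1 x2 y1 y2 z1 z2 → (((((y1 ⊗ z2) ⊕ (⊝ (y2 ⊗ z1))) ⊗ x1) ⊕ (((z1 ⊗ x2) ⊕ (⊝ (z2 ⊗ x1))) ⊗ y1)) ⊕ (((x1 ⊗ y2) ⊕ (⊝ (x2 ⊗ y1))) ⊗ z1)) ⊜ 𝟎) refl
    plücker₂ : ∀ x1 x2 y1 y2 z1 z2 → ((y1 * z2 - y2 * z1) * x2 + (z1 * x2 - z2 * x1) * y2) + (x1 * y2 - x2 * y1) * z2 ≡ 0#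
    plücker₂ = solve 6 (λ x1 x2 y1 y2 z1 z2 → (((((y1 ⊗ z2) ⊕ (⊝ (y2 ⊗ z1))) ⊗ x2) ⊕ (((z1 ⊗ x2) ⊕ (⊝ (z2 ⊗ x1))) ⊗ y2)) ⊕ (((x1 ⊗ y2) ⊕ (⊝ (x2 ⊗ y1))) ⊗ z2)) ⊜ 𝟎) refl
    zx≡0 : Dec (y1 ≡ 0#) → zx ≡ 0#
    zx≡0 (no y1≢0) = xy≡0⇒x≡0 (trans (sym (trans (cong (λ w → w * x1 + zx * y1 + wedge (x1 , x2) (y1 , y2) * z1) y~z)
                                  (trans (cong (λ w → 0# * x1 + zx * y1 + w * z1) x~y) (drop-zeros _ _ _))))
                                (plücker₁ x1 x2 y1 y2 z1 z2)) y1≢0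
    zx≡0 (yes y1≡0) = xy≡0⇒x≡0 (trans (sym (trans (cong (λ w → w * x2 + zx * y2 + wedge (x1 , x2) (y1 , y2) * z2) y~z)
                                  (trans (cong (λ w → 0# * x2 + zx * y2 + w * z2) x~y) (drop-zeros _ _ _))))
                                (plücker₂ x1 x2 y1 y2 z1 z2)) (λ y2≡0 → nzy (y1≡0 , y2≡0))


  Nonzero-act : ∀ M {u} → det M ≢0 → Nonzero u → Nonzero (act M u)
  Nonzero-act M {s , t} nd nu Mu≡0 = nu (xy≡0⇒y≡0 (cong proj₁ detM•u≡0) nd , xy≡0⇒y≡0 (cong proj₂ detM•u≡0) nd)
    where
    a*0+b*0 : ∀ a b → a * 0# + b * 0# ≡ 0#
    a*0+b*0 = solve 2 (λ a b → ((a ⊗ 𝟎) ⊕ (b ⊗ 𝟎)) ⊜ 𝟎) refl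
    adj-act≡0 : ∀ N {v} → proj₁ v ≡ 0# → proj₂ v ≡ 0# → act (adj N) v ≡ (0# , 0#)
    adj-act≡0 (mat a b c d) {v1 , v2} refl refl = cong₂ _,_ (a*0+b*0 d (- b)) (a*0+b*0 (- c) a)
    detM•u≡0 : det M • (s , t) ≡ (0# , 0#)
    detM•u≡0 = trans (sym (adj-act M (s , t))) (adj-act≡0 M (proj₁ Mu≡0) (proj₂ Mu≡0))

  Nonzero-•⇒≢0 : ∀ {k u} → Nonzero (k • u) → k ≢0
  Nonzero-•⇒≢0 {k} {s , t} n e = n (trans (cong (_* s) e) (zeroˡ s) , trans (cong (_* t) e) (zeroˡ t))

  ~⇒multiple : ∀ {u v} → u ~ v → Nonzero u → Σ Carrier (λ k → v ≡ k • u)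
  ~⇒multiple {s , t} {v1 , v2} e nu with s ≟ 0#
  ... | no s≢0 = s ⁻¹ * v1 , cong₂ _,_ (rescale s≢0) (trans (xy≡z⇒y≡x⁻¹z s≢0 (x-y≡0⇒x≡y e)) (rotate _ _ _))
    where
    rotate : ∀ a b c → a * (b * c) ≡ (a * c) * b
    rotate = solve 3 (λ a b c → (a ⊗ (b ⊗ c)) ⊜ ((a ⊗ c) ⊗ b)) refl
    rescale : ∀ {b} → b ≢0 → ∀ {x} → x ≡ (b ⁻¹ * x) * b
    rescale {b} nb {x} = sym (trans (*-assoc _ _ _) (trans (cong (b ⁻¹ *_) (*-comm x b)) (⁻¹-*-cancel nb x)))
  ... | yes s≡0 = t ⁻¹ * v2 , cong₂ _,_ (trans (xy≡z⇒y≡x⁻¹z t≢0 (sym (x-y≡0⇒x≡y e))) (rotate _ _ _)) (rescale t≢0)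
    where
    t≢0 : t ≢0
    t≢0 t≡0 = nu (s≡0 , t≡0)
    rotate : ∀ a b c → a * (b * c) ≡ (a * c) * b
    rotate = solve 3 (λ a b c → (a ⊗ (b ⊗ c)) ⊜ ((a ⊗ c) ⊗ b)) refl
    rescale : ∀ {b} → b ≢0 → ∀ {x} → x ≡ (b ⁻¹ * x) * b
    rescale {b} nb {x} = sym (trans (*-assoc _ _ _) (trans (cong (b ⁻¹ *_) (*-comm x b)) (⁻¹-*-cancel nb x)))

  -- Triples serve both as binary quadratic forms x₁st + x₂s² + x₃t² and as line coordinates of the plane.
  Q3 : Set
  Q3 = Carrier × Carrier × Carrier

  evQ : Q3 → V2 → Carrier
  evQ (x1 , x2 , x3) (s , t) = x1 * (s * t) + x2 * (s * s) + x3 * (t * t)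

  productForm : V2 → V2 → Q3
  productForm (s1 , t1) (s2 , t2) = (- (t1 * s2 + s1 * t2) , t1 * t2 , s1 * s2)

  cross : Q3 → Q3 → Q3
  cross (x1 , x2 , x3) (y1 , y2 , y3) = (x2 * y3 - x3 * y2 , x3 * y1 - x1 * y3 , x1 * y2 - x2 * y1)

  IsZero₃ : Q3 → Set
  IsZero₃ (a , b , c) = a ≡ 0# × b ≡ 0# × c ≡ 0#

  _•3_ : Carrier → Q3 → Q3
  k •3 (a , b , c) = (k * a , k * b , k * c)

  0•3-IsZero₃ : ∀ {k} → k ≡ 0# → ∀ b → IsZero₃ (k •3 b)
  0•3-IsZero₃ refl (b1 , b2 , b3) = zeroˡ b1 , zeroˡ b2 , zeroˡ b3

  evQ-productForm : ∀ u1 u2 u → evQ (productForm u1 u2) u ≡ wedge u u1 * wedge u u2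
  evQ-productForm (s1 , t1) (s2 , t2) (s , t) = identity s1 t1 s2 t2 s t
    where
    identity : ∀ s1 t1 s2 t2 s t → (- (t1 * s2 + s1 * t2)) * (s * t) + (t1 * t2) * (s * s) + (s1 * s2) * (t * t) ≡ (s * t1 - t * s1) * (s * t2 - t * s2)
    identity = solve 6 (λ s1 t1 s2 t2 s t → ((((⊝ ((t1 ⊗ s2) ⊕ (s1 ⊗ t2))) ⊗ (s ⊗ t)) ⊕ ((t1 ⊗ t2) ⊗ (s ⊗ s))) ⊕ ((s1 ⊗ s2) ⊗ (t ⊗ t))) ⊜ (((s ⊗ t1) ⊕ (⊝ (t ⊗ s1))) ⊗ ((s ⊗ t2) ⊕ (⊝ (t ⊗ s2))))) refl

  evQ-• : ∀ x k u → evQ x (k • u) ≡ (k * k) * evQ x u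
  evQ-• (x1 , x2 , x3) k (s , t) = identity x1 x2 x3 k s t
    where
    identity : ∀ x1 x2 x3 k s t → x1 * ((k * s) * (k * t)) + x2 * ((k * s) * (k * s)) + x3 * ((k * t) * (k * t)) ≡ (k * k) * (x1 * (s * t) + x2 * (s * s) + x3 * (t * t))
    identity = solve 6 (λ x1 x2 x3 k s t → (((x1 ⊗ ((k ⊗ s) ⊗ (k ⊗ t))) ⊕ (x2 ⊗ ((k ⊗ s) ⊗ (k ⊗ s)))) ⊕ (x3 ⊗ ((k ⊗ t) ⊗ (k ⊗ t)))) ⊜ ((k ⊗ k) ⊗ (((x1 ⊗ (s ⊗ t)) ⊕ (x2 ⊗ (s ⊗ s))) ⊕ (x3 ⊗ (t ⊗ t))))) refl

  evQ-•3 : ∀ k x u → evQ (k •3 x) u ≡ k * evQ x u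
  evQ-•3 k (x1 , x2 , x3) (s , t) = identity x1 x2 x3 k s t
    where
    identity : ∀ x1 x2 x3 k s t → (k * x1) * (s * t) + (k * x2) * (s * s) + (k * x3) * (t * t) ≡ k * (x1 * (s * t) + x2 * (s * s) + x3 * (t * t))
    identity = solve 6 (λ x1 x2 x3 k s t → ((((k ⊗ x1) ⊗ (s ⊗ t)) ⊕ ((k ⊗ x2) ⊗ (s ⊗ s))) ⊕ ((k ⊗ x3) ⊗ (t ⊗ t))) ⊜ (k ⊗ (((x1 ⊗ (s ⊗ t)) ⊕ (x2 ⊗ (s ⊗ s))) ⊕ (x3 ⊗ (t ⊗ t))))) refl

  evQ-~ : ∀ x {u v} → u ~ v → Nonzero u → evQ x u ≡ 0# → evQ x v ≡ 0#
  evQ-~ x {u} e nu z with ~⇒multiple e nu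
  ... | k , refl = trans (evQ-• x k u) (trans (cong ((k * k) *_) z) (zeroʳ _))

  evQ-zero : ∀ x → (∀ u → evQ x u ≡ 0#) → IsZero₃ x
  evQ-zero (x1 , x2 , x3) vanishes = x1≡0 , x2≡0 , x3≡0
    where
    at-e₁ : ∀ x1 x2 x3 → x1 * (1# * 0#) + x2 * (1# * 1#) + x3 * (0# * 0#) ≡ x2
    at-e₁ = solve 3 (λ x1 x2 x3 → (((x1 ⊗ (𝟏 ⊗ 𝟎)) ⊕ (x2 ⊗ (𝟏 ⊗ 𝟏))) ⊕ (x3 ⊗ (𝟎 ⊗ 𝟎))) ⊜ x2) refl
    at-e₂ : ∀ x1 x2 x3 → x1 * (0# * 1#) + x2 * (0# * 0#) + x3 * (1# * 1#) ≡ x3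
    at-e₂ = solve 3 (λ x1 x2 x3 → (((x1 ⊗ (𝟎 ⊗ 𝟏)) ⊕ (x2 ⊗ (𝟎 ⊗ 𝟎))) ⊕ (x3 ⊗ (𝟏 ⊗ 𝟏))) ⊜ x3) refl
    at-e₃ : ∀ x1 x2 x3 → x1 * (1# * 1#) + x2 * (1# * 1#) + x3 * (1# * 1#) ≡ x1 + x2 + x3
    at-e₃ = solve 3 (λ x1 x2 x3 → (((x1 ⊗ (𝟏 ⊗ 𝟏)) ⊕ (x2 ⊗ (𝟏 ⊗ 𝟏))) ⊕ (x3 ⊗ (𝟏 ⊗ 𝟏))) ⊜ ((x1 ⊕ x2) ⊕ x3)) refl
    +0+0 : ∀ a → a + 0# + 0# ≡ a
    +0+0 = solve 1 (λ a → ((a ⊕ 𝟎) ⊕ 𝟎) ⊜ a) refl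
    x2≡0 = trans (sym (at-e₁ x1 x2 x3)) (vanishes (1# , 0#))
    x3≡0 = trans (sym (at-e₂ x1 x2 x3)) (vanishes (0# , 1#))
    x1≡0 = trans (sym (+0+0 x1)) (trans (cong₂ (λ A B → x1 + A + B) (sym x2≡0) (sym x3≡0))
             (trans (sym (at-e₃ x1 x2 x3)) (vanishes (1# , 1#))))

  -- A form vanishing at two independent points u₁, u₂ is a multiple of productForm u₁ u₂, because their cross product vanishes.
  cross-productForm≡0 : ∀ x u1 u2 → evQ x u1 ≡ 0# → evQ x u2 ≡ 0# → wedge u1 u2 ≢0 → IsZero₃ (cross x (productForm u1 u2))
  cross-productForm≡0 (x1 , x2 , x3) (s1 , t1) (s2 , t2) e₁ e₂ nd =
      xy≡0⇒y≡0 (trans (first x1 x2 x3 s1 t1 s2 t2) (combination≡0 _ _)) nd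
    , xy≡0⇒y≡0 (trans (second x1 x2 x3 s1 t1 s2 t2) (combination≡0 _ _)) nd
    , xy≡0⇒y≡0 (trans (third x1 x2 x3 s1 t1 s2 t2) (combination≡0 _ _)) nd
    where
    combination≡0 : ∀ a b → a * evQ (x1 , x2 , x3) (s1 , t1) - b * evQ (x1 , x2 , x3) (s2 , t2) ≡ 0#
    combination≡0 a b = trans (cong₂ (λ X Y → a * X - b * Y) e₁ e₂) (a*0-b*0 a b)
      where
      a*0-b*0 : ∀ a b → a * 0# - b * 0# ≡ 0#
      a*0-b*0 = solve 2 (λ a b → ((a ⊗ 𝟎) ⊕ (⊝ (b ⊗ 𝟎))) ⊜ 𝟎) refl
    first : ∀ x1 x2 x3 s1 t1 s2 t2 → (s1 * t2 - t1 * s2) * (x2 * (s1 * s2) - x3 * (t1 * t2)) ≡ (s2 * t2) * (x1 * (s1 * t1) + x2 * (s1 * s1) + x3 * (t1 * t1)) - (s1 * t1) * (x1 * (s2 * t2) + x2 * (s2 * s2) + x3 * (t2 * t2))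
    first = solve 7 (λ x1 x2 x3 s1 t1 s2 t2 → (((s1 ⊗ t2) ⊕ (⊝ (t1 ⊗ s2))) ⊗ ((x2 ⊗ (s1 ⊗ s2)) ⊕ (⊝ (x3 ⊗ (t1 ⊗ t2))))) ⊜ (((s2 ⊗ t2) ⊗ (((x1 ⊗ (s1 ⊗ t1)) ⊕ (x2 ⊗ (s1 ⊗ s1))) ⊕ (x3 ⊗ (t1 ⊗ t1)))) ⊕ (⊝ ((s1 ⊗ t1) ⊗ (((x1 ⊗ (s2 ⊗ t2)) ⊕ (x2 ⊗ (s2 ⊗ s2))) ⊕ (x3 ⊗ (t2 ⊗ t2))))))) refl
    second : ∀ x1 x2 x3 s1 t1 s2 t2 → (s1 * t2 - t1 * s2) * (x3 * (- (t1 * s2 + s1 * t2)) - x1 * (s1 * s2)) ≡ (s2 * s2) * (x1 * (s1 * t1) + x2 * (s1 * s1) + x3 * (t1 * t1)) - (s1 * s1) * (x1 * (s2 * t2) + x2 * (s2 * s2) + x3 * (t2 * t2))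
    second = solve 7 (λ x1 x2 x3 s1 t1 s2 t2 → (((s1 ⊗ t2) ⊕ (⊝ (t1 ⊗ s2))) ⊗ ((x3 ⊗ (⊝ ((t1 ⊗ s2) ⊕ (s1 ⊗ t2)))) ⊕ (⊝ (x1 ⊗ (s1 ⊗ s2))))) ⊜ (((s2 ⊗ s2) ⊗ (((x1 ⊗ (s1 ⊗ t1)) ⊕ (x2 ⊗ (s1 ⊗ s1))) ⊕ (x3 ⊗ (t1 ⊗ t1)))) ⊕ (⊝ ((s1 ⊗ s1) ⊗ (((x1 ⊗ (s2 ⊗ t2)) ⊕ (x2 ⊗ (s2 ⊗ s2))) ⊕ (x3 ⊗ (t2 ⊗ t2))))))) refl
    third : ∀ x1 x2 x3 s1 t1 s2 t2 → (s1 * t2 - t1 * s2) * (x1 * (t1 * t2) - x2 * (- (t1 * s2 + s1 * t2))) ≡ (t2 * t2) * (x1 * (s1 * t1) + x2 * (s1 * s1) + x3 * (t1 * t1)) - (t1 * t1) * (x1 * (s2 * t2) + x2 * (s2 * s2) + x3 * (t2 * t2))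
    third = solve 7 (λ x1 x2 x3 s1 t1 s2 t2 → (((s1 ⊗ t2) ⊕ (⊝ (t1 ⊗ s2))) ⊗ ((x1 ⊗ (t1 ⊗ t2)) ⊕ (⊝ (x2 ⊗ (⊝ ((t1 ⊗ s2) ⊕ (s1 ⊗ t2))))))) ⊜ (((t2 ⊗ t2) ⊗ (((x1 ⊗ (s1 ⊗ t1)) ⊕ (x2 ⊗ (s1 ⊗ s1))) ⊕ (x3 ⊗ (t1 ⊗ t1)))) ⊕ (⊝ ((t1 ⊗ t1) ⊗ (((x1 ⊗ (s2 ⊗ t2)) ⊕ (x2 ⊗ (s2 ⊗ s2))) ⊕ (x3 ⊗ (t2 ⊗ t2))))))) refl

  evQ-IsZero₃ : ∀ x → IsZero₃ x → ∀ u → evQ x u ≡ 0#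
  evQ-IsZero₃ (x1 , x2 , x3) (refl , refl , refl) (s , t) = zero-form s t
    where
    zero-form : ∀ s t → 0# * (s * t) + 0# * (s * s) + 0# * (t * t) ≡ 0#
    zero-form = solve 2 (λ s t → (((𝟎 ⊗ (s ⊗ t)) ⊕ (𝟎 ⊗ (s ⊗ s))) ⊕ (𝟎 ⊗ (t ⊗ t))) ⊜ 𝟎) refl

  -- Evaluated at u₁ + u₂, productForm u₁ u₂ gives −(wedge u₁ u₂)², which is nonzero.
  productForm-nonzero : ∀ u1 u2 → wedge u1 u2 ≢0 → ¬ IsZero₃ (productForm u1 u2)
  productForm-nonzero (s1 , t1) (s2 , t2) nd z =
    -‿≢0 (*-≢0 nd nd) (trans value-at-sum (evQ-IsZero₃ (productForm (s1 , t1) (s2 , t2)) z (s1 + s2 , t1 + t2)))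
    where
    at-sum : ∀ s1 t1 s2 t2 → ((s1 + s2) * t1 - (t1 + t2) * s1) * ((s1 + s2) * t2 - (t1 + t2) * s2) ≡ - ((s1 * t2 - t1 * s2) * (s1 * t2 - t1 * s2))
    at-sum = solve 4 (λ s1 t1 s2 t2 → ((((s1 ⊕ s2) ⊗ t1) ⊕ (⊝ ((t1 ⊕ t2) ⊗ s1))) ⊗ (((s1 ⊕ s2) ⊗ t2) ⊕ (⊝ ((t1 ⊕ t2) ⊗ s2)))) ⊜ (⊝ (((s1 ⊗ t2) ⊕ (⊝ (t1 ⊗ s2))) ⊗ ((s1 ⊗ t2) ⊕ (⊝ (t1 ⊗ s2)))))) refl
    value-at-sum : - (wedge (s1 , t1) (s2 , t2) * wedge (s1 , t1) (s2 , t2)) ≡ evQ (productForm (s1 , t1) (s2 , t2)) (s1 + s2 , t1 + t2)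
    value-at-sum = sym (trans (evQ-productForm (s1 , t1) (s2 , t2) (s1 + s2 , t1 + t2)) (at-sum s1 t1 s2 t2))

  cross≡0⇒multiple : ∀ x b → IsZero₃ (cross x b) → ¬ IsZero₃ b → Σ Carrier (λ k → x ≡ k •3 b)
  cross≡0⇒multiple (x1 , x2 , x3) (b1 , b2 , b3) (c1 , c2 , c3) nb = go (b1 ≟ 0#) (b2 ≟ 0#) (b3 ≟ 0#)
    where
    scaled : ∀ {bi bj xi xj} → bi ≢0 → xj * bi ≡ xi * bj → xj ≡ (bi ⁻¹ * xi) * bj
    scaled {bi} nb e = trans (xy≡z⇒y≡x⁻¹z nb (trans (*-comm bi _) e)) (sym (*-assoc _ _ _))
    self : ∀ {b x} → b ≢0 → x ≡ (b ⁻¹ * x) * b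
    self {b} {x} nb = scaled nb refl
    go : Dec (b1 ≡ 0#) → Dec (b2 ≡ 0#) → Dec (b3 ≡ 0#) → Σ Carrier (λ k → (x1 , x2 , x3) ≡ k •3 (b1 , b2 , b3))
    go (no n1) _ _ = b1 ⁻¹ * x1 ,
      cong₂ _,_ (self n1) (cong₂ _,_ (scaled n1 (sym (x-y≡0⇒x≡y c3))) (scaled n1 (x-y≡0⇒x≡y c2)))
    go (yes _) (no n2) _ = b2 ⁻¹ * x2 ,
      cong₂ _,_ (scaled n2 (x-y≡0⇒x≡y c3)) (cong₂ _,_ (self n2) (scaled n2 (sym (x-y≡0⇒x≡y c1))))
    go (yes _) (yes _) (no n3) = b3 ⁻¹ * x3 ,
      cong₂ _,_ (scaled n3 (sym (x-y≡0⇒x≡y c2))) (cong₂ _,_ (scaled n3 (x-y≡0⇒x≡y c1)) (self n3))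
    go (yes p1) (yes p2) (yes p3) = ⊥-elim (nb (p1 , p2 , p3))

  twoZeros⇒multiple : ∀ x u1 u2 → evQ x u1 ≡ 0# → evQ x u2 ≡ 0# → wedge u1 u2 ≢0 →
                      Σ Carrier (λ k → x ≡ k •3 productForm u1 u2)
  twoZeros⇒multiple x u1 u2 e₁ e₂ nd =
    cross≡0⇒multiple x (productForm u1 u2) (cross-productForm≡0 x u1 u2 e₁ e₂ nd) (productForm-nonzero u1 u2 nd)

  threeZeros⇒zero : ∀ x u1 u2 u3 → evQ x u1 ≡ 0# → evQ x u2 ≡ 0# → evQ x u3 ≡ 0# →
                    wedge u1 u2 ≢0 → wedge u3 u1 ≢0 → wedge u3 u2 ≢0 → IsZero₃ x
  threeZeros⇒zero x u1 u2 u3 e₁ e₂ e₃ n12 n31 n32 = subst IsZero₃ (sym x≡k•b) (0•3-IsZero₃ k≡0 (productForm u1 u2))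
    where
    k = proj₁ (twoZeros⇒multiple x u1 u2 e₁ e₂ n12)
    x≡k•b = proj₂ (twoZeros⇒multiple x u1 u2 e₁ e₂ n12)
    k≡0 : k ≡ 0#
    k≡0 = xy≡0⇒x≡0 (trans (sym (trans (evQ-•3 k (productForm u1 u2) u3) (cong (k *_) (evQ-productForm u1 u2 u3))))
                      (trans (cong (λ y → evQ y u3) (sym x≡k•b)) e₃)) (*-≢0 n31 n32)

  commonZeros⇒cross≡0 : ∀ x y u1 u2 → evQ x u1 ≡ 0# → evQ x u2 ≡ 0# → evQ y u1 ≡ 0# → evQ y u2 ≡ 0# →
                        wedge u1 u2 ≢0 → IsZero₃ (cross x y)
  commonZeros⇒cross≡0 x y u1 u2 e₁ e₂ f₁ f₂ nd =
    subst IsZero₃ (sym (cong₂ cross (proj₂ x-multiple) (proj₂ y-multiple))) (cross-multiples (productForm u1 u2))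
    where
    x-multiple = twoZeros⇒multiple x u1 u2 e₁ e₂ nd
    y-multiple = twoZeros⇒multiple y u1 u2 f₁ f₂ nd
    component : ∀ b c k l → (k * b) * (l * c) - (k * c) * (l * b) ≡ 0#
    component = solve 4 (λ b c k l → (((k ⊗ b) ⊗ (l ⊗ c)) ⊕ (⊝ ((k ⊗ c) ⊗ (l ⊗ b)))) ⊜ 𝟎) refl
    cross-multiples : ∀ b → IsZero₃ (cross (proj₁ x-multiple •3 b) (proj₁ y-multiple •3 b))
    cross-multiples (b1 , b2 , b3) = component b2 b3 _ _ , component b3 b1 _ _ , component b1 b2 _ _

  e₁ e₂ e₃ : V2
  e₁ = (1# , 0#)
  e₂ = (0# , 1#)
  e₃ = (1# , 1#)

  Nonzero-e₁ : Nonzero e₁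
  Nonzero-e₁ (p , _) = 1≢0 p
  Nonzero-e₂ : Nonzero e₂
  Nonzero-e₂ (_ , p) = 1≢0 p
  Nonzero-e₃ : Nonzero e₃
  Nonzero-e₃ (p , _) = 1≢0 p

  record GeneralPosition (u1 u2 u3 : V2) : Set where
    field
      n1 : Nonzero u1
      n2 : Nonzero u2
      n3 : Nonzero u3
      d12 : wedge u1 u2 ≢0
      d31 : wedge u3 u1 ≢0
      d32 : wedge u3 u2 ≢0

  -- frame u₁ u₂ u₃ has columns λu₁ and μu₂ with λu₁ + μu₂ = u₃ (Cramer's rule), so it sends the standard frame e₁, e₂, e₃ to u₁, u₂, u₃.
  frameˡ frameʳ : V2 → V2 → V2 → Carrier
  frameˡ u1 u2 u3 = wedge u3 u2 * (wedge u1 u2) ⁻¹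
  frameʳ u1 u2 u3 = wedge u1 u3 * (wedge u1 u2) ⁻¹

  frame : V2 → V2 → V2 → Mat
  frame (s1 , t1) (s2 , t2) u3 = mat (L * s1) (M * s2) (L * t1) (M * t2)
    where L = frameˡ (s1 , t1) (s2 , t2) u3
          M = frameʳ (s1 , t1) (s2 , t2) u3

  frame-e₁ : ∀ u1 u2 u3 → act (frame u1 u2 u3) e₁ ≡ frameˡ u1 u2 u3 • u1
  frame-e₁ (s1 , t1) (s2 , t2) u3 = cong₂ _,_ (column _ _ s1 s2) (column _ _ t1 t2)
    where
    column : ∀ L M a b → (L * a) * 1# + (M * b) * 0# ≡ L * a
    column = solve 4 (λ L M a b → (((L ⊗ a) ⊗ 𝟏) ⊕ ((M ⊗ b) ⊗ 𝟎)) ⊜ (L ⊗ a)) refl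

  frame-e₂ : ∀ u1 u2 u3 → act (frame u1 u2 u3) e₂ ≡ frameʳ u1 u2 u3 • u2
  frame-e₂ (s1 , t1) (s2 , t2) u3 = cong₂ _,_ (column _ _ s1 s2) (column _ _ t1 t2)
    where
    column : ∀ L M a b → (L * a) * 0# + (M * b) * 1# ≡ M * b
    column = solve 4 (λ L M a b → (((L ⊗ a) ⊗ 𝟎) ⊕ ((M ⊗ b) ⊗ 𝟏)) ⊜ (M ⊗ b)) refl

  frame-e₃ : ∀ u1 u2 u3 → wedge u1 u2 ≢0 → act (frame u1 u2 u3) e₃ ≡ u3
  frame-e₃ (s1 , t1) (s2 , t2) (s3 , t3) nd = cong₂ _,_
    (trans (sum _ _ _ s1 s2) (trans (cong (D⁻¹ *_) (cramer₁ s1 t1 s2 t2 s3 t3)) (⁻¹-*-cancel nd s3)))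
    (trans (sum _ _ _ t1 t2) (trans (cong (D⁻¹ *_) (cramer₂ s1 t1 s2 t2 s3 t3)) (⁻¹-*-cancel nd t3)))
    where
    D⁻¹ = (wedge (s1 , t1) (s2 , t2)) ⁻¹
    sum : ∀ A B D s1 s2 → ((A * D) * s1) * 1# + ((B * D) * s2) * 1# ≡ D * (A * s1 + B * s2)
    sum = solve 5 (λ A B D s1 s2 → ((((A ⊗ D) ⊗ s1) ⊗ 𝟏) ⊕ (((B ⊗ D) ⊗ s2) ⊗ 𝟏)) ⊜ (D ⊗ ((A ⊗ s1) ⊕ (B ⊗ s2)))) refl
    cramer₁ : ∀ s1 t1 s2 t2 s3 t3 → (s3 * t2 - t3 * s2) * s1 + (s1 * t3 - t1 * s3) * s2 ≡ (s1 * t2 - t1 * s2) * s3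
    cramer₁ = solve 6 (λ s1 t1 s2 t2 s3 t3 → ((((s3 ⊗ t2) ⊕ (⊝ (t3 ⊗ s2))) ⊗ s1) ⊕ (((s1 ⊗ t3) ⊕ (⊝ (t1 ⊗ s3))) ⊗ s2)) ⊜ (((s1 ⊗ t2) ⊕ (⊝ (t1 ⊗ s2))) ⊗ s3)) refl
    cramer₂ : ∀ s1 t1 s2 t2 s3 t3 → (s3 * t2 - t3 * s2) * t1 + (s1 * t3 - t1 * s3) * t2 ≡ (s1 * t2 - t1 * s2) * t3
    cramer₂ = solve 6 (λ s1 t1 s2 t2 s3 t3 → ((((s3 ⊗ t2) ⊕ (⊝ (t3 ⊗ s2))) ⊗ t1) ⊕ (((s1 ⊗ t3) ⊕ (⊝ (t1 ⊗ s3))) ⊗ t2)) ⊜ (((s1 ⊗ t2) ⊕ (⊝ (t1 ⊗ s2))) ⊗ t3)) refl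

  frame-det : ∀ u1 u2 u3 → det (frame u1 u2 u3) ≡ (frameˡ u1 u2 u3 * frameʳ u1 u2 u3) * wedge u1 u2
  frame-det (s1 , t1) (s2 , t2) u3 = identity _ _ s1 t1 s2 t2
    where
    identity : ∀ L M s1 t1 s2 t2 → (L * s1) * (M * t2) - (M * s2) * (L * t1) ≡ (L * M) * (s1 * t2 - t1 * s2)
    identity = solve 6 (λ L M s1 t1 s2 t2 → (((L ⊗ s1) ⊗ (M ⊗ t2)) ⊕ (⊝ ((M ⊗ s2) ⊗ (L ⊗ t1)))) ⊜ ((L ⊗ M) ⊗ ((s1 ⊗ t2) ⊕ (⊝ (t1 ⊗ s2))))) refl

  frame-det≢0 : ∀ {u1 u2 u3} → GeneralPosition u1 u2 u3 → det (frame u1 u2 u3) ≢0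
  frame-det≢0 {u1} {u2} {u3} I e = *-≢0 (*-≢0 (*-≢0 d32 (⁻¹-≢0 d12)) (*-≢0 (wedge-swap-≢0 d31) (⁻¹-≢0 d12))) d12
                                      (trans (sym (frame-det u1 u2 u3)) e)
    where open GeneralPosition I

  transport~ : ∀ T T' {e u v} → det T ≢0 → det T' ≢0 → Nonzero e → Nonzero u →
               act T e ~ u → act T' e ~ v → act (mul T' (adj T)) u ~ v
  transport~ T T' {e} {u} {v} dT dT' ne nu Te~u T'e~v = subst (_~ v) (sym (act-mul T' (adj T) u)) (~trans (~act T' adjT-u~e) T'e~v (Nonzero-act T' dT' ne))
    where
    adjT-Te~e : act (adj T) (act T e) ~ e
    adjT-Te~e = subst (_~ e) (sym (adj-act T e)) (•~ (det T) e)
    adjT-u~e : act (adj T) u ~ e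
    adjT-u~e = ~trans (~act (adj T) (~sym Te~u)) adjT-Te~e (Nonzero-act (adj T) (det-adj≢0 T dT) (Nonzero-act T dT ne))

  threePointMap : V2 → V2 → V2 → V2 → V2 → V2 → Mat
  threePointMap u1 u2 u3 v1 v2 v3 = mul (frame v1 v2 v3) (adj (frame u1 u2 u3))

  threePointMap-det≢0 : ∀ {u1 u2 u3 v1 v2 v3} → GeneralPosition u1 u2 u3 → GeneralPosition v1 v2 v3 →
                        det (threePointMap u1 u2 u3 v1 v2 v3) ≢0
  threePointMap-det≢0 {u1} {u2} {u3} {v1} {v2} {v3} I J e =
    *-≢0 (frame-det≢0 J) (det-adj≢0 (frame u1 u2 u3) (frame-det≢0 I)) (trans (sym (det-mul (frame v1 v2 v3) (adj (frame u1 u2 u3)))) e)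

  record Maps₃ (M : Mat) (u1 u2 u3 v1 v2 v3 : V2) : Set where
    field
      m1 : act M u1 ~ v1
      m2 : act M u2 ~ v2
      m3 : act M u3 ~ v3

  threePointMap-maps : ∀ {u1 u2 u3 v1 v2 v3} → GeneralPosition u1 u2 u3 → GeneralPosition v1 v2 v3 →
                       Maps₃ (threePointMap u1 u2 u3 v1 v2 v3) u1 u2 u3 v1 v2 v3
  threePointMap-maps {u1} {u2} {u3} {v1} {v2} {v3} I J = record
    { m1 = transport Nonzero-e₁ (GeneralPosition.n1 I)
             (subst (_~ u1) (sym (frame-e₁ u1 u2 u3)) (•~ _ u1)) (subst (_~ v1) (sym (frame-e₁ v1 v2 v3)) (•~ _ v1))
    ; m2 = transport Nonzero-e₂ (GeneralPosition.n2 I)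
             (subst (_~ u2) (sym (frame-e₂ u1 u2 u3)) (•~ _ u2)) (subst (_~ v2) (sym (frame-e₂ v1 v2 v3)) (•~ _ v2))
    ; m3 = transport Nonzero-e₃ (GeneralPosition.n3 I)
             (subst (_~ u3) (sym (frame-e₃ u1 u2 u3 (GeneralPosition.d12 I))) (~refl u3))
             (subst (_~ v3) (sym (frame-e₃ v1 v2 v3 (GeneralPosition.d12 J))) (~refl v3))
    }
    where
    transport : ∀ {e u v} → Nonzero e → Nonzero u → act (frame u1 u2 u3) e ~ u → act (frame v1 v2 v3) e ~ v →
                act (threePointMap u1 u2 u3 v1 v2 v3) u ~ v
    transport = transport~ (frame u1 u2 u3) (frame v1 v2 v3) (frame-det≢0 I) (frame-det≢0 J)

  MatEq : Mat → Mat → Set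
  MatEq (mat a b c d) (mat e f g h) = a ≡ e × b ≡ f × c ≡ g × d ≡ h

  -- With P = adj M · N, the condition M u ~ N u says that the form (p₁₁ − p₂₂, −p₂₁, p₁₂) vanishes at u; three such zeros force P to be scalar.
  agreeOnThree⇒proportional : ∀ M N {u1 u2 u3} → det M ≢0 → GeneralPosition u1 u2 u3 →
                              act M u1 ~ act N u1 → act M u2 ~ act N u2 → act M u3 ~ act N u3 →
                              Σ Carrier (λ κ → MatEq N (κ •M M))
  agreeOnThree⇒proportional (mat a b c d) (mat e f g h) {u1} {u2} {u3} dM I h1 h2 h3 = κ , N≡κM
    where
    p11 = d * e + - b * g
    p12 = d * f + - b * h
    p21 = - c * e + a * g
    p22 = - c * f + a * h
    form : Q3
    form = (p11 - p22 , - p21 , p12)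
    wedge-identity : ∀ a b c d e f g h s t →
      ((d * e + (- b) * g) * s + (d * f + (- b) * h) * t) * t - (((- c) * e + a * g) * s + ((- c) * f + a * h) * t) * s
        ≡ (e * s + f * t) * (c * s + d * t) - (g * s + h * t) * (a * s + b * t)
    wedge-identity = solve 10 (λ a b c d e f g h s t → ((((((d ⊗ e) ⊕ ((⊝ b) ⊗ g)) ⊗ s) ⊕ (((d ⊗ f) ⊕ ((⊝ b) ⊗ h)) ⊗ t)) ⊗ t) ⊕ (⊝ ((((((⊝ c) ⊗ e) ⊕ (a ⊗ g)) ⊗ s) ⊕ ((((⊝ c) ⊗ f) ⊕ (a ⊗ h)) ⊗ t)) ⊗ s))) ⊜ ((((e ⊗ s) ⊕ (f ⊗ t)) ⊗ ((c ⊗ s) ⊕ (d ⊗ t))) ⊕ (⊝ (((g ⊗ s) ⊕ (h ⊗ t)) ⊗ ((a ⊗ s) ⊕ (b ⊗ t)))))) refl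
    as-form : ∀ p q r w s t → (p * s + q * t) * t - (r * s + w * t) * s ≡ (p - w) * (s * t) + (- r) * (s * s) + q * (t * t)
    as-form = solve 6 (λ p q r w s t → ((((p ⊗ s) ⊕ (q ⊗ t)) ⊗ t) ⊕ (⊝ (((r ⊗ s) ⊕ (w ⊗ t)) ⊗ s))) ⊜ ((((p ⊕ (⊝ w)) ⊗ (s ⊗ t)) ⊕ ((⊝ r) ⊗ (s ⊗ s))) ⊕ (q ⊗ (t ⊗ t)))) refl
    form-zero : ∀ u → act (mat a b c d) u ~ act (mat e f g h) u → evQ form u ≡ 0#
    form-zero (s , t) Mu~Nu = trans (sym (as-form p11 p12 p21 p22 s t)) (trans (wedge-identity a b c d e f g h s t) (~sym Mu~Nu))
    form≡0 : IsZero₃ form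
    form≡0 = threeZeros⇒zero form u1 u2 u3 (form-zero u1 h1) (form-zero u2 h2) (form-zero u3 h3) d12 d31 d32
      where open GeneralPosition I
    p21≡0 : p21 ≡ 0#
    p21≡0 = -x≡0⇒x≡0 (proj₁ (proj₂ form≡0))
    p12≡0 : p12 ≡ 0#
    p12≡0 = proj₂ (proj₂ form≡0)
    p22≡p11 : p22 ≡ p11
    p22≡p11 = sym (x-y≡0⇒x≡y (proj₁ form≡0))
    κ = (a * d - b * c) ⁻¹ * p11
    solve-entry : ∀ {n m z w} → (a * d - b * c) * n ≡ m * p11 + z * w → w ≡ 0# → n ≡ κ * m
    solve-entry {n} {m} {z} eq refl = trans (xy≡z⇒y≡x⁻¹z dM (trans eq (drop m p11 z))) (sym (*-assoc _ _ _))
      where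
      drop : ∀ m p z → m * p + z * 0# ≡ p * m
      drop = solve 3 (λ m p z → ((m ⊗ p) ⊕ (z ⊗ 𝟎)) ⊜ (p ⊗ m)) refl
    swap+ : ∀ x y → x + y ≡ y + x
    swap+ = solve 2 (λ x y → (x ⊕ y) ⊜ (y ⊕ x)) refl
    entry₁₁ : ∀ a b c d e f g h → (a * d - b * c) * e ≡ a * (d * e + (- b) * g) + b * ((- c) * e + a * g)
    entry₁₁ = solve 8 (λ a b c d e f g h → (((a ⊗ d) ⊕ (⊝ (b ⊗ c))) ⊗ e) ⊜ ((a ⊗ ((d ⊗ e) ⊕ ((⊝ b) ⊗ g))) ⊕ (b ⊗ (((⊝ c) ⊗ e) ⊕ (a ⊗ g))))) refl
    entry₁₂ : ∀ a b c d e f g h → (a * d - b * c) * f ≡ a * (d * f + (- b) * h) + b * ((- c) * f + a * h)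
    entry₁₂ = solve 8 (λ a b c d e f g h → (((a ⊗ d) ⊕ (⊝ (b ⊗ c))) ⊗ f) ⊜ ((a ⊗ ((d ⊗ f) ⊕ ((⊝ b) ⊗ h))) ⊕ (b ⊗ (((⊝ c) ⊗ f) ⊕ (a ⊗ h))))) refl
    entry₂₁ : ∀ a b c d e f g h → (a * d - b * c) * g ≡ c * (d * e + (- b) * g) + d * ((- c) * e + a * g)
    entry₂₁ = solve 8 (λ a b c d e f g h → (((a ⊗ d) ⊕ (⊝ (b ⊗ c))) ⊗ g) ⊜ ((c ⊗ ((d ⊗ e) ⊕ ((⊝ b) ⊗ g))) ⊕ (d ⊗ (((⊝ c) ⊗ e) ⊕ (a ⊗ g))))) refl
    entry₂₂ : ∀ a b c d e f g h → (a * d - b * c) * h ≡ c * (d * f + (- b) * h) + d * ((- c) * f + a * h)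
    entry₂₂ = solve 8 (λ a b c d e f g h → (((a ⊗ d) ⊕ (⊝ (b ⊗ c))) ⊗ h) ⊜ ((c ⊗ ((d ⊗ f) ⊕ ((⊝ b) ⊗ h))) ⊕ (d ⊗ (((⊝ c) ⊗ f) ⊕ (a ⊗ h))))) refl
    N≡κM : MatEq (mat e f g h) (κ •M mat a b c d)
    N≡κM = solve-entry (entry₁₁ a b c d e f g h) p21≡0
         , solve-entry (trans (entry₁₂ a b c d e f g h) (trans (cong (λ W → a * p12 + b * W) p22≡p11) (swap+ _ _))) p12≡0
         , solve-entry (entry₂₁ a b c d e f g h) p21≡0
         , solve-entry (trans (entry₂₂ a b c d e f g h) (trans (cong (λ W → c * p12 + d * W) p22≡p11) (swap+ _ _))) p12≡0

  -- With x the common cross ratio, the equation x·[a,X][b,c] = [a,c][b,X] is linear in X and cuts out a single point.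
  crossRatio-determines : ∀ x a b c X Y → x ≢0 → wedge a b ≢0 → wedge b c ≢0 →
                          x * (wedge a X * wedge b c) ≡ wedge a c * wedge b X →
                          x * (wedge a Y * wedge b c) ≡ wedge a c * wedge b Y → X ~ Y
  crossRatio-determines x (a1 , a2) (b1 , b2) (c1 , c2) (X1 , X2) (Y1 , Y2) nx nab nbc eX eY =
    xy≡0⇒y≡0 (xy≡0⇒y≡0 (trans (eliminate x a1 a2 b1 b2 c1 c2 X1 X2 Y1 Y2)
      (trans (cong₂ (λ P Q → P * (b1 * Y2 - b2 * Y1) - Q * (b1 * X2 - b2 * X1)) eX eY) (cancel _ _ _))) (*-≢0 nx nbc)) nab
    where
    eliminate : ∀ x a1 a2 b1 b2 c1 c2 X1 X2 Y1 Y2 →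
      (x * (b1 * c2 - b2 * c1)) * ((a1 * b2 - a2 * b1) * (X1 * Y2 - X2 * Y1))
        ≡ (x * ((a1 * X2 - a2 * X1) * (b1 * c2 - b2 * c1))) * (b1 * Y2 - b2 * Y1) - (x * ((a1 * Y2 - a2 * Y1) * (b1 * c2 - b2 * c1))) * (b1 * X2 - b2 * X1)
    eliminate = solve 11 (λ x a1 a2 b1 b2 c1 c2 X1 X2 Y1 Y2 → ((x ⊗ ((b1 ⊗ c2) ⊕ (⊝ (b2 ⊗ c1)))) ⊗ (((a1 ⊗ b2) ⊕ (⊝ (a2 ⊗ b1))) ⊗ ((X1 ⊗ Y2) ⊕ (⊝ (X2 ⊗ Y1))))) ⊜ (((x ⊗ (((a1 ⊗ X2) ⊕ (⊝ (a2 ⊗ X1))) ⊗ ((b1 ⊗ c2) ⊕ (⊝ (b2 ⊗ c1))))) ⊗ ((b1 ⊗ Y2) ⊕ (⊝ (b2 ⊗ Y1)))) ⊕ (⊝ ((x ⊗ (((a1 ⊗ Y2) ⊕ (⊝ (a2 ⊗ Y1))) ⊗ ((b1 ⊗ c2) ⊕ (⊝ (b2 ⊗ c1))))) ⊗ ((b1 ⊗ X2) ⊕ (⊝ (b2 ⊗ X1))))))) refl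
    cancel : ∀ p q r → (p * q) * r - (p * r) * q ≡ 0#
    cancel = solve 3 (λ p q r → (((p ⊗ q) ⊗ r) ⊕ (⊝ ((p ⊗ r) ⊗ q))) ⊜ 𝟎) refl

  dot : Q3 → Q3 → Carrier
  dot (l1 , l2 , l3) (x , y , z) = l1 * x + l2 * y + l3 * z

  dot-•₃ : ∀ c l p → dot (c •3 l) p ≡ c * dot l p
  dot-•₃ c (l1 , l2 , l3) (x , y , z) = identity c l1 l2 l3 x y z
    where
    identity : ∀ c l1 l2 l3 x y z → (c * l1) * x + (c * l2) * y + (c * l3) * z ≡ c * (l1 * x + l2 * y + l3 * z)
    identity = solve 7 (λ c l1 l2 l3 x y z → ((((c ⊗ l1) ⊗ x) ⊕ ((c ⊗ l2) ⊗ y)) ⊕ ((c ⊗ l3) ⊗ z)) ⊜ (c ⊗ (((l1 ⊗ x) ⊕ (l2 ⊗ y)) ⊕ (l3 ⊗ z)))) refl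

  -- The transpose of embed on line coordinates: m · embed p = dualEmbed m · p, see dualEmbed-adjoint.
  dualEmbed : Carrier → Carrier → Carrier → Carrier → Q3 → Q3
  dualEmbed a b c d (m1 , m2 , m3) =
      (m1 * (a * d + b * c) + m2 * ((1# + 1#) * (a * b)) + m3 * ((1# + 1#) * (c * d))
    , m1 * (a * c) + m2 * (a * a) + m3 * (c * c)
    , m1 * (b * d) + m2 * (b * b) + m3 * (d * d))

  dualEmbed-adjoint : ∀ m1 m2 m3 a b c d x y z →
    m1 * ((a * d + b * c) * x + (a * c) * y + (b * d) * z) + m2 * (((1# + 1#) * (a * b)) * x + (a * a) * y + (b * b) * z) + m3 * (((1# + 1#) * (c * d)) * x + (c * c) * y + (d * d) * z)
      ≡ dot (dualEmbed a b c d (m1 , m2 , m3)) (x , y , z)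
  dualEmbed-adjoint = solve 10 (λ m1 m2 m3 a b c d x y z → (((m1 ⊗ (((((a ⊗ d) ⊕ (b ⊗ c)) ⊗ x) ⊕ ((a ⊗ c) ⊗ y)) ⊕ ((b ⊗ d) ⊗ z))) ⊕ (m2 ⊗ ((((𝟐 ⊗ (a ⊗ b)) ⊗ x) ⊕ ((a ⊗ a) ⊗ y)) ⊕ ((b ⊗ b) ⊗ z)))) ⊕ (m3 ⊗ ((((𝟐 ⊗ (c ⊗ d)) ⊗ x) ⊕ ((c ⊗ c) ⊗ y)) ⊕ ((d ⊗ d) ⊗ z)))) ⊜ ((((((m1 ⊗ ((a ⊗ d) ⊕ (b ⊗ c))) ⊕ (m2 ⊗ (𝟐 ⊗ (a ⊗ b)))) ⊕ (m3 ⊗ (𝟐 ⊗ (c ⊗ d)))) ⊗ x) ⊕ ((((m1 ⊗ (a ⊗ c)) ⊕ (m2 ⊗ (a ⊗ a))) ⊕ (m3 ⊗ (c ⊗ c))) ⊗ y)) ⊕ ((((m1 ⊗ (b ⊗ d)) ⊕ (m2 ⊗ (b ⊗ b))) ⊕ (m3 ⊗ (d ⊗ d))) ⊗ z))) refl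

  evQ-dualEmbed : ∀ a b c d m v → evQ m (act (mat a b c d) v) ≡ evQ (dualEmbed a b c d m) v
  evQ-dualEmbed a b c d (m1 , m2 , m3) (s , t) = identity m1 m2 m3 a b c d s t
    where
    identity : ∀ m1 m2 m3 a b c d s t →
      m1 * ((a * s + b * t) * (c * s + d * t)) + m2 * ((a * s + b * t) * (a * s + b * t)) + m3 * ((c * s + d * t) * (c * s + d * t))
        ≡ (m1 * (a * d + b * c) + m2 * ((1# + 1#) * (a * b)) + m3 * ((1# + 1#) * (c * d))) * (s * t) + (m1 * (a * c) + m2 * (a * a) + m3 * (c * c)) * (s * s) + (m1 * (b * d) + m2 * (b * b) + m3 * (d * d)) * (t * t)
    identity = solve 9 (λ m1 m2 m3 a b c d s t → (((m1 ⊗ (((a ⊗ s) ⊕ (b ⊗ t)) ⊗ ((c ⊗ s) ⊕ (d ⊗ t)))) ⊕ (m2 ⊗ (((a ⊗ s) ⊕ (b ⊗ t)) ⊗ ((a ⊗ s) ⊕ (b ⊗ t))))) ⊕ (m3 ⊗ (((c ⊗ s) ⊕ (d ⊗ t)) ⊗ ((c ⊗ s) ⊕ (d ⊗ t))))) ⊜ ((((((m1 ⊗ ((a ⊗ d) ⊕ (b ⊗ c))) ⊕ (m2 ⊗ (𝟐 ⊗ (a ⊗ b)))) ⊕ (m3 ⊗ (𝟐 ⊗ (c ⊗ d)))) ⊗ (s ⊗ t)) ⊕ ((((m1 ⊗ (a ⊗ c)) ⊕ (m2 ⊗ (a ⊗ a))) ⊕ (m3 ⊗ (c ⊗ c)))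 ⊗ (s ⊗ s))) ⊕ ((((m1 ⊗ (b ⊗ d)) ⊕ (m2 ⊗ (b ⊗ b))) ⊕ (m3 ⊗ (d ⊗ d))) ⊗ (t ⊗ t)))) refl

  -- The three points ⟨l, p⟩ = 0 used below are the rows of the cross-product matrix of l.
  sameZeros⇒proportional : ∀ (l w : Q3) → ¬ IsZero₃ l → (∀ p → dot l p ≡ 0# → dot w p ≡ 0#) → (∀ p → dot w p ≡ 0# → dot l p ≡ 0#) →
                           Σ Carrier (λ c → c ≢0 × w ≡ c •3 l)
  sameZeros⇒proportional (l1 , l2 , l3) (w1 , w2 , w3) nl l⇒w w⇒l = c , c≢0 , w≡c•l
    where
    on-l₁ : ∀ l1 l2 l3 → l1 * 0# + l2 * l3 + l3 * (- l2) ≡ 0#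
    on-l₁ = solve 3 (λ l1 l2 l3 → (((l1 ⊗ 𝟎) ⊕ (l2 ⊗ l3)) ⊕ (l3 ⊗ (⊝ l2))) ⊜ 𝟎) refl
    on-l₂ : ∀ l1 l2 l3 → l1 * (- l3) + l2 * 0# + l3 * l1 ≡ 0#
    on-l₂ = solve 3 (λ l1 l2 l3 → (((l1 ⊗ (⊝ l3)) ⊕ (l2 ⊗ 𝟎)) ⊕ (l3 ⊗ l1)) ⊜ 𝟎) refl
    on-l₃ : ∀ l1 l2 l3 → l1 * l2 + l2 * (- l1) + l3 * 0# ≡ 0#
    on-l₃ = solve 3 (λ l1 l2 l3 → (((l1 ⊗ l2) ⊕ (l2 ⊗ (⊝ l1))) ⊕ (l3 ⊗ 𝟎)) ⊜ 𝟎) refl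
    cross₁ : ∀ w1 w2 w3 l2 l3 → w1 * 0# + w2 * l3 + w3 * (- l2) ≡ w2 * l3 - w3 * l2
    cross₁ = solve 5 (λ w1 w2 w3 l2 l3 → (((w1 ⊗ 𝟎) ⊕ (w2 ⊗ l3)) ⊕ (w3 ⊗ (⊝ l2))) ⊜ ((w2 ⊗ l3) ⊕ (⊝ (w3 ⊗ l2)))) refl
    cross₂ : ∀ w1 w2 w3 l1 l3 → w1 * (- l3) + w2 * 0# + w3 * l1 ≡ w3 * l1 - w1 * l3
    cross₂ = solve 5 (λ w1 w2 w3 l1 l3 → (((w1 ⊗ (⊝ l3)) ⊕ (w2 ⊗ 𝟎)) ⊕ (w3 ⊗ l1)) ⊜ ((w3 ⊗ l1) ⊕ (⊝ (w1 ⊗ l3)))) refl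
    cross₃ : ∀ w1 w2 w3 l1 l2 → w1 * l2 + w2 * (- l1) + w3 * 0# ≡ w1 * l2 - w2 * l1
    cross₃ = solve 5 (λ w1 w2 w3 l1 l2 → (((w1 ⊗ l2) ⊕ (w2 ⊗ (⊝ l1))) ⊕ (w3 ⊗ 𝟎)) ⊜ ((w1 ⊗ l2) ⊕ (⊝ (w2 ⊗ l1)))) refl
    w×l≡0 : IsZero₃ (cross (w1 , w2 , w3) (l1 , l2 , l3))
    w×l≡0 = trans (sym (cross₁ w1 w2 w3 l2 l3)) (l⇒w (0# , l3 , - l2) (on-l₁ l1 l2 l3))
          , trans (sym (cross₂ w1 w2 w3 l1 l3)) (l⇒w (- l3 , 0# , l1) (on-l₂ l1 l2 l3))
          , trans (sym (cross₃ w1 w2 w3 l1 l2)) (l⇒w (l2 , - l1 , 0#) (on-l₃ l1 l2 l3))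
    c = proj₁ (cross≡0⇒multiple (w1 , w2 , w3) (l1 , l2 , l3) w×l≡0 nl)
    w≡c•l = proj₂ (cross≡0⇒multiple (w1 , w2 , w3) (l1 , l2 , l3) w×l≡0 nl)
    at-e : ∀ l1 l2 l3 → (l1 * 1# + l2 * 0# + l3 * 0# ≡ l1) × (l1 * 0# + l2 * 1# + l3 * 0# ≡ l2) × (l1 * 0# + l2 * 0# + l3 * 1# ≡ l3)
    at-e l1 l2 l3 = solve 3 (λ l1 l2 l3 → (((l1 ⊗ 𝟏) ⊕ (l2 ⊗ 𝟎)) ⊕ (l3 ⊗ 𝟎)) ⊜ l1) refl l1 l2 l3
                  , solve 3 (λ l1 l2 l3 → (((l1 ⊗ 𝟎) ⊕ (l2 ⊗ 𝟏)) ⊕ (l3 ⊗ 𝟎)) ⊜ l2) refl l1 l2 l3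
                  , solve 3 (λ l1 l2 l3 → (((l1 ⊗ 𝟎) ⊕ (l2 ⊗ 𝟎)) ⊕ (l3 ⊗ 𝟏)) ⊜ l3) refl l1 l2 l3
    c≢0 : c ≢0
    c≢0 c≡0 = nl ( trans (sym (proj₁ (at-e l1 l2 l3))) (w⇒l _ (w≡0 _))
                 , trans (sym (proj₁ (proj₂ (at-e l1 l2 l3)))) (w⇒l _ (w≡0 _))
                 , trans (sym (proj₂ (proj₂ (at-e l1 l2 l3)))) (w⇒l _ (w≡0 _)) )
      where
      w≡0 : ∀ p → dot (w1 , w2 , w3) p ≡ 0#
      w≡0 p = trans (cong (λ W → dot W p) w≡c•l) (trans (dot-•₃ c (l1 , l2 , l3) p) (trans (cong (_* dot (l1 , l2 , l3) p) c≡0) (zeroˡ _)))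
module FiniteField (𝔽 : Field) (n : ℕ) (card : Fin n ↔ Field.Carrier 𝔽) where
  private
    C : Set
    C = Field.Carrier 𝔽

  enum : Fin n → C
  enum = Inverse.to card

  index : C → Fin n
  index = Inverse.from card

  enum-index : ∀ x → enum (index x) ≡ x
  enum-index = Inverse.strictlyInverseˡ card

  index-enum : ∀ i → index (enum i) ≡ i
  index-enum = Inverse.strictlyInverseʳ card

  enum-injective : ∀ i j → enum i ≡ enum j → i ≡ j
  enum-injective i j e = trans (sym (index-enum i)) (trans (cong index e) (index-enum j))

  _≟_ : Decidable {A = C} _≡_
  x ≟ y with index x FinP.≟ index y
  ... | yes e = yes (trans (sym (enum-index x)) (trans (cong enum e) (enum-index y)))
  ... | no ne = no λ e → ne (cong index e)

  open FieldProperties 𝔽 _≟_ public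
  open ProjectiveLine 𝔽 _≟_ public

  card≡suc : Σ ℕ (λ m → n ≡ suc m)
  card≡suc = inhabited (index 0#)
    where
    inhabited : ∀ {m} → Fin m → Σ ℕ (λ k → m ≡ suc k)
    inhabited {suc k} _ = k , refl

  private
    commutativeRing : CommutativeRing _ _
    commutativeRing = record { isCommutativeRing = isCommutativeRing }
    module Π = Algebra.Properties.CommutativeMonoid.Sum (CommutativeRing.*-commutativeMonoid commutativeRing)

    ∏-≢0 : ∀ {m} (t : Fin m → C) → (∀ i → t i ≢0) → Π.sum t ≢0
    ∏-≢0 {zero} t h = 1≢0
    ∏-≢0 {suc m} t h = *-≢0 (h zero) (∏-≢0 (λ i → t (suc i)) (λ i → h (suc i)))

    ∏-const : ∀ m y → Π.sum {m} (λ _ → y) ≡ y ^ m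
    ∏-const zero y = refl
    ∏-const (suc m) y = cong (y *_) (∏-const m y)

    ifZero : C → C → C → C
    ifZero x z w with x ≟ 0#
    ... | yes _ = z
    ... | no _ = w

    ifZero-yes : ∀ {x} z w → x ≡ 0# → ifZero x z w ≡ z
    ifZero-yes {x} z w e with x ≟ 0#
    ... | yes _ = refl
    ... | no p = ⊥-elim (p e)

    ifZero-no : ∀ {x} z w → x ≢0 → ifZero x z w ≡ w
    ifZero-no {x} z w ne with x ≟ 0#
    ... | yes p = ⊥-elim (ne p)
    ... | no _ = refl

    unit : C → C
    unit x = ifZero x 1# x

    unit-≢0 : ∀ x → unit x ≢0
    unit-≢0 x with x ≟ 0#
    ... | yes _ = 1≢0
    ... | no p = p

  -- Fermat: multiplication by y permutes the field, and multiplies the product of the units by y^(n−1).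
  module _ (y : C) (y≢0 : y ≢0) where
    private
      factor : C → C
      factor x = ifZero x 1# y

      unit-scale : ∀ x → unit (y * x) ≡ factor x * unit x
      unit-scale x with x ≟ 0#
      ... | yes x≡0 = trans (ifZero-yes 1# _ (trans (cong (y *_) x≡0) (zeroʳ y))) (sym (*-identityˡ 1#))
      ... | no x≢0 = ifZero-no 1# _ (*-≢0 y≢0 x≢0)

      scale : Perm.Permutation n n
      scale = Perm.permutation (λ i → index (y * enum i)) (λ i → index (y ⁻¹ * enum i))
        (λ i → trans (cong (λ z → index (y * z)) (enum-index _))
                 (trans (cong index (trans (sym (*-assoc _ _ _)) (trans (cong (_* enum i) (inverse y y≢0)) (*-identityˡ _)))) (index-enum i)))
        (λ i → trans (cong (λ z → index (y ⁻¹ * z)) (enum-index _)) (trans (cong index (⁻¹-*-cancel y≢0 (enum i))) (index-enum i)))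

      units factors : Fin n → C
      units i = unit (enum i)
      factors i = factor (enum i)

      ∏units≡∏factors*∏units : Π.sum units ≡ Π.sum factors * Π.sum units
      ∏units≡∏factors*∏units = trans (Π.sum-permute units scale)
        (trans (Π.sum-cong-≗ (λ i → trans (cong unit (enum-index _)) (unit-scale (enum i)))) (Π.∑-distrib-+ factors units))

      ∏factors : ∀ m → n ≡ suc m → Π.sum factors ≡ y ^ m
      ∏factors m refl = trans (Π.sum-remove {i = index 0#} factors)
        (trans (cong₂ _*_ (ifZero-yes 1# y (enum-index 0#)) (Π.sum-cong-≗ {y = λ _ → y} (λ j → ifZero-no 1# y (λ e →
                  FinP.punchInᵢ≢i (index 0#) j (trans (sym (index-enum _)) (cong index e))))))
          (trans (*-identityˡ _) (∏-const m y)))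

    ^pred≡1 : ∀ m → n ≡ suc m → y ^ m ≡ 1#
    ^pred≡1 m e = sym (*-cancelˡ (∏-≢0 units (λ i → unit-≢0 (enum i)))
      (trans (*-identityʳ _) (trans ∏units≡∏factors*∏units (trans (cong (_* Π.sum units) (∏factors m e)) (*-comm _ _)))))

  ^card≡id : ∀ x → x ^ n ≡ x
  ^card≡id x with card≡suc | x ≟ 0#
  ... | m , refl | yes refl = 0^suc≡0 m
  ... | m , refl | no x≢0 = trans (cong (x *_) (^pred≡1 x x≢0 m refl)) (*-identityʳ x)

  -- (x + 1)ⁿ − xⁿ − 1 has degree below n and vanishes on all n elements, so it is the zero polynomial.
  binomialTail-card : ∀ {m} (e : n ≡ suc m) i → lookup (subst (Vec C) e (binomialTail n)) i ≡ lookup (monomial {suc m} zero) i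
  binomialTail-card {m} refl i = x-y≡0⇒x≡y (trans (sym (VecP.lookup-zipWith _-_ i (binomialTail n) (monomial zero)))
                                  (manyRoots⇒zero difference enum (enum-injective) roots i))
    where
    difference = zipWith _-_ (binomialTail n) (monomial {n} zero)
    roots : ∀ i → horner difference (enum i) ≡ 0#
    roots i = trans (horner-zipWith- (binomialTail n) (monomial zero) x)
                (trans (cong₂ _-_ tail≡1 (horner-monomial {n} zero x)) (-‿inverseʳ 1#))
      where
      x = enum i
      tail≡1 : horner (binomialTail n) x ≡ 1#
      tail≡1 = +-cancel-middle (trans (horner-binomialTail n x) (trans (^card≡id (x + 1#)) (cong (_+ 1#) (sym (^card≡id x)))))
module Conic (S : Setup) where
  open Setup S
  module FF = FiniteField 𝔽 q cardF
  module KK = FiniteField 𝕂 (q ℕ.* q) cardK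
  open KK

  FC KC : Set
  FC = FF.Carrier
  KC = KK.Carrier

  ι0 : ι FF.0# ≡ 0#
  ι0 = trans (sym (x+x-x≡x (ι FF.0#))) (trans (cong (_- ι FF.0#) (trans (sym (ι-+ FF.0# FF.0#)) (cong ι (FF.+-identityʳ FF.0#))))
         (-‿inverseʳ _))
    where
    x+x-x≡x : ∀ x → (x + x) - x ≡ x
    x+x-x≡x = solve 1 (λ x → ((x ⊕ x) ⊕ (⊝ x)) ⊜ x) refl

  ι-neg : ∀ x → ι (FF.- x) ≡ - ι x
  ι-neg x = sym (trans (sym (+-identityˡ _)) (trans (cong (_+ - ι x) (sym sum≡0)) (a+b-a≡b (ι x) (ι (FF.- x)))))
    where
    sum≡0 : ι x + ι (FF.- x) ≡ 0#
    sum≡0 = trans (sym (ι-+ x (FF.- x))) (trans (cong ι (FF.-‿inverseʳ x)) ι0)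
    a+b-a≡b : ∀ a b → (a + b) + (- a) ≡ b
    a+b-a≡b = solve 2 (λ a b → ((a ⊕ b) ⊕ (⊝ a)) ⊜ b) refl

  ι-sub : ∀ x y → ι (x FF.- y) ≡ ι x - ι y
  ι-sub x y = trans (ι-+ x (FF.- y)) (cong (ι x +_) (ι-neg y))

  ι-det : ∀ a b c d → ι (a FF.* d FF.- b FF.* c) ≡ ι a * ι d - ι b * ι c
  ι-det a b c d = trans (ι-sub _ _) (cong₂ _-_ (ι-* a d) (ι-* b c))

  ι≢0 : ∀ {x} → FF._≢0 x → ι x ≢0
  ι≢0 {x} nx e = 0≢1 (trans (sym (trans (cong (_* ι (x FF.⁻¹)) e) (zeroˡ _)))
                   (trans (sym (ι-* x (x FF.⁻¹))) (trans (cong ι (FF.inverse x nx)) ι-1)))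

  ι-injective : ∀ {x y} → ι x ≡ ι y → x ≡ y
  ι-injective {x} {y} e with (x FF.- y) FF.≟ FF.0#
  ... | yes p = FF.x-y≡0⇒x≡y p
  ... | no p = ⊥-elim (ι≢0 p (trans (ι-sub x y) (x≡y⇒x-y≡0 e)))


  ι-⁻¹ : ∀ {x} → FF._≢0 x → ι (x FF.⁻¹) ≡ (ι x) ⁻¹
  ι-⁻¹ {x} nx = ⁻¹-unique (ι≢0 nx) (trans (sym (ι-* x (x FF.⁻¹))) (trans (cong ι (FF.inverse x nx)) ι-1))

  ι-^ : ∀ x n → ι (x FF.^ n) ≡ ι x ^ n
  ι-^ x zero = ι-1
  ι-^ x (suc n) = trans (ι-* x (x FF.^ n)) (cong (ι x *_) (ι-^ x n))

  InFqK? : ∀ x → Dec (InFqK S x)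
  InFqK? x with FinP.any? (λ i → ι (FF.enum i) ≟ x)
  ... | yes (i , e) = yes (FF.enum i , e)
  ... | no ne = no λ { (y , e) → ne (FF.index y , trans (cong ι (FF.enum-index y)) e) }

  q≥2 : Σ ℕ (λ m → q ≡ suc (suc m))
  q≥2 = twoElements (FF.index FF.0#) (FF.index FF.1#) (λ e → FF.0≢1 (trans (sym (FF.enum-index _)) (trans (cong FF.enum e) (FF.enum-index _))))
    where
    twoElements : ∀ {m} → (i j : Fin m) → ¬ i ≡ j → Σ ℕ (λ k → m ≡ suc (suc k))
    twoElements {suc zero} zero zero ne = ⊥-elim (ne refl)
    twoElements {suc (suc k)} _ _ _ = k , refl

  -- The Frobenius of 𝕂 over 𝔽

  σ : KC → KC
  σ x = x ^ q

  σ-* : ∀ x y → σ (x * y) ≡ σ x * σ y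
  σ-* x y = ^-distrib-* x y q

  σ-1 : σ 1# ≡ 1#
  σ-1 = 1^n≡1 q

  σ-0 : σ 0# ≡ 0#
  σ-0 = trans (cong (0# ^_) (proj₂ FF.card≡suc)) (0^suc≡0 (proj₁ FF.card≡suc))

  σ-ι : ∀ y → σ (ι y) ≡ ι y
  σ-ι y = trans (sym (ι-^ y q)) (cong ι (FF.^card≡id y))

  σ-involutive : ∀ x → σ (σ x) ≡ x
  σ-involutive x = trans (sym (^-*-assoc x q q)) (KK.^card≡id x)

  σ-injective : ∀ {x y} → σ x ≡ σ y → x ≡ y
  σ-injective {x} {y} e = trans (sym (σ-involutive x)) (trans (cong σ e) (σ-involutive y))

  σ≢0 : ∀ {x} → x ≢0 → σ x ≢0
  σ≢0 = ^-≢0 q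

  σ-⁻¹ : ∀ {x} → x ≢0 → σ (x ⁻¹) ≡ (σ x) ⁻¹
  σ-⁻¹ = ⁻¹-^ q

  -- The coefficients of (z + 1)^q − z^q lie in 𝔽, where they are those of the constant 1.
  σ-+1 : ∀ z → σ (z + 1#) ≡ σ z + 1#
  σ-+1 z = trans (sym (horner-binomialTail q z)) (trans (cong (_+ σ z) tail≡1) (+-comm _ _))
    where
    m = proj₁ FF.card≡suc
    q≡1+m = proj₂ FF.card≡suc
    +-comm : ∀ x y → x + y ≡ y + x
    +-comm = solve 2 (λ x y → (x ⊕ y) ⊜ (y ⊕ x)) refl
    map-ι-shiftAdd : ∀ {n} p (v : Vec FC n) → map ι (FF.shiftAdd p v) ≡ shiftAdd (ι p) (map ι v)
    map-ι-shiftAdd p [] = cong (_∷ []) (trans (ι-+ FF.1# p) (cong (_+ ι p) ι-1))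
    map-ι-shiftAdd p (v ∷ vs) = cong₂ _∷_ (ι-+ v p) (map-ι-shiftAdd v vs)
    map-ι-binomialTail : ∀ n → map ι (FF.binomialTail n) ≡ binomialTail n
    map-ι-binomialTail zero = refl
    map-ι-binomialTail (suc n) = trans (map-ι-shiftAdd FF.0# (FF.binomialTail n)) (cong₂ shiftAdd ι0 (map-ι-binomialTail n))
    subst-map : ∀ {a b} (e : a ≡ b) (v : Vec FC a) → subst (Vec KC) e (map ι v) ≡ map ι (subst (Vec FC) e v)
    subst-map refl v = refl
    horner-subst : ∀ {a b} (e : a ≡ b) (v : Vec KC a) → horner (subst (Vec KC) e v) z ≡ horner v z
    horner-subst refl v = refl
    ι-monomial : ∀ i → ι (lookup (FF.monomial {suc m} zero) i) ≡ lookup (monomial {suc m} zero) i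
    ι-monomial zero = ι-1
    ι-monomial (suc i) = trans (cong ι (VecP.lookup-replicate i FF.0#)) (trans ι0 (sym (VecP.lookup-replicate i 0#)))
    coefficients : ∀ i → lookup (subst (Vec KC) q≡1+m (binomialTail q)) i ≡ lookup (monomial {suc m} zero) i
    coefficients i = trans (cong (λ v → lookup (subst (Vec KC) q≡1+m v) i) (sym (map-ι-binomialTail q)))
      (trans (cong (λ v → lookup v i) (subst-map q≡1+m (FF.binomialTail q)))
        (trans (VecP.lookup-map i ι (subst (Vec FC) q≡1+m (FF.binomialTail q))) (trans (cong ι (FF.binomialTail-card q≡1+m i)) (ι-monomial i))))
    tail≡1 : horner (binomialTail q) z ≡ 1#
    tail≡1 = trans (sym (horner-subst q≡1+m (binomialTail q)))
      (trans (horner-cong (subst (Vec KC) q≡1+m (binomialTail q)) (monomial {suc m} zero) z coefficients) (horner-monomial {suc m} zero z))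

  σ-+ : ∀ x y → σ (x + y) ≡ σ x + σ y
  σ-+ x y with y ≟ 0#
  ... | yes refl = trans (cong σ (+-identityʳ x)) (sym (trans (cong (σ x +_) σ-0) (+-identityʳ _)))
  ... | no y≢0 = begin
      σ (x + y)                ≡⟨ cong σ (factor-out x y y≢0) ⟩
      σ (y * (x * y ⁻¹ + 1#))  ≡⟨ σ-* y _ ⟩
      σ y * σ (x * y ⁻¹ + 1#)  ≡⟨ cong (σ y *_) (σ-+1 (x * y ⁻¹)) ⟩
      σ y * (σ (x * y ⁻¹) + 1#) ≡⟨ cong (σ y *_) (cong (_+ 1#) (σ-* x (y ⁻¹))) ⟩
      σ y * (σ x * σ (y ⁻¹) + 1#) ≡⟨ cong (λ w → σ y * (σ x * w + 1#)) (σ-⁻¹ y≢0) ⟩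
      σ y * (σ x * (σ y) ⁻¹ + 1#) ≡⟨ sym (factor-out (σ x) (σ y) (σ≢0 y≢0)) ⟩
      σ x + σ y ∎
    where
    open ≡-Reasoning
    factor-out : ∀ a b → b ≢0 → a + b ≡ b * (a * b ⁻¹ + 1#)
    factor-out a b b≢0 = trans (cong (_+ b) (sym (trans (cong (a *_) (inverseˡ b≢0)) (*-identityʳ a))))
                           (expand a b (b ⁻¹))
      where
      expand : ∀ a b c → a * (c * b) + b ≡ b * (a * c + 1#)
      expand = solve 3 (λ a b c → ((a ⊗ (c ⊗ b)) ⊕ b) ⊜ (b ⊗ ((a ⊗ c) ⊕ 𝟏))) refl

  σ-neg : ∀ x → σ (- x) ≡ - σ x
  σ-neg x = +-cancel-middle {b = σ x} (trans (+-comm _ _) (trans (sym (σ-+ x (- x)))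
              (trans (cong σ (-‿inverseʳ x)) (trans σ-0 (sym (-‿inverseʳ (σ x)))))))
    where
    +-comm : ∀ x y → x + y ≡ y + x
    +-comm = solve 2 (λ x y → (x ⊕ y) ⊜ (y ⊕ x)) refl

  σ-sub : ∀ x y → σ (x - y) ≡ σ x - σ y
  σ-sub x y = trans (σ-+ x (- y)) (cong (σ x +_) (σ-neg y))

  -- Otherwise z^q − z would have q + 1 roots: x and the q elements of 𝔽.
  σ-fixed⇒InFqK : ∀ x → σ x ≡ x → InFqK S x
  σ-fixed⇒InFqK x σx≡x with InFqK? x
  ... | yes x∈𝔽 = x∈𝔽
  ... | no x∉𝔽 = ⊥-elim (1≢0 (trans (sym leading) (manyRoots⇒zero c points points-injective roots (fromℕ N))))
    where
    m = proj₁ q≥2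
    N = suc (suc m)
    q≡N = proj₂ q≥2
    fieldPoint : Fin N → FC
    fieldPoint i = FF.enum (subst Fin (sym q≡N) i)
    points : Fin (suc N) → KC
    points zero = x
    points (suc i) = ι (fieldPoint i)
    points-injective : ∀ i j → points i ≡ points j → i ≡ j
    points-injective zero zero _ = refl
    points-injective zero (suc j) e = ⊥-elim (x∉𝔽 (_ , sym e))
    points-injective (suc i) zero e = ⊥-elim (x∉𝔽 (_ , e))
    points-injective (suc i) (suc j) e = cong suc (subst-injective (sym q≡N) (FF.enum-injective _ _ (ι-injective e)))
    c : Vec KC (suc N)
    c = zipWith _-_ (monomial (fromℕ N)) (monomial (suc zero))
    horner-c : ∀ z → horner c z ≡ σ z - z * 1#
    horner-c z = trans (horner-zipWith- (monomial (fromℕ N)) (monomial (suc zero)) z)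
      (cong₂ _-_ (trans (horner-monomial (fromℕ N) z) (trans (cong (z ^_) (FinP.toℕ-fromℕ N)) (cong (z ^_) (sym q≡N))))
                 (horner-monomial {suc N} (suc zero) z))
    fixed⇒root : ∀ {z} → σ z ≡ z → horner c z ≡ 0#
    fixed⇒root {z} e = trans (horner-c z) (trans (cong₂ _-_ e (*-identityʳ z)) (-‿inverseʳ z))
    roots : ∀ i → horner c (points i) ≡ 0#
    roots zero = fixed⇒root σx≡x
    roots (suc i) = fixed⇒root (σ-ι (fieldPoint i))
    leading : lookup c (fromℕ N) ≡ 1#
    leading = trans (VecP.lookup-zipWith _-_ (fromℕ N) (monomial (fromℕ N)) (monomial (suc zero)))
      (trans (cong₂ _-_ (lookup-monomial (fromℕ N)) (lookup-monomial-≢ (suc zero) (fromℕ N) (λ ()))) (x-0≡x 1#))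

  -- Points of the conic in homogeneous coordinates

  PP : Set
  PP = P1 S

  homog : PP → V2
  homog = hom S

  br≡wedge : ∀ α γ → br S α γ ≡ wedge (homog α) (homog γ)
  br≡wedge nothing nothing = refl
  br≡wedge nothing (just x) = refl
  br≡wedge (just x) nothing = refl
  br≡wedge (just x) (just y) = refl

  Nonzero-homog : ∀ α → Nonzero (homog α)
  Nonzero-homog nothing (p , _) = 1≢0 p
  Nonzero-homog (just x) (_ , p) = 1≢0 p

  homog-injective : ∀ {α β} → homog α ~ homog β → α ≡ β
  homog-injective {nothing} {nothing} e = refl
  homog-injective {nothing} {just b} e = ⊥-elim (1≢0 (trans (sym (∞-finite b)) e))
    where
    ∞-finite : ∀ b → 1# * 1# - 0# * b ≡ 1#
    ∞-finite = solve 1 (λ b → ((𝟏 ⊗ 𝟏) ⊕ (⊝ (𝟎 ⊗ b))) ⊜ 𝟏) refl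
  homog-injective {just a} {nothing} e = ⊥-elim (-‿≢0 1≢0 (trans (sym (finite-∞ a)) e))
    where
    finite-∞ : ∀ a → a * 0# - 1# * 1# ≡ - 1#
    finite-∞ = solve 1 (λ a → ((a ⊗ 𝟎) ⊕ (⊝ (𝟏 ⊗ 𝟏))) ⊜ (⊝ 𝟏)) refl
  homog-injective {just a} {just b} e = cong just (x-y≡0⇒x≡y (trans (sym (finite-finite a b)) e))
    where
    finite-finite : ∀ a b → a * 1# - 1# * b ≡ a - b
    finite-finite = solve 2 (λ a b → ((a ⊗ 𝟏) ⊕ (⊝ (𝟏 ⊗ b))) ⊜ (a ⊕ (⊝ b))) refl

  ≢⇒wedge≢0 : ∀ {α β} → ¬ α ≡ β → wedge (homog α) (homog β) ≢0
  ≢⇒wedge≢0 ne e = ne (homog-injective e)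

  wedge-product≡0 : ∀ {a b c d} → wedge (homog a) (homog b) * wedge (homog c) (homog d) ≡ 0# → a ≡ b ⊎ c ≡ d
  wedge-product≡0 e = Sum.map homog-injective homog-injective (xy≡0⇒x≡0⊎y≡0 e)

  private
    toP1-dec : ∀ s t → Dec (t ≡ 0#) → PP
    toP1-dec s t (yes _) = nothing
    toP1-dec s t (no _) = just (s * t ⁻¹)

  toP1 : V2 → PP
  toP1 (s , t) = toP1-dec s t (t ≟ 0#)

  homog-toP1 : ∀ v → Nonzero v → homog (toP1 v) ~ v
  homog-toP1 (s , t) nv = go (t ≟ 0#)
    where
    at-∞ : ∀ s t → 1# * t - 0# * s ≡ t
    at-∞ = solve 2 (λ s t → ((𝟏 ⊗ t) ⊕ (⊝ (𝟎 ⊗ s))) ⊜ t) refl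
    at-finite : ∀ s t⁻¹ t → (s * t⁻¹) * t - 1# * s ≡ s * (t⁻¹ * t) - s
    at-finite = solve 3 (λ s ti t → (((s ⊗ ti) ⊗ t) ⊕ (⊝ (𝟏 ⊗ s))) ⊜ ((s ⊗ (ti ⊗ t)) ⊕ (⊝ s))) refl
    go : (d : Dec (t ≡ 0#)) → homog (toP1-dec s t d) ~ (s , t)
    go (yes t≡0) = trans (at-∞ s t) t≡0
    go (no t≢0) = trans (at-finite s (t ⁻¹) t)
      (trans (cong (λ W → s * W - s) (inverseˡ t≢0)) (trans (cong (_- s) (*-identityʳ s)) (-‿inverseʳ s)))

  toP1-~ : ∀ {u v} → Nonzero u → Nonzero v → u ~ v → toP1 u ≡ toP1 v
  toP1-~ {u} {v} nu nv e = homog-injective (~trans (~trans (homog-toP1 u nu) e nu) (~sym (homog-toP1 v nv)) nv)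

  toP1-homog : ∀ α → toP1 (homog α) ≡ α
  toP1-homog α = homog-injective (homog-toP1 (homog α) (Nonzero-homog α))

  homog-toP1-scale : ∀ v → Nonzero v → Σ KC (λ k → k ≢0 × homog (toP1 v) ≡ k • v)
  homog-toP1-scale v nv with ~⇒multiple (~sym (homog-toP1 v nv)) nv
  ... | k , e = k , Nonzero-•⇒≢0 (subst Nonzero e (Nonzero-homog (toP1 v))) , e

  -- Lines of PG(2,q) as binary quadratic forms

  ιQ : FF.Q3 → Q3
  ιQ (x , y , z) = (ι x , ι y , ι z)

  ιLine : Line S → Q3
  ιLine ℓ = ιQ (proj₁ ℓ)

  line-nonzero : ∀ (ℓ : Line S) → ¬ FF.IsZero₃ (proj₁ ℓ)
  line-nonzero ((l1 , l2 , l3) , ℓ≢0) (z1 , z2 , z3) = ℓ≢0 (cong₂ _,_ z1 (cong₂ _,_ z2 z3))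

  IsZero₃-ι : ∀ l → IsZero₃ (ιQ l) → FF.IsZero₃ l
  IsZero₃-ι (a , b , c) (z1 , z2 , z3) = ι-injective (trans z1 (sym ι0)) , ι-injective (trans z2 (sym ι0)) , ι-injective (trans z3 (sym ι0))

  ιQ-•3 : ∀ c l → ιQ (c FF.•3 l) ≡ ι c •3 ιQ l
  ιQ-•3 c (x , y , z) = cong₂ _,_ (ι-* c x) (cong₂ _,_ (ι-* c y) (ι-* c z))

  cross-ι : ∀ l w → cross (ιQ l) (ιQ w) ≡ ιQ (FF.cross l w)
  cross-ι (l1 , l2 , l3) (w1 , w2 , w3) = sym (cong₂ _,_ (ι-det l2 l3 w2 w3) (cong₂ _,_ (ι-det l3 l1 w3 w1) (ι-det l1 l2 w1 w2)))

  OnLine⇔evQ≡0 : ∀ ℓ α → OnLine S ℓ α ⇔ (evQ (ιLine ℓ) (homog α) ≡ 0#)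
  OnLine⇔evQ≡0 ((l1 , l2 , l3) , _) (just x) =
    mk⇔ (trans (sym (homogenise (ι l1) (ι l2) (ι l3) x))) (trans (homogenise (ι l1) (ι l2) (ι l3) x))
    where
    homogenise : ∀ a b c x → a * x + b * (x * x) + c ≡ a * (x * 1#) + b * (x * x) + c * (1# * 1#)
    homogenise = solve 4 (λ a b c x → (((a ⊗ x) ⊕ (b ⊗ (x ⊗ x))) ⊕ c) ⊜ (((a ⊗ (x ⊗ 𝟏)) ⊕ (b ⊗ (x ⊗ x))) ⊕ (c ⊗ (𝟏 ⊗ 𝟏)))) refl
  OnLine⇔evQ≡0 ((l1 , l2 , l3) , _) nothing =
    mk⇔ (λ e → trans (at-∞ (ι l1) (ι l2) (ι l3)) (trans (cong ι e) ι0))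
        (λ e → ι-injective (trans (sym (at-∞ (ι l1) (ι l2) (ι l3))) (trans e (sym ι0))))
    where
    at-∞ : ∀ a b c → a * (1# * 0#) + b * (1# * 1#) + c * (0# * 0#) ≡ b
    at-∞ = solve 3 (λ a b c → (((a ⊗ (𝟏 ⊗ 𝟎)) ⊕ (b ⊗ (𝟏 ⊗ 𝟏))) ⊕ (c ⊗ (𝟎 ⊗ 𝟎))) ⊜ b) refl

  OnLine⇒evQ≡0 : ∀ ℓ α → OnLine S ℓ α → evQ (ιLine ℓ) (homog α) ≡ 0#
  OnLine⇒evQ≡0 ℓ α = Equivalence.to (OnLine⇔evQ≡0 ℓ α)

  evQ≡0⇒OnLine : ∀ ℓ α → evQ (ιLine ℓ) (homog α) ≡ 0# → OnLine S ℓ α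
  evQ≡0⇒OnLine ℓ α = Equivalence.from (OnLine⇔evQ≡0 ℓ α)

  OnLine-toP1⇒evQ≡0 : ∀ ℓ v → Nonzero v → OnLine S ℓ (toP1 v) → evQ (ιLine ℓ) v ≡ 0#
  OnLine-toP1⇒evQ≡0 ℓ v nv o = evQ-~ (ιLine ℓ) (homog-toP1 v nv) (Nonzero-homog (toP1 v)) (OnLine⇒evQ≡0 ℓ (toP1 v) o)

  evQ≡0⇒OnLine-toP1 : ∀ ℓ v → Nonzero v → evQ (ιLine ℓ) v ≡ 0# → OnLine S ℓ (toP1 v)
  evQ≡0⇒OnLine-toP1 ℓ v nv e = evQ≡0⇒OnLine ℓ (toP1 v) (evQ-~ (ιLine ℓ) (~sym (homog-toP1 v nv)) nv e)

  Meets-sym : ∀ {ℓ α β} → Meets S ℓ α β → Meets S ℓ β α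
  Meets-sym (ne , oa , ob , all) = (λ e → ne (sym e)) , ob , oa , λ γ o → Sum.swap (all γ o)

  commonPoints⇒proportional : ∀ (ℓ m : Line S) {α β} → Meets S ℓ α β → OnLine S m α → OnLine S m β →
                              Σ FC (λ c → proj₁ m ≡ c FF.•3 proj₁ ℓ)
  commonPoints⇒proportional ℓ m {α} {β} (α≢β , αℓ , βℓ , _) αm βm =
    FF.cross≡0⇒multiple (proj₁ m) (proj₁ ℓ) (IsZero₃-ι _ (subst IsZero₃ (cross-ι (proj₁ m) (proj₁ ℓ)) m×ℓ≡0)) (line-nonzero ℓ)
    where
    m×ℓ≡0 : IsZero₃ (cross (ιLine m) (ιLine ℓ))
    m×ℓ≡0 = commonZeros⇒cross≡0 (ιLine m) (ιLine ℓ) (homog α) (homog β) (OnLine⇒evQ≡0 m α αm) (OnLine⇒evQ≡0 m β βm)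
              (OnLine⇒evQ≡0 ℓ α αℓ) (OnLine⇒evQ≡0 ℓ β βℓ) (≢⇒wedge≢0 α≢β)

  sameMeets⇒SameLine : ∀ (ℓ m : Line S) {α β} → Meets S ℓ α β → Meets S m α β → SameLine S ℓ m
  sameMeets⇒SameLine ℓ m αβℓ (_ , αm , βm , _) = commonPoints⇒proportional ℓ m αβℓ αm βm

  -- The collineation of g ∈ GL(2,q) acting on lines

  matK : GL2 S → Mat
  matK g = mat (ι (GL2.a g)) (ι (GL2.b g)) (ι (GL2.c g)) (ι (GL2.d g))

  matK-det≢0 : ∀ g → det (matK g) ≢0
  matK-det≢0 g = subst _≢0 (ι-det (GL2.a g) (GL2.b g) (GL2.c g) (GL2.d g)) (ι≢0 (GL2.det≢0 g))

  adjGL2 : GL2 S → GL2 S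
  adjGL2 g = record { a = d ; b = FF.- b ; c = FF.- c ; d = a
                    ; det≢0 = λ e → det≢0 (trans (sym (FF.det-adj (FF.mat a b c d))) e) }
    where open GL2 g

  matK-adj : ∀ g → matK (adjGL2 g) ≡ adj (matK g)
  matK-adj g = cong₂ (λ B C → mat (ι (GL2.d g)) B C (ι (GL2.a g))) (ι-neg _) (ι-neg _)

  ι-dualEmbed : ∀ a b c d m → ιQ (FF.dualEmbed a b c d m) ≡ dualEmbed (ι a) (ι b) (ι c) (ι d) (ιQ m)
  ι-dualEmbed a b c d (m1 , m2 , m3) =
    cong₂ _,_ (ι-sum₃ (trans (ι-* _ _) (cong (ι m1 *_) (trans (ι-+ _ _) (cong₂ _+_ (ι-* a d) (ι-* b c)))))
                      (trans (ι-* _ _) (cong (ι m2 *_) (trans (ι-* _ _) (cong₂ _*_ ι2 (ι-* a b)))))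
                      (trans (ι-* _ _) (cong (ι m3 *_) (trans (ι-* _ _) (cong₂ _*_ ι2 (ι-* c d))))))
      (cong₂ _,_ (ι-sum₃ (ι-*² _ _ _) (ι-*² _ _ _) (ι-*² _ _ _)) (ι-sum₃ (ι-*² _ _ _) (ι-*² _ _ _) (ι-*² _ _ _)))
    where
    ι-sum₃ : ∀ {x y z X Y Z} → ι x ≡ X → ι y ≡ Y → ι z ≡ Z → ι (x FF.+ y FF.+ z) ≡ X + Y + Z
    ι-sum₃ {x} {y} refl refl refl = trans (ι-+ _ _) (cong (_+ _) (ι-+ x y))
    ι-*² : ∀ x y z → ι (x FF.* (y FF.* z)) ≡ ι x * (ι y * ι z)
    ι-*² x y z = trans (ι-* _ _) (cong (ι x *_) (ι-* y z))
    ι2 : ι (FF.1# FF.+ FF.1#) ≡ 1# + 1#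
    ι2 = trans (ι-+ _ _) (cong₂ _+_ ι-1 ι-1)

  dualEmbedGL2 : GL2 S → FF.Q3 → FF.Q3
  dualEmbedGL2 g = FF.dualEmbed (GL2.a g) (GL2.b g) (GL2.c g) (GL2.d g)

  embed-∈⇔dot≡0 : ∀ g (ℓ' : Line S) p → (_∈L_ S (embed S g p) ℓ') ⇔ (FF.dot (dualEmbedGL2 g (proj₁ ℓ')) p ≡ FF.0#)
  embed-∈⇔dot≡0 g ((m1 , m2 , m3) , _) (x , y , z) = mk⇔ (trans (sym adjoint)) (trans adjoint)
    where adjoint = FF.dualEmbed-adjoint m1 m2 m3 (GL2.a g) (GL2.b g) (GL2.c g) (GL2.d g) x y z

  DualProportional : GL2 S → Line S → Line S → Set
  DualProportional g ℓ ℓ' = Σ FC (λ c → FF._≢0 c × dualEmbedGL2 g (proj₁ ℓ') ≡ c FF.•3 proj₁ ℓ)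

  MapsLine⇒DualProportional : ∀ g ℓ ℓ' → MapsLine S g ℓ ℓ' → DualProportional g ℓ ℓ'
  MapsLine⇒DualProportional g ℓ ℓ' ml = FF.sameZeros⇒proportional (proj₁ ℓ) (dualEmbedGL2 g (proj₁ ℓ')) (line-nonzero ℓ)
    (λ p e → Equivalence.to (embed-∈⇔dot≡0 g ℓ' p) (Equivalence.to (ml p) e))
    (λ p e → Equivalence.from (ml p) (Equivalence.from (embed-∈⇔dot≡0 g ℓ' p) e))

  DualProportional⇒MapsLine : ∀ g ℓ ℓ' → DualProportional g ℓ ℓ' → MapsLine S g ℓ ℓ'
  DualProportional⇒MapsLine g ℓ ℓ' (c , c≢0 , w≡c•l) p = mk⇔
    (λ e → Equivalence.from (embed-∈⇔dot≡0 g ℓ' p) (trans dot-w (trans (cong (c FF.*_) e) (FF.zeroʳ c))))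
    (λ e → FF.xy≡0⇒y≡0 (trans (sym dot-w) (Equivalence.to (embed-∈⇔dot≡0 g ℓ' p) e)) c≢0)
    where
    dot-w : FF.dot (dualEmbedGL2 g (proj₁ ℓ')) p ≡ c FF.* FF.dot (proj₁ ℓ) p
    dot-w = trans (cong (λ W → FF.dot W p) w≡c•l) (FF.dot-•₃ c (proj₁ ℓ) p)

  FormRelated : Mat → Line S → Line S → Set
  FormRelated M ℓ ℓ' = Σ KC (λ κ → κ ≢0 × (∀ v → evQ (ιLine ℓ') (act M v) ≡ κ * evQ (ιLine ℓ) v))

  DualProportional⇒FormRelated : ∀ g ℓ ℓ' → DualProportional g ℓ ℓ' → FormRelated (matK g) ℓ ℓ'
  DualProportional⇒FormRelated g ℓ ℓ' (c , c≢0 , w≡c•l) = ι c , ι≢0 c≢0 , λ v →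
    trans (evQ-dualEmbed _ _ _ _ (ιLine ℓ') v)
      (trans (cong (λ W → evQ W v) (sym (ι-dualEmbed _ _ _ _ (proj₁ ℓ'))))
        (trans (cong (λ W → evQ (ιQ W) v) w≡c•l)
          (trans (cong (λ W → evQ W v) (ιQ-•3 c (proj₁ ℓ))) (evQ-•3 (ι c) (ιLine ℓ) v))))

  mapP1 : Mat → PP → PP
  mapP1 M α = toP1 (act M (homog α))

  module Transport (M : Mat) (dM : det M ≢0) where
    Nonzero-act-homog : ∀ N → det N ≢0 → ∀ α → Nonzero (act N (homog α))
    Nonzero-act-homog N dN α = Nonzero-act N dN (Nonzero-homog α)

    mapP1-cancel : ∀ N N' → det N ≢0 → det N' ≢0 → ∀ α k → act N (act N' (homog α)) ≡ k • homog α → mapP1 N (mapP1 N' α) ≡ α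
    mapP1-cancel N N' dN dN' α k eq = trans
      (toP1-~ (Nonzero-act-homog N dN (mapP1 N' α)) (Nonzero-homog α)
        (~trans (~act N (homog-toP1 (act N' (homog α)) (Nonzero-act-homog N' dN' α))) (subst (_~ homog α) (sym eq) (•~ _ _))
                (Nonzero-act N dN (Nonzero-act-homog N' dN' α))))
      (toP1-homog α)

    mapP1-adj-inverseʳ : ∀ γ → mapP1 M (mapP1 (adj M) γ) ≡ γ
    mapP1-adj-inverseʳ γ = mapP1-cancel M (adj M) dM (det-adj≢0 M dM) γ (det M) (act-adj M (homog γ))

    mapP1-adj-inverseˡ : ∀ α → mapP1 (adj M) (mapP1 M α) ≡ α
    mapP1-adj-inverseˡ α = mapP1-cancel (adj M) M (det-adj≢0 M dM) dM α (det M) (adj-act M (homog α))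

    mapP1-injective : ∀ {α β} → mapP1 M α ≡ mapP1 M β → α ≡ β
    mapP1-injective {α} {β} e = trans (sym (mapP1-adj-inverseˡ α)) (trans (cong (mapP1 (adj M)) e) (mapP1-adj-inverseˡ β))

    module _ {ℓ ℓ'} (rel : FormRelated M ℓ ℓ') where
      private
        κ = proj₁ rel
        κ≢0 = proj₁ (proj₂ rel)
        relation = proj₂ (proj₂ rel)

      mapP1-OnLine : ∀ {α} → OnLine S ℓ α → OnLine S ℓ' (mapP1 M α)
      mapP1-OnLine {α} o = evQ≡0⇒OnLine-toP1 ℓ' (act M (homog α)) (Nonzero-act-homog M dM α)
        (trans (relation (homog α)) (trans (cong (κ *_) (OnLine⇒evQ≡0 ℓ α o)) (zeroʳ κ)))

      mapP1-OnLine⁻¹ : ∀ {α} → OnLine S ℓ' (mapP1 M α) → OnLine S ℓ α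
      mapP1-OnLine⁻¹ {α} o = evQ≡0⇒OnLine ℓ α
        (xy≡0⇒y≡0 (trans (sym (relation (homog α))) (OnLine-toP1⇒evQ≡0 ℓ' (act M (homog α)) (Nonzero-act-homog M dM α) o)) κ≢0)

      formRelated-adj : FormRelated (adj M) ℓ' ℓ
      formRelated-adj = κ ⁻¹ * (det M * det M) , *-≢0 (⁻¹-≢0 κ≢0) (*-≢0 dM dM) , λ v →
        trans (xy≡z⇒y≡x⁻¹z κ≢0 (trans (sym (relation (act (adj M) v))) (trans (cong (evQ (ιLine ℓ')) (act-adj M v)) (evQ-• (ιLine ℓ') (det M) v))))
              (sym (*-assoc _ _ _))

      mapP1-Meets : ∀ {α β} → Meets S ℓ α β → Meets S ℓ' (mapP1 M α) (mapP1 M β)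
      mapP1-Meets {α} {β} (α≢β , αℓ , βℓ , only) = (λ e → α≢β (mapP1-injective e)) , mapP1-OnLine αℓ , mapP1-OnLine βℓ , only'
        where
        pullback : ∀ {γ' δ} → mapP1 (adj M) γ' ≡ δ → γ' ≡ mapP1 M δ
        pullback {γ'} e = trans (sym (mapP1-adj-inverseʳ γ')) (cong (mapP1 M) e)
        only' : ∀ γ' → OnLine S ℓ' γ' → γ' ≡ mapP1 M α ⊎ γ' ≡ mapP1 M β
        only' γ' o = Sum.map pullback pullback
          (only (mapP1 (adj M) γ') (mapP1-OnLine⁻¹ (subst (OnLine S ℓ') (sym (mapP1-adj-inverseʳ γ')) o)))

  -- Frobenius on the conic: lines of PG(2,q) are σ-stable, and the 𝔽-rational points are the σ-fixed ones

  σv : V2 → V2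
  σv (s , t) = (σ s , σ t)

  σP : PP → PP
  σP nothing = nothing
  σP (just x) = just (σ x)

  σMat : Mat → Mat
  σMat (mat a b c d) = mat (σ a) (σ b) (σ c) (σ d)

  homog-σ : ∀ α → homog (σP α) ≡ σv (homog α)
  homog-σ nothing = cong₂ _,_ (sym σ-1) (sym σ-0)
  homog-σ (just x) = cong₂ _,_ refl (sym σ-1)

  σP-involutive : ∀ α → σP (σP α) ≡ α
  σP-involutive nothing = refl
  σP-involutive (just x) = cong just (σ-involutive x)

  ~-σ : ∀ {u v} → u ~ v → σv u ~ σv v
  ~-σ {s , t} {u , v} e = trans (sym (trans (σ-sub _ _) (cong₂ _-_ (σ-* s v) (σ-* t u)))) (trans (cong σ e) σ-0)

  Nonzero-σ : ∀ {u} → Nonzero u → Nonzero (σv u)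
  Nonzero-σ {s , t} nu (σs≡0 , σt≡0) = nu (σ-injective (trans σs≡0 (sym σ-0)) , σ-injective (trans σt≡0 (sym σ-0)))

  toP1-σ : ∀ v → Nonzero v → toP1 (σv v) ≡ σP (toP1 v)
  toP1-σ v nv = homog-injective (~trans (homog-toP1 (σv v) (Nonzero-σ nv))
    (subst (σv v ~_) (sym (homog-σ (toP1 v))) (~-σ (~sym (homog-toP1 v nv)))) (Nonzero-σ nv))

  act-σMat : ∀ M v → act (σMat M) (σv v) ≡ σv (act M v)
  act-σMat (mat a b c d) (s , t) = cong₂ _,_ (sym (trans (σ-+ _ _) (cong₂ _+_ (σ-* a s) (σ-* b t))))
                                            (sym (trans (σ-+ _ _) (cong₂ _+_ (σ-* c s) (σ-* d t))))

  matK-σ : ∀ g → σMat (matK g) ≡ matK g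
  matK-σ g = cong₂ (λ A B → A B) (cong₂ (λ A B → A B) (cong₂ mat (σ-ι _) (σ-ι _)) (σ-ι _)) (σ-ι _)

  mapP1-σ : ∀ g α → mapP1 (matK g) (σP α) ≡ σP (mapP1 (matK g) α)
  mapP1-σ g α = trans (cong toP1 (trans (cong (act (matK g)) (homog-σ α))
                        (trans (cong (λ N → act N (σv (homog α))) (sym (matK-σ g))) (act-σMat (matK g) (homog α)))))
                  (toP1-σ (act (matK g) (homog α)) (Nonzero-act (matK g) (matK-det≢0 g) (Nonzero-homog α)))

  evQ-σ : ∀ l v → evQ (ιQ l) (σv v) ≡ σ (evQ (ιQ l) v)
  evQ-σ (a , b , c) (s , t) = sym (trans (σ-+ _ _) (cong₂ _+_ (trans (σ-+ _ _) (cong₂ _+_ (term a s t) (term b s s))) (term c t t)))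
    where
    term : ∀ k x y → σ (ι k * (x * y)) ≡ ι k * (σ x * σ y)
    term k x y = trans (σ-* _ _) (cong₂ _*_ (σ-ι k) (σ-* x y))

  OnLine-σ : ∀ ℓ α → OnLine S ℓ α → OnLine S ℓ (σP α)
  OnLine-σ ℓ α o = evQ≡0⇒OnLine ℓ (σP α) (trans (cong (evQ (ιLine ℓ)) (homog-σ α))
                     (trans (evQ-σ (proj₁ ℓ) (homog α)) (trans (cong σ (OnLine⇒evQ≡0 ℓ α o)) σ-0)))

  InFq⇒σ-fixed : ∀ α → InFq S α → σP α ≡ α
  InFq⇒σ-fixed nothing _ = refl
  InFq⇒σ-fixed (just x) (y , e) = cong just (trans (cong σ (sym e)) (trans (σ-ι y) e))

  σ-fixed⇒InFq : ∀ α → σP α ≡ α → InFq S α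
  σ-fixed⇒InFq nothing _ = tt
  σ-fixed⇒InFq (just x) e = σ-fixed⇒InFqK x (just-injective e)

  InFq? : ∀ α → Dec (InFq S α)
  InFq? nothing = yes tt
  InFq? (just x) = InFqK? x

  -- An irrational intersection point α forces the other one to be σ α.
  irrational⇒Elliptic : ∀ ℓ α β → Meets S ℓ α β → ¬ InFq S α → Elliptic S ℓ
  irrational⇒Elliptic ℓ nothing β αβℓ α∉𝔽 = ⊥-elim (α∉𝔽 tt)
  irrational⇒Elliptic ℓ (just a) β αβℓ@(_ , aℓ , _ , only) a∉𝔽 = a , a∉𝔽 , subst (Meets S ℓ (just a)) β≡σa αβℓ
    where
    β≡σa : β ≡ just (a ^ q)
    β≡σa = Sum.[ (λ e → ⊥-elim (a∉𝔽 (σ-fixed⇒InFq (just a) e))) , sym ] (only (σP (just a)) (OnLine-σ ℓ (just a) aℓ))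

  hyperbolic⊎elliptic : ∀ ℓ → NonTangent S ℓ → Hyperbolic S ℓ ⊎ Elliptic S ℓ
  hyperbolic⊎elliptic ℓ (α , β , αβℓ) with InFq? α | InFq? β
  ... | yes α∈𝔽 | yes β∈𝔽 = inj₁ (α , β , αβℓ , α∈𝔽 , β∈𝔽)
  ... | no α∉𝔽 | _ = inj₂ (irrational⇒Elliptic ℓ α β αβℓ α∉𝔽)
  ... | yes _ | no β∉𝔽 = inj₂ (irrational⇒Elliptic ℓ β α (Meets-sym αβℓ) β∉𝔽)

  homog~ι⇒InFq : ∀ α s t → homog α ~ (ι s , ι t) → Nonzero (ι s , ι t) → InFq S α
  homog~ι⇒InFq nothing s t _ _ = tt
  homog~ι⇒InFq (just x) s t e nz = go (t FF.≟ FF.0#)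
    where
    drop-1 : ∀ x t s → x * t - 1# * s ≡ x * t - s
    drop-1 = solve 3 (λ x t s → ((x ⊗ t) ⊕ (⊝ (𝟏 ⊗ s))) ⊜ ((x ⊗ t) ⊕ (⊝ s))) refl
    xt≡s : x * ι t ≡ ι s
    xt≡s = x-y≡0⇒x≡y (trans (sym (drop-1 x (ι t) (ι s))) e)
    go : Dec (t ≡ FF.0#) → InFqK S x
    go (yes t≡0) = ⊥-elim (nz (trans (sym xt≡s) (trans (cong (λ T → x * ι T) t≡0) (trans (cong (x *_) ι0) (zeroʳ x))) , trans (cong ι t≡0) ι0))
    go (no t≢0) = s FF.* t FF.⁻¹ , trans (ι-* s (t FF.⁻¹)) (trans (cong (ι s *_) (ι-⁻¹ t≢0))
                    (trans (cong (_* (ι t) ⁻¹) (sym xt≡s)) (trans (*-assoc _ _ _) (trans (cong (x *_) (inverse (ι t) (ι≢0 t≢0))) (*-identityʳ x)))))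

  InFq⇒homog-ι : ∀ α → InFq S α → Σ FC (λ s → Σ FC (λ t → homog α ≡ (ι s , ι t)))
  InFq⇒homog-ι nothing _ = FF.1# , FF.0# , cong₂ _,_ (sym ι-1) (sym ι0)
  InFq⇒homog-ι (just x) (y , e) = y , FF.1# , cong₂ _,_ (sym e) (sym ι-1)

  act-matK-ι : ∀ g s t → act (matK g) (ι s , ι t) ≡ (ι (GL2.a g FF.* s FF.+ GL2.b g FF.* t) , ι (GL2.c g FF.* s FF.+ GL2.d g FF.* t))
  act-matK-ι g s t = sym (cong₂ _,_ (trans (ι-+ _ _) (cong₂ _+_ (ι-* _ _) (ι-* _ _))) (trans (ι-+ _ _) (cong₂ _+_ (ι-* _ _) (ι-* _ _))))

  InFq-mapP1 : ∀ g α → InFq S α → InFq S (mapP1 (matK g) α)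
  InFq-mapP1 g α α∈𝔽 = homog~ι⇒InFq (mapP1 (matK g) α) _ _ (subst (homog (toP1 w) ~_) w≡ι (homog-toP1 w w≢0)) (subst Nonzero w≡ι w≢0)
    where
    coords = InFq⇒homog-ι α α∈𝔽
    w = act (matK g) (homog α)
    w≢0 : Nonzero w
    w≢0 = Nonzero-act (matK g) (matK-det≢0 g) (Nonzero-homog α)
    w≡ι : w ≡ _
    w≡ι = trans (cong (act (matK g)) (proj₂ (proj₂ coords))) (act-matK-ι g (proj₁ coords) (proj₁ (proj₂ coords)))

  InFq-mapP1⁻¹ : ∀ g α → InFq S (mapP1 (matK g) α) → InFq S α
  InFq-mapP1⁻¹ g α gα∈𝔽 = subst (InFq S) (Transport.mapP1-adj-inverseˡ (matK g) (matK-det≢0 g) α)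
    (subst (λ N → InFq S (mapP1 N (mapP1 (matK g) α))) (matK-adj g) (InFq-mapP1 (adjGL2 g) _ gα∈𝔽))

  -- Cross ratios: CrossRatioOf n d r says r = n / d in 𝕂 ∪ {∞}

  CrossRatioOf : KC → KC → PP → Set
  CrossRatioOf n d nothing = d ≡ 0#
  CrossRatioOf n d (just x) = d ≢0 × x * d ≡ n

  crossNum crossDen : PP → PP → PP → PP → KC
  crossNum α β γ δ = wedge (homog α) (homog γ) * wedge (homog β) (homog δ)
  crossDen α β γ δ = wedge (homog α) (homog δ) * wedge (homog β) (homog γ)

  IsCR⇔CrossRatioOf : ∀ α β γ δ r → IsCR S α β γ δ r ⇔ CrossRatioOf (crossNum α β γ δ) (crossDen α β γ δ) r
  IsCR⇔CrossRatioOf α β γ δ nothing = mk⇔ (trans (sym den)) (trans den)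
    where den = cong₂ _*_ (br≡wedge α δ) (br≡wedge β γ)
  IsCR⇔CrossRatioOf α β γ δ (just x) =
    mk⇔ (λ { (d≢0 , e) → (λ z → d≢0 (trans den z)) , trans (cong (x *_) (sym den)) (trans e num) })
        (λ { (d≢0 , e) → (λ z → d≢0 (trans (sym den) z)) , trans (cong (x *_) den) (trans e (sym num)) })
    where
    den = cong₂ _*_ (br≡wedge α δ) (br≡wedge β γ)
    num = cong₂ _*_ (br≡wedge α γ) (br≡wedge β δ)

  IsCR⇒CrossRatioOf : ∀ α β γ δ r → IsCR S α β γ δ r → CrossRatioOf (crossNum α β γ δ) (crossDen α β γ δ) r
  IsCR⇒CrossRatioOf α β γ δ r = Equivalence.to (IsCR⇔CrossRatioOf α β γ δ r)

  CrossRatioOf⇒IsCR : ∀ α β γ δ r → CrossRatioOf (crossNum α β γ δ) (crossDen α β γ δ) r → IsCR S α β γ δ r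
  CrossRatioOf⇒IsCR α β γ δ r = Equivalence.from (IsCR⇔CrossRatioOf α β γ δ r)

  CrossRatioOf-scale : ∀ {n d n' d' Λ} r → Λ ≢0 → n' ≡ Λ * n → d' ≡ Λ * d → CrossRatioOf n d r → CrossRatioOf n' d' r
  CrossRatioOf-scale nothing Λ≢0 en ed d≡0 = trans ed (trans (cong (_ *_) d≡0) (zeroʳ _))
  CrossRatioOf-scale {n} {d} {Λ = Λ} (just x) Λ≢0 en ed (d≢0 , e) =
    (λ z → *-≢0 Λ≢0 d≢0 (trans (sym ed) z)) , trans (cong (x *_) ed) (trans (swap x Λ d) (trans (cong (Λ *_) e) (sym en)))
    where
    swap : ∀ x L d → x * (L * d) ≡ L * (x * d)
    swap = solve 3 (λ x L d → (x ⊗ (L ⊗ d)) ⊜ (L ⊗ (x ⊗ d))) refl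

  CrossRatioOf-swap : ∀ α β γ δ r → CrossRatioOf (crossNum α β γ δ) (crossDen α β γ δ) r → CrossRatioOf (crossNum β α δ γ) (crossDen β α δ γ) r
  CrossRatioOf-swap α β γ δ r = CrossRatioOf-scale r 1≢0 (trans (*-comm _ _) (sym (*-identityˡ _))) (trans (*-comm _ _) (sym (*-identityˡ _)))

  CrossRatioOf-inverse : ∀ {n d} r₀ r → CrossRatioOf n d r₀ → IsInv S r₀ r → ¬ (n ≡ 0# × d ≡ 0#) → CrossRatioOf d n r
  CrossRatioOf-inverse {n} {d} nothing r d≡0 r≡0 nondegenerate =
    subst (CrossRatioOf d n) (sym r≡0) ((λ n≡0 → nondegenerate (n≡0 , d≡0)) , trans (zeroˡ n) (sym d≡0))
  CrossRatioOf-inverse {n} {d} (just x) nothing (d≢0 , e) x≡0 _ = trans (sym e) (trans (cong (_* d) x≡0) (zeroˡ d))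
  CrossRatioOf-inverse {n} {d} (just x) (just y) (d≢0 , e) xy≡1 _ =
    (λ n≡0 → *-≢0 x≢0 d≢0 (trans e n≡0)) , trans (cong (y *_) (sym e)) (trans (rotate y x d) (trans (cong (_* d) xy≡1) (*-identityˡ d)))
    where
    x≢0 : x ≢0
    x≢0 x≡0 = 1≢0 (trans (sym xy≡1) (trans (cong (_* y) x≡0) (zeroˡ y)))
    rotate : ∀ y x d → y * (x * d) ≡ (x * y) * d
    rotate = solve 3 (λ y x d → (y ⊗ (x ⊗ d)) ⊜ ((x ⊗ y) ⊗ d)) refl

  crossRatio-defined : ∀ {α β γ δ} → ¬ α ≡ β → ¬ γ ≡ δ → ¬ (crossNum α β γ δ ≡ 0# × crossDen α β γ δ ≡ 0#)
  crossRatio-defined {α} {β} {γ} {δ} α≢β γ≢δ (n≡0 , d≡0) = go (wedge-product≡0 {α} {γ} {β} {δ} n≡0) (wedge-product≡0 {α} {δ} {β} {γ} d≡0)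
    where
    go : α ≡ γ ⊎ β ≡ δ → α ≡ δ ⊎ β ≡ γ → ⊥
    go (inj₁ α≡γ) (inj₁ α≡δ) = γ≢δ (trans (sym α≡γ) α≡δ)
    go (inj₁ α≡γ) (inj₂ β≡γ) = α≢β (trans α≡γ (sym β≡γ))
    go (inj₂ β≡δ) (inj₁ α≡δ) = α≢β (trans α≡δ (sym β≡δ))
    go (inj₂ β≡δ) (inj₂ β≡γ) = γ≢δ (trans (sym β≡γ) β≡δ)

  crossRatio : KC → KC → ∀ {d} → Dec (d ≡ 0#) → PP
  crossRatio n d (yes _) = nothing
  crossRatio n d (no _) = just (n * d ⁻¹)

  crossRatio-correct : ∀ n d (d≟0 : Dec (d ≡ 0#)) → CrossRatioOf n d (crossRatio n d d≟0)
  crossRatio-correct n d (yes d≡0) = d≡0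
  crossRatio-correct n d (no d≢0) = d≢0 , trans (*-assoc _ _ _) (trans (cong (n *_) (inverseˡ d≢0)) (*-identityʳ n))

  wedge-scaled-act : ∀ M k l u v → wedge (k • act M u) (l • act M v) ≡ (k * l) * (det M * wedge u v)
  wedge-scaled-act M k l u v = trans (wedge-•ˡ k (act M u) (l • act M v))
    (trans (cong (k *_) (trans (wedge-•ʳ l (act M u) (act M v)) (cong (l *_) (wedge-act M u v)))) (sym (*-assoc _ _ _)))

  -- mapP1 M rescales each homogeneous vector, so both cross-ratio terms pick up the same factor Λ.
  IsCR-mapP1 : ∀ M → det M ≢0 → ∀ α β γ δ r → IsCR S α β γ δ r → IsCR S (mapP1 M α) (mapP1 M β) (mapP1 M γ) (mapP1 M δ) r
  IsCR-mapP1 M dM α β γ δ r c = CrossRatioOf⇒IsCR _ _ _ _ r (CrossRatioOf-scale r Λ≢0 num den (IsCR⇒CrossRatioOf α β γ δ r c))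
    where
    scale : ∀ α → Σ KC (λ k → k ≢0 × homog (mapP1 M α) ≡ k • act M (homog α))
    scale α = homog-toP1-scale (act M (homog α)) (Nonzero-act M dM (Nonzero-homog α))
    k : PP → KC
    k x = proj₁ (scale x)
    D = det M
    Λ = (k α * k β * k γ * k δ) * (D * D)
    Λ≢0 : Λ ≢0
    Λ≢0 = *-≢0 (*-≢0 (*-≢0 (*-≢0 (proj₁ (proj₂ (scale α))) (proj₁ (proj₂ (scale β)))) (proj₁ (proj₂ (scale γ)))) (proj₁ (proj₂ (scale δ)))) (*-≢0 dM dM)
    image-wedge : ∀ x y → wedge (homog (mapP1 M x)) (homog (mapP1 M y)) ≡ (k x * k y) * (D * wedge (homog x) (homog y))
    image-wedge x y = trans (cong₂ wedge (proj₂ (proj₂ (scale x))) (proj₂ (proj₂ (scale y)))) (wedge-scaled-act M _ _ (homog x) (homog y))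
    collect₁ : ∀ ka kb kc kd D ac bd → ((ka * kc) * (D * ac)) * ((kb * kd) * (D * bd)) ≡ (ka * kb * kc * kd * (D * D)) * (ac * bd)
    collect₁ = solve 7 (λ ka kb kc kd D ac bd → (((ka ⊗ kc) ⊗ (D ⊗ ac)) ⊗ ((kb ⊗ kd) ⊗ (D ⊗ bd))) ⊜ (((((ka ⊗ kb) ⊗ kc) ⊗ kd) ⊗ (D ⊗ D)) ⊗ (ac ⊗ bd))) refl
    collect₂ : ∀ ka kb kc kd D ad bc → ((ka * kd) * (D * ad)) * ((kb * kc) * (D * bc)) ≡ (ka * kb * kc * kd * (D * D)) * (ad * bc)
    collect₂ = solve 7 (λ ka kb kc kd D ad bc → (((ka ⊗ kd) ⊗ (D ⊗ ad)) ⊗ ((kb ⊗ kc) ⊗ (D ⊗ bc))) ⊜ (((((ka ⊗ kb) ⊗ kc) ⊗ kd) ⊗ (D ⊗ D)) ⊗ (ad ⊗ bc))) refl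
    num : crossNum (mapP1 M α) (mapP1 M β) (mapP1 M γ) (mapP1 M δ) ≡ Λ * crossNum α β γ δ
    num = trans (cong₂ _*_ (image-wedge α γ) (image-wedge β δ)) (collect₁ _ _ _ _ D _ _)
    den : crossDen (mapP1 M α) (mapP1 M β) (mapP1 M γ) (mapP1 M δ) ≡ Λ * crossDen α β γ δ
    den = trans (cong₂ _*_ (image-wedge α δ) (image-wedge β γ)) (collect₂ _ _ _ _ D _ _)

  InCR-mapP1 : ∀ M (dM : det M ≢0) {ℓ m ℓ' m'} → FormRelated M ℓ ℓ' → FormRelated M m m' → ∀ x → InCR S ℓ m x → InCR S ℓ' m' x
  InCR-mapP1 M dM rℓ rm x (α , β , γ , δ , αβℓ , γδm , ρ) =
    mapP1 M α , mapP1 M β , mapP1 M γ , mapP1 M δ , Transport.mapP1-Meets M dM rℓ αβℓ , Transport.mapP1-Meets M dM rm γδm , InRho-image ρ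
    where
    InRho-image : InRho S α β γ δ x → InRho S (mapP1 M α) (mapP1 M β) (mapP1 M γ) (mapP1 M δ) x
    InRho-image (inj₁ c) = inj₁ (IsCR-mapP1 M dM α β γ δ x c)
    InRho-image (inj₂ (r , c , r⁻¹≡x)) = inj₂ (r , IsCR-mapP1 M dM α β γ δ r c , r⁻¹≡x)

  -- Necessity of the conditions

  Hyperbolic-mapP1 : ∀ g {ℓ ℓ'} → FormRelated (matK g) ℓ ℓ' → Hyperbolic S ℓ → Hyperbolic S ℓ'
  Hyperbolic-mapP1 g rel (α , β , αβℓ , α∈𝔽 , β∈𝔽) =
    mapP1 (matK g) α , mapP1 (matK g) β , Transport.mapP1-Meets (matK g) (matK-det≢0 g) rel αβℓ , InFq-mapP1 g α α∈𝔽 , InFq-mapP1 g β β∈𝔽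

  Elliptic-mapP1 : ∀ g {ℓ ℓ'} → FormRelated (matK g) ℓ ℓ' → Elliptic S ℓ → Elliptic S ℓ'
  Elliptic-mapP1 g {ℓ} {ℓ'} rel (a , a∉𝔽 , aℓ) = elliptic (mapP1 (matK g) (just a)) image-meets (λ i → a∉𝔽 (InFq-mapP1⁻¹ g (just a) i))
    where
    image-meets : Meets S ℓ' (mapP1 (matK g) (just a)) (σP (mapP1 (matK g) (just a)))
    image-meets = subst (Meets S ℓ' (mapP1 (matK g) (just a))) (mapP1-σ g (just a)) (Transport.mapP1-Meets (matK g) (matK-det≢0 g) rel aℓ)
    elliptic : ∀ α' → Meets S ℓ' α' (σP α') → ¬ InFq S α' → Elliptic S ℓ'
    elliptic nothing _ ∞∉𝔽 = ⊥-elim (∞∉𝔽 tt)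
    elliptic (just a') a'ℓ' a'∉𝔽 = a' , a'∉𝔽 , a'ℓ'

  SameType-mapP1 : ∀ g ℓ ℓ' → NonTangent S ℓ → FormRelated (matK g) ℓ ℓ' → SameType S ℓ ℓ'
  SameType-mapP1 g ℓ ℓ' nt rel = Sum.map (λ h → h , Hyperbolic-mapP1 g rel h) (λ e → e , Elliptic-mapP1 g rel e) (hyperbolic⊎elliptic ℓ nt)

  forward : ∀ ℓ m ℓ' m' → NonTangent S ℓ → NonTangent S m →
            Σ (GL2 S) (λ g → MapsLine S g ℓ ℓ' × MapsLine S g m m') →
            SameType S ℓ ℓ' × SameType S m m' × SameCR S ℓ m ℓ' m'
  forward ℓ m ℓ' m' ntℓ ntm (g , gℓ , gm) =
    SameType-mapP1 g ℓ ℓ' ntℓ rℓ , SameType-mapP1 g m m' ntm rm ,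
    λ x → mk⇔ (InCR-mapP1 (matK g) dK rℓ rm x)
              (InCR-mapP1 (adj (matK g)) (det-adj≢0 (matK g) dK) (Transport.formRelated-adj (matK g) dK {ℓ} {ℓ'} rℓ) (Transport.formRelated-adj (matK g) dK {m} {m'} rm) x)
    where
    rℓ = DualProportional⇒FormRelated g ℓ ℓ' (MapsLine⇒DualProportional g ℓ ℓ' gℓ)
    rm = DualProportional⇒FormRelated g m m' (MapsLine⇒DualProportional g m m' gm)
    dK = matK-det≢0 g

  -- Sufficiency of the conditions

  -- σ fixes both points of a hyperbolic line and swaps those of an elliptic one; the two pairs must behave alike.
  FrobeniusCompatible : PP → PP → PP → PP → Set
  FrobeniusCompatible a b a' b' = (σP a ≡ a × σP b ≡ b × σP a' ≡ a' × σP b' ≡ b') ⊎ (σP a ≡ b × σP b ≡ a × σP a' ≡ b' × σP b' ≡ a')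

  compatible-swapˡ : ∀ {a b a' b'} → FrobeniusCompatible a b a' b' → FrobeniusCompatible b a a' b'
  compatible-swapˡ (inj₁ (p , q , r , s)) = inj₁ (q , p , r , s)
  compatible-swapˡ (inj₂ (p , q , r , s)) = inj₂ (q , p , r , s)

  compatible-swapʳ : ∀ {a b a' b'} → FrobeniusCompatible a b a' b' → FrobeniusCompatible a b b' a'
  compatible-swapʳ (inj₁ (p , q , r , s)) = inj₁ (p , q , s , r)
  compatible-swapʳ (inj₂ (p , q , r , s)) = inj₂ (p , q , s , r)

  hyperbolic-σ-fixed : ∀ {ℓ α β} → Hyperbolic S ℓ → Meets S ℓ α β → σP α ≡ α × σP β ≡ β
  hyperbolic-σ-fixed {α = α} {β} (a , b , (_ , _ , _ , only) , a∈𝔽 , b∈𝔽) (_ , αℓ , βℓ , _) = fixed α (only α αℓ) , fixed β (only β βℓ)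
    where
    fixed : ∀ x → x ≡ a ⊎ x ≡ b → σP x ≡ x
    fixed x (inj₁ refl) = InFq⇒σ-fixed x a∈𝔽
    fixed x (inj₂ refl) = InFq⇒σ-fixed x b∈𝔽

  elliptic-σ-swapped : ∀ {ℓ α β} → Elliptic S ℓ → Meets S ℓ α β → σP α ≡ β × σP β ≡ α
  elliptic-σ-swapped {α = α} {β} (a , _ , (_ , _ , _ , only) ) (α≢β , αℓ , βℓ , _) = go (only α αℓ) (only β βℓ)
    where
    σσa = σP-involutive (just a)
    go : α ≡ just a ⊎ α ≡ just (a ^ q) → β ≡ just a ⊎ β ≡ just (a ^ q) → σP α ≡ β × σP β ≡ α
    go (inj₁ α≡a) (inj₁ β≡a) = ⊥-elim (α≢β (trans α≡a (sym β≡a)))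
    go (inj₁ α≡a) (inj₂ β≡σa) = trans (cong σP α≡a) (sym β≡σa) , trans (cong σP β≡σa) (trans σσa (sym α≡a))
    go (inj₂ α≡σa) (inj₁ β≡a) = trans (cong σP α≡σa) (trans σσa (sym β≡a)) , trans (cong σP β≡a) (sym α≡σa)
    go (inj₂ α≡σa) (inj₂ β≡σa) = ⊥-elim (α≢β (trans α≡σa (sym β≡σa)))

  SameType⇒compatible : ∀ {ℓ ℓ' α β α' β'} → SameType S ℓ ℓ' → Meets S ℓ α β → Meets S ℓ' α' β' → FrobeniusCompatible α β α' β'
  SameType⇒compatible (inj₁ (hℓ , hℓ')) αβℓ αβℓ' =
    inj₁ (proj₁ (hyperbolic-σ-fixed hℓ αβℓ) , proj₂ (hyperbolic-σ-fixed hℓ αβℓ) , proj₁ (hyperbolic-σ-fixed hℓ' αβℓ') , proj₂ (hyperbolic-σ-fixed hℓ' αβℓ'))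
  SameType⇒compatible (inj₂ (eℓ , eℓ')) αβℓ αβℓ' =
    inj₂ (proj₁ (elliptic-σ-swapped eℓ αβℓ) , proj₂ (elliptic-σ-swapped eℓ αβℓ) , proj₁ (elliptic-σ-swapped eℓ' αβℓ') , proj₂ (elliptic-σ-swapped eℓ' αβℓ'))

  Sends : Mat → PP → PP → Set
  Sends M x x' = act M (homog x) ~ homog x'

  Sends⇒mapP1 : ∀ M → det M ≢0 → ∀ x x' → Sends M x x' → mapP1 M x ≡ x'
  Sends⇒mapP1 M dM x x' s = trans (toP1-~ (Nonzero-act M dM (Nonzero-homog x)) (Nonzero-homog x') s) (toP1-homog x')

  Sends-mapP1 : ∀ M → det M ≢0 → ∀ x → Sends M x (mapP1 M x)
  Sends-mapP1 M dM x = ~sym (homog-toP1 (act M (homog x)) (Nonzero-act M dM (Nonzero-homog x)))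

  Sends-σ : ∀ M x x' → Sends M x x' → Sends (σMat M) (σP x) (σP x')
  Sends-σ M x x' s = subst₂ _~_ (trans (sym (act-σMat M (homog x))) (cong (act (σMat M)) (sym (homog-σ x)))) (sym (homog-σ x')) (~-σ s)

  Sends-σMat : ∀ M {a b a' b'} → FrobeniusCompatible a b a' b' → Sends M a a' → Sends M b b' → Sends (σMat M) a a' × Sends (σMat M) b b'
  Sends-σMat M {a} {b} {a'} {b'} (inj₁ (σa , σb , σa' , σb')) sa sb =
    subst₂ (Sends (σMat M)) σa σa' (Sends-σ M a a' sa) , subst₂ (Sends (σMat M)) σb σb' (Sends-σ M b b' sb)
  Sends-σMat M {a} {b} {a'} {b'} (inj₂ (σa , σb , σa' , σb')) sa sb =
    subst₂ (Sends (σMat M)) σb σb' (Sends-σ M b b' sb) , subst₂ (Sends (σMat M)) σa σa' (Sends-σ M a a' sa)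

  Sends-both⇒~ : ∀ {M N} x x' → Sends M x x' → Sends N x x' → act M (homog x) ~ act N (homog x)
  Sends-both⇒~ x x' sM sN = ~trans sM (~sym sN) (Nonzero-homog x')

  -- If σ M = κ M and e is a nonzero entry of M, then e⁻¹ M has σ-fixed entries, i.e. lies over 𝔽.
  σ-proportional⇒GL2 : ∀ M → det M ≢0 → ∀ {κ} → MatEq (σMat M) (κ •M M) → ∀ {e} → e ≢0 → σ e ≡ κ * e →
                       Σ (GL2 S) (λ g → Σ KC (λ k → ∀ v → act (matK g) v ≡ k • act M v))
  σ-proportional⇒GL2 M@(mat m11 m12 m21 m22) dM {κ} (σ11 , σ12 , σ21 , σ22) {e} e≢0 σe =
    g , e ⁻¹ , λ v → trans (cong (λ N → act N v) matK-g) (act-•M (e ⁻¹) M v)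
    where
    κ≢0 : κ ≢0
    κ≢0 κ≡0 = σ≢0 e≢0 (trans σe (trans (cong (_* e) κ≡0) (zeroˡ e)))
    κe≢0 = *-≢0 κ≢0 e≢0
    regroup : ∀ k e m e⁻¹ → (k * e) * (e⁻¹ * m) ≡ (k * m) * (e * e⁻¹)
    regroup = solve 4 (λ k e m ei → ((k ⊗ e) ⊗ (ei ⊗ m)) ⊜ ((k ⊗ m) ⊗ (e ⊗ ei))) refl
    normalised : ∀ {x} → σ x ≡ κ * x → σ (e ⁻¹ * x) ≡ e ⁻¹ * x
    normalised {x} σx = trans (σ-* _ _) (trans (cong₂ _*_ (trans (σ-⁻¹ e≢0) (cong _⁻¹ σe)) σx)
      (*-cancelˡ κe≢0 (trans (*-⁻¹-cancel κe≢0 (κ * x))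
        (sym (trans (regroup κ e x (e ⁻¹)) (trans (cong ((κ * x) *_) (inverse e e≢0)) (*-identityʳ _)))))))
    r11 = σ-fixed⇒InFqK _ (normalised σ11)
    r12 = σ-fixed⇒InFqK _ (normalised σ12)
    r21 = σ-fixed⇒InFqK _ (normalised σ21)
    r22 = σ-fixed⇒InFqK _ (normalised σ22)
    a = proj₁ r11
    b = proj₁ r12
    c = proj₁ r21
    d = proj₁ r22
    matK-entries : mat (ι a) (ι b) (ι c) (ι d) ≡ (e ⁻¹) •M M
    matK-entries = cong₂ (λ A B → A B) (cong₂ (λ A B → A B) (cong₂ mat (proj₂ r11) (proj₂ r12)) (proj₂ r21)) (proj₂ r22)
    det≢0 : FF._≢0 (a FF.* d FF.- b FF.* c)
    det≢0 z = *-≢0 (*-≢0 (⁻¹-≢0 e≢0) (⁻¹-≢0 e≢0)) dM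
      (trans (sym (det-•M (e ⁻¹) M)) (trans (cong det (sym matK-entries)) (trans (sym (ι-det a b c d)) (trans (cong ι z) ι0))))
    g : GL2 S
    g = record { a = a ; b = b ; c = c ; d = d ; det≢0 = det≢0 }
    matK-g : matK g ≡ (e ⁻¹) •M M
    matK-g = matK-entries

  descendToGL2 : ∀ M → det M ≢0 → (κ : KC) → MatEq (σMat M) (κ •M M) →
                 Σ (GL2 S) (λ g → Σ KC (λ k → ∀ v → act (matK g) v ≡ k • act M v))
  descendToGL2 M@(mat m11 m12 m21 m22) dM κ σM≡κM@(σ11 , σ12 , σ21 , σ22) with m11 ≟ 0# | m12 ≟ 0# | m21 ≟ 0# | m22 ≟ 0#
  ... | no n | _ | _ | _ = σ-proportional⇒GL2 M dM σM≡κM n σ11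
  ... | yes _ | no n | _ | _ = σ-proportional⇒GL2 M dM σM≡κM n σ12
  ... | yes _ | yes _ | no n | _ = σ-proportional⇒GL2 M dM σM≡κM n σ21
  ... | yes _ | yes _ | yes _ | no n = σ-proportional⇒GL2 M dM σM≡κM n σ22
  ... | yes refl | yes refl | yes refl | yes refl = ⊥-elim (dM (trans (cong₂ _-_ (zeroˡ 0#) (zeroˡ 0#)) (-‿inverseʳ 0#)))

  Sends-rescale : ∀ g M k → (∀ v → act (matK g) v ≡ k • act M v) → det M ≢0 → ∀ x x' → Sends M x x' → Sends (matK g) x x'
  Sends-rescale g M k gM dM x x' s = subst (_~ homog x') (sym (gM (homog x))) (~trans (•~ k (act M (homog x))) s (Nonzero-act M dM (Nonzero-homog x)))

  -- The form of ℓ' pulled back along g vanishes at the two points of ℓ, so it is a multiple of the form of ℓ.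
  Sends⇒MapsLine : ∀ g ℓ ℓ' {α β α' β'} → Meets S ℓ α β → Meets S ℓ' α' β' → Sends (matK g) α α' → Sends (matK g) β β' → MapsLine S g ℓ ℓ'
  Sends⇒MapsLine g ℓ ℓ' {α} {β} {α'} {β'} (α≢β , αℓ , βℓ , _) (_ , α'ℓ' , β'ℓ' , _) sα sβ = DualProportional⇒MapsLine g ℓ ℓ' (c , c≢0 , w≡c•l)
    where
    w = dualEmbedGL2 g (proj₁ ℓ')
    evQ-w : ∀ v → evQ (ιQ w) v ≡ evQ (ιLine ℓ') (act (matK g) v)
    evQ-w v = trans (cong (λ W → evQ W v) (ι-dualEmbed _ _ _ _ (proj₁ ℓ'))) (sym (evQ-dualEmbed _ _ _ _ (ιLine ℓ') v))
    w-at : ∀ {x x'} → Sends (matK g) x x' → OnLine S ℓ' x' → evQ (ιQ w) (homog x) ≡ 0#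
    w-at {x} {x'} s x'ℓ' = trans (evQ-w _) (evQ-~ (ιLine ℓ') (~sym s) (Nonzero-homog x') (OnLine⇒evQ≡0 ℓ' x' x'ℓ'))
    w×ℓ≡0 : IsZero₃ (cross (ιQ w) (ιLine ℓ))
    w×ℓ≡0 = commonZeros⇒cross≡0 (ιQ w) (ιLine ℓ) (homog α) (homog β) (w-at {α} sα α'ℓ') (w-at {β} sβ β'ℓ')
              (OnLine⇒evQ≡0 ℓ α αℓ) (OnLine⇒evQ≡0 ℓ β βℓ) (≢⇒wedge≢0 α≢β)
    multiple = FF.cross≡0⇒multiple w (proj₁ ℓ) (IsZero₃-ι _ (subst IsZero₃ (cross-ι w (proj₁ ℓ)) w×ℓ≡0)) (line-nonzero ℓ)
    c = proj₁ multiple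
    w≡c•l = proj₂ multiple
    c≢0 : FF._≢0 c
    c≢0 c≡0 = line-nonzero ℓ' (IsZero₃-ι _ (evQ-zero (ιLine ℓ') ℓ'-vanishes))
      where
      w-vanishes : ∀ v → evQ (ιQ w) v ≡ 0#
      w-vanishes v = trans (cong (λ W → evQ (ιQ W) v) w≡c•l) (trans (cong (λ W → evQ W v) (ιQ-•3 c (proj₁ ℓ)))
                       (trans (evQ-•3 _ _ v) (trans (cong (_* evQ (ιLine ℓ) v) (trans (cong ι c≡0) ι0)) (zeroˡ _))))
      ℓ'-vanishes : ∀ u → evQ (ιLine ℓ') u ≡ 0#
      ℓ'-vanishes u = xy≡0⇒y≡0 (trans (sym (evQ-• (ιLine ℓ') (det (matK g)) u))
                        (trans (cong (evQ (ιLine ℓ')) (sym (act-adj (matK g) u))) (trans (sym (evQ-w _)) (w-vanishes _))))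
                        (*-≢0 (matK-det≢0 g) (matK-det≢0 g))

  general-position : ∀ a b u → ¬ a ≡ b → ¬ u ≡ a → ¬ u ≡ b → GeneralPosition (homog a) (homog b) (homog u)
  general-position a b u a≢b u≢a u≢b = record
    { n1 = Nonzero-homog a ; n2 = Nonzero-homog b ; n3 = Nonzero-homog u
    ; d12 = ≢⇒wedge≢0 a≢b ; d31 = ≢⇒wedge≢0 u≢a ; d32 = ≢⇒wedge≢0 u≢b }

  wedge≢0⇒≢ : ∀ a b → wedge (homog a) (homog b) ≢0 → ¬ a ≡ b
  wedge≢0⇒≢ a b n refl = n (~refl (homog a))

  module Backward (ℓ m ℓ' m' : Line S) (ℓ≢m : ¬ SameLine S ℓ m) (ℓ'≢m' : ¬ SameLine S ℓ' m') where
    Goal : Set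
    Goal = Σ (GL2 S) (λ g → MapsLine S g ℓ ℓ' × MapsLine S g m m')

    record Configuration : Set where
      field
        α β γ δ α' β' γ' δ' : PP
        αβℓ : Meets S ℓ α β
        γδm : Meets S m γ δ
        αβℓ' : Meets S ℓ' α' β'
        γδm' : Meets S m' γ' δ'
        compatibleℓ : FrobeniusCompatible α β α' β'
        compatiblem : FrobeniusCompatible γ δ γ' δ'
        r : PP
        cr : CrossRatioOf (crossNum α β γ δ) (crossDen α β γ δ) r
        cr' : CrossRatioOf (crossNum α' β' γ' δ') (crossDen α' β' γ' δ') r

    swapˡ : Configuration → Configuration
    swapˡ C = record { α = β ; β = α ; γ = δ ; δ = γ ; α' = α' ; β' = β' ; γ' = γ' ; δ' = δ'
                     ; αβℓ = Meets-sym αβℓ ; γδm = Meets-sym γδm ; αβℓ' = αβℓ' ; γδm' = γδm'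
                     ; compatibleℓ = compatible-swapˡ compatibleℓ ; compatiblem = compatible-swapˡ compatiblem ; r = r
                     ; cr = CrossRatioOf-swap α β γ δ r cr ; cr' = cr' }
      where open Configuration C

    swapʳ : Configuration → Configuration
    swapʳ C = record { α = α ; β = β ; γ = γ ; δ = δ ; α' = β' ; β' = α' ; γ' = δ' ; δ' = γ'
                     ; αβℓ = αβℓ ; γδm = γδm ; αβℓ' = Meets-sym αβℓ' ; γδm' = Meets-sym γδm'
                     ; compatibleℓ = compatible-swapʳ compatibleℓ ; compatiblem = compatible-swapʳ compatiblem ; r = r
                     ; cr = cr ; cr' = CrossRatioOf-swap α' β' γ' δ' r cr' }
      where open Configuration C

    module _ (C : Configuration) where
      open Configuration C

      distinct-lines : ∀ {a b c d} {n n' : Line S} → ¬ SameLine S n n' → Meets S n a b → Meets S n' c d → ¬ (a ≡ c × b ≡ d)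
      distinct-lines n≢n' abn cdn' (refl , refl) = n≢n' (sameMeets⇒SameLine _ _ abn cdn')

      -- M and σ M agree at α, β and a third point u, hence σ M = κ M and M descends to GL(2,q).
      fromMatrix : (M : Mat) → det M ≢0 → Sends M α α' → Sends M β β' → Sends M γ γ' → Sends M δ δ' →
                   ∀ {u} → u ≡ γ ⊎ u ≡ δ → GeneralPosition (homog α) (homog β) (homog u) → Goal
      fromMatrix M dM sα sβ sγ sδ u∈γδ I =
        g , Sends⇒MapsLine g ℓ ℓ' αβℓ αβℓ' (rescale α α' sα) (rescale β β' sβ) , Sends⇒MapsLine g m m' γδm γδm' (rescale γ γ' sγ) (rescale δ δ' sδ)
        where
        σℓ = Sends-σMat M compatibleℓ sα sβ
        σm = Sends-σMat M compatiblem sγ sδ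
        agree : ∀ {v} → v ≡ γ ⊎ v ≡ δ → act M (homog v) ~ act (σMat M) (homog v)
        agree (inj₁ refl) = Sends-both⇒~ γ γ' sγ (proj₁ σm)
        agree (inj₂ refl) = Sends-both⇒~ δ δ' sδ (proj₂ σm)
        proportional = agreeOnThree⇒proportional M (σMat M) dM I (Sends-both⇒~ α α' sα (proj₁ σℓ)) (Sends-both⇒~ β β' sβ (proj₂ σℓ)) (agree u∈γδ)
        descent = descendToGL2 M dM (proj₁ proportional) (proj₂ proportional)
        g = proj₁ descent
        rescale : ∀ x x' → Sends M x x' → Sends (matK g) x x'
        rescale = Sends-rescale g M (proj₁ (proj₂ descent)) (proj₂ (proj₂ descent)) dM

      caseCrossRatio∞ : α ≡ δ → α' ≡ δ' → Goal
      caseCrossRatio∞ α≡δ α'≡δ' = fromMatrix M dM (Maps₃.m1 sends) (Maps₃.m2 sends) (Maps₃.m3 sends) (subst₂ (Sends M) α≡δ α'≡δ' (Maps₃.m1 sends)) (inj₁ refl) I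
        where
        I = general-position α β γ (proj₁ αβℓ) (λ γ≡α → proj₁ γδm (trans γ≡α α≡δ)) (λ γ≡β → distinct-lines ℓ≢m αβℓ (Meets-sym γδm) (α≡δ , sym γ≡β))
        I' = general-position α' β' γ' (proj₁ αβℓ') (λ γ≡α → proj₁ γδm' (trans γ≡α α'≡δ')) (λ γ≡β → distinct-lines ℓ'≢m' αβℓ' (Meets-sym γδm') (α'≡δ' , sym γ≡β))
        M = threePointMap (homog α) (homog β) (homog γ) (homog α') (homog β') (homog γ')
        dM = threePointMap-det≢0 I I'
        sends = threePointMap-maps I I'

      caseCrossRatio0 : α ≡ γ → α' ≡ γ' → Goal
      caseCrossRatio0 α≡γ α'≡γ' = fromMatrix M dM (Maps₃.m1 sends) (Maps₃.m2 sends) (subst₂ (Sends M) α≡γ α'≡γ' (Maps₃.m1 sends)) (Maps₃.m3 sends) (inj₂ refl) I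
        where
        I = general-position α β δ (proj₁ αβℓ) (λ δ≡α → proj₁ γδm (sym (trans δ≡α α≡γ))) (λ δ≡β → distinct-lines ℓ≢m αβℓ γδm (α≡γ , sym δ≡β))
        I' = general-position α' β' δ' (proj₁ αβℓ') (λ δ≡α → proj₁ γδm' (sym (trans δ≡α α'≡γ'))) (λ δ≡β → distinct-lines ℓ'≢m' αβℓ' γδm' (α'≡γ' , sym δ≡β))
        M = threePointMap (homog α) (homog β) (homog δ) (homog α') (homog β') (homog δ')
        dM = threePointMap-det≢0 I I'
        sends = threePointMap-maps I I'

      -- M sends α, β, γ to α', β', γ'; the image of δ then has cross ratio x with them, which pins it down to δ'.
      caseCrossRatioGeneric : (x : KC) → r ≡ just x → x ≢0 → Goal
      caseCrossRatioGeneric x refl x≢0 = fromMatrix M dM sα sβ sγ sδ (inj₁ refl) I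
        where
        num≢0 : ∀ a b c d → CrossRatioOf (crossNum a b c d) (crossDen a b c d) (just x) → crossNum a b c d ≢0
        num≢0 a b c d (d≢0 , e) z = *-≢0 x≢0 d≢0 (trans e z)
        I = general-position α β γ (proj₁ αβℓ) (λ γ≡α → wedge≢0⇒≢ α γ (x*y≢0⇒x≢0 (num≢0 α β γ δ cr)) (sym γ≡α))
              (λ γ≡β → wedge≢0⇒≢ β γ (x*y≢0⇒y≢0 (proj₁ cr)) (sym γ≡β))
        I' = general-position α' β' γ' (proj₁ αβℓ') (λ γ≡α → wedge≢0⇒≢ α' γ' (x*y≢0⇒x≢0 (num≢0 α' β' γ' δ' cr')) (sym γ≡α))
               (λ γ≡β → wedge≢0⇒≢ β' γ' (x*y≢0⇒y≢0 (proj₁ cr')) (sym γ≡β))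
        M = threePointMap (homog α) (homog β) (homog γ) (homog α') (homog β') (homog γ')
        dM = threePointMap-det≢0 I I'
        sends = threePointMap-maps I I'
        sα = Maps₃.m1 sends
        sβ = Maps₃.m2 sends
        sγ = Maps₃.m3 sends
        δM = mapP1 M δ
        image-cr : CrossRatioOf (crossNum α' β' γ' δM) (crossDen α' β' γ' δM) (just x)
        image-cr = subst (λ p → CrossRatioOf (crossNum (proj₁ p) (proj₁ (proj₂ p)) (proj₂ (proj₂ p)) δM) (crossDen (proj₁ p) (proj₁ (proj₂ p)) (proj₂ (proj₂ p)) δM) (just x))
                     (cong₂ _,_ (Sends⇒mapP1 M dM α α' sα) (cong₂ _,_ (Sends⇒mapP1 M dM β β' sβ) (Sends⇒mapP1 M dM γ γ' sγ)))
                     (IsCR⇒CrossRatioOf (mapP1 M α) (mapP1 M β) (mapP1 M γ) δM (just x) (IsCR-mapP1 M dM α β γ δ (just x) (CrossRatioOf⇒IsCR α β γ δ (just x) cr)))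
        δM~δ' : homog δM ~ homog δ'
        δM~δ' = crossRatio-determines x (homog α') (homog β') (homog γ') (homog δM) (homog δ') x≢0 (≢⇒wedge≢0 (proj₁ αβℓ'))
                  (wedge-swap-≢0 (GeneralPosition.d32 I')) (proj₂ image-cr) (proj₂ cr')
        sδ : Sends M δ δ'
        sδ = ~trans (Sends-mapP1 M dM δ) δM~δ' (Nonzero-homog δM)

    open Configuration using (α; β; γ; δ; α'; β'; γ'; δ')

    fromConfiguration : Configuration → Goal
    fromConfiguration C with Configuration.r C in r≡
    ... | nothing = Sum.[ (λ α≡δ → primed C α≡δ r≡) , (λ β≡γ → primed (swapˡ C) β≡γ r≡) ] (wedge-product≡0 {α C} {δ C} {β C} {γ C} (subst (CrossRatioOf _ _) r≡ (Configuration.cr C)))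
      where
      primed : ∀ C → Configuration.α C ≡ Configuration.δ C → Configuration.r C ≡ nothing → Goal
      primed C α≡δ r≡∞ = Sum.[ caseCrossRatio∞ C α≡δ , caseCrossRatio∞ (swapʳ C) α≡δ ] (wedge-product≡0 {α' C} {δ' C} {β' C} {γ' C} (subst (CrossRatioOf _ _) r≡∞ (Configuration.cr' C)))
    ... | just x with x ≟ 0#
    ...   | no x≢0 = caseCrossRatioGeneric C x r≡ x≢0
    ...   | yes refl = Sum.[ (λ α≡γ → primed C α≡γ r≡) , (λ β≡δ → primed (swapˡ C) β≡δ r≡) ] (wedge-product≡0 {α C} {γ C} {β C} {δ C} (numerator≡0 (Configuration.cr C) r≡))
      where
      numerator≡0 : ∀ {n d r} → CrossRatioOf n d r → r ≡ just 0# → n ≡ 0#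
      numerator≡0 (_ , e) refl = trans (sym e) (zeroˡ _)
      primed : ∀ C → Configuration.α C ≡ Configuration.γ C → Configuration.r C ≡ just 0# → Goal
      primed C α≡γ r≡0 = Sum.[ caseCrossRatio0 C α≡γ , caseCrossRatio0 (swapʳ C) α≡γ ] (wedge-product≡0 {α' C} {γ' C} {β' C} {δ' C} (numerator≡0 (Configuration.cr' C) r≡0))

  backward : ∀ ℓ m ℓ' m' → NonTangent S ℓ → NonTangent S m → NonTangent S ℓ' → NonTangent S m' →
             ¬ SameLine S ℓ m → ¬ SameLine S ℓ' m' →
             SameType S ℓ ℓ' × SameType S m m' × SameCR S ℓ m ℓ' m' →
             Σ (GL2 S) (λ g → MapsLine S g ℓ ℓ' × MapsLine S g m m')
  backward ℓ m ℓ' m' (α , β , αβℓ) (γ , δ , γδm) _ _ ℓ≢m ℓ'≢m' (typeℓ , typem , sameCR) = fromPrimed (Equivalence.to (sameCR r) r∈ρ)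
    where
    open Backward ℓ m ℓ' m' ℓ≢m ℓ'≢m'
    d≟0 = crossDen α β γ δ ≟ 0#
    r = crossRatio (crossNum α β γ δ) (crossDen α β γ δ) d≟0
    cr : CrossRatioOf (crossNum α β γ δ) (crossDen α β γ δ) r
    cr = crossRatio-correct (crossNum α β γ δ) (crossDen α β γ δ) d≟0
    r∈ρ : InCR S ℓ m r
    r∈ρ = α , β , γ , δ , αβℓ , γδm , inj₁ (CrossRatioOf⇒IsCR α β γ δ r cr)
    configure : ∀ {α' β' γ' δ'} → Meets S ℓ' α' β' → Meets S m' γ' δ' → CrossRatioOf (crossNum α' β' γ' δ') (crossDen α' β' γ' δ') r → Goal
    configure αβℓ' γδm' cr' = fromConfiguration (record
      { αβℓ = αβℓ ; γδm = γδm ; αβℓ' = αβℓ' ; γδm' = γδm'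
      ; compatibleℓ = SameType⇒compatible typeℓ αβℓ αβℓ' ; compatiblem = SameType⇒compatible typem γδm γδm'
      ; r = r ; cr = cr ; cr' = cr' })
    -- A witness for r⁻¹ is turned into one for r by exchanging the two points of m'.
    fromPrimed : InCR S ℓ' m' r → Goal
    fromPrimed (α' , β' , γ' , δ' , αβℓ' , γδm' , inj₁ c') = configure αβℓ' γδm' (IsCR⇒CrossRatioOf α' β' γ' δ' r c')
    fromPrimed (α' , β' , γ' , δ' , αβℓ' , γδm' , inj₂ (r₀ , c₀ , inverse)) =
      configure αβℓ' (Meets-sym γδm') (CrossRatioOf-inverse r₀ r (IsCR⇒CrossRatioOf α' β' γ' δ' r₀ c₀) inverse (crossRatio-defined {α'} {β'} {γ'} {δ'} (proj₁ αβℓ') (proj₁ γδm')))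

mainTheorem5 : (S : Setup) (ℓ m ℓ' m' : Line S) →
    NonTangent S ℓ → NonTangent S m → NonTangent S ℓ' → NonTangent S m' →
    ¬ SameLine S ℓ m → ¬ SameLine S ℓ' m' →
    (Σ (GL2 S) (λ g → MapsLine S g ℓ ℓ' × MapsLine S g m m'))
      ⇔ (SameType S ℓ ℓ' × SameType S m m' × SameCR S ℓ m ℓ' m')
mainTheorem5 S ℓ m ℓ' m' ntℓ ntm ntℓ' ntm' nsl nsl' =
  mk⇔ (forward ℓ m ℓ' m' ntℓ ntm) (backward ℓ m ℓ' m' ntℓ ntm ntℓ' ntm' nsl nsl')
  where open Conic S
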